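{- Let $q$ be a prime power and $G=\mathrm{GL}_n(\mathbb{F}_q)$. For every $h\in G$, every $\pi\in\mathfrak{S}_n$ and every $1\le i\le n-1$, \[ \mathrm{proj}(hB\cdot T_i)=\mathrm{proj}(hB)\cdot T_i,\qquad \mathrm{incl}(\pi\cdot T_i)=\mathrm{incl}(\pi)\cdot T_i. \]
   Context: $B$ (resp. $B^-$) is the group of invertible upper (resp. lower) triangular matrices. For $\sigma\in\mathfrak{S}_n$ let $P_\sigma$ be the permutation matrix with $1$ in entries $(\sigma_j,j)$ and $[\sigma]$ the set of cosets $gB$ with $g\in B^-P_\sigma B$; these partition $G/B$. On the vector space with basis $G/B$, $T_i$ acts on the right by $(gB)\cdot T_i=gs_iB+\sum_{t\ne0}gf_i(t)B$, where $s_i$ is the permutation matrix swapping columns $i,i+1$ under right multiplication and $f_i(t)$ is the identity plus $t$ in entry $(i+1,i)$. On the vector space with basis $\mathfrak{S}_n$ (one-line notation), $\pi\cdot T_i=q\,\pi s_i$ if $\pi_{i+1}<\pi_i$ and $\pi\cdot T_i=\pi s_i+(q-1)\pi$ if $\pi_{i+1}>\pi_i$, where $\pi s_i$ swaps positions $i,i+1$. The linear maps are $\mathrm{proj}(gB)=\sigma$ for $gB\in[\sigma]$ and $\mathrm{incl}(\pi)=q^{\mathrm{inv}(\pi)}\sum_{gB\in[\pi]}gB$, with $\mathrm{inv}(\pi)=\#\{i<j:\pi_i>\pi_j\}$. -}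

module Defs where

open import Data.Nat as ℕ using (ℕ; zero; suc)
open import Data.Nat.Primality using (Prime)
open import Data.Fin as Fin using (Fin; zero; suc; inject₁)
open import Data.Fin.Properties as FinP using ()
open import Data.Integer as ℤ using (ℤ; +_)
open import Data.List as List using (List; []; _∷_; map; concatMap; length; foldr; allFin; filterᵇ)
open import Data.List.Membership.Propositional using (_∈_)
open import Data.List.Relation.Unary.Unique.Propositional using (Unique)
open import Data.Bool using (Bool; true; false; _∧_; _∨_; not; if_then_else_)
open import Data.Product using (Σ; ∃; ∃-syntax; _×_; _,_)
open import Relation.Nullary.Decidable using (⌊_⌋)
open import Relation.Binary.PropositionalEquality using (_≡_; _≢_)
open import Relation.Binary.Definitions using (DecidableEquality)
open import Algebra.Structures using (IsCommutativeRing)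
import Data.Vec.Functional as VF
open import Data.Bool.ListAction using () renaming (any to anyL; all to allL)

IsPrimePower : ℕ → Set
IsPrimePower q = ∃[ p ] ∃[ k ] (Prime p × q ≡ p ℕ.^ suc k)

record FiniteField (q : ℕ) : Set₁ where
  infixl 6 _+_
  infixl 7 _*_
  field
    Carrier           : Set
    _≟_               : DecidableEquality Carrier
    _+_ _*_           : Carrier → Carrier → Carrier
    -_                : Carrier → Carrier
    0# 1#             : Carrier
    isCommutativeRing : IsCommutativeRing _≡_ _+_ _*_ -_ 0# 1#
    0≢1               : 0# ≢ 1#
    inverse           : ∀ x → x ≢ 0# → ∃[ y ] (x * y ≡ 1#)
    elements          : List Carrier
    complete          : ∀ x → x ∈ elements
    unique            : Unique elements
    card              : length elements ≡ q

allFuns : {A : Set} → List A → (k : ℕ) → List (Fin k → A)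
allFuns xs zero    = (λ ()) ∷ []
allFuns xs (suc k) = concatMap (λ x → map (λ f → x VF.∷ f) (allFuns xs k)) xs

allF : {n : ℕ} → (Fin n → Bool) → Bool
allF {n} p = allL p (allFin n)

anyF : {n : ℕ} → (Fin n → Bool) → Bool
anyF {n} p = anyL p (allFin n)

sumℤ : List ℤ → ℤ
sumℤ = foldr ℤ._+_ (+ 0)

-- Permutations in one-line notation: π : Fin n → Fin n (injective)

-- the adjacent transposition of positions i, i+1 (0-indexed: inject₁ i, suc i)
swap : {m : ℕ} → Fin m → Fin (suc m) → Fin (suc m)
swap i k = if ⌊ k FinP.≟ inject₁ i ⌋ then suc i
           else (if ⌊ k FinP.≟ suc i ⌋ then inject₁ i else k)

isInjective : {n : ℕ} → (Fin n → Fin n) → Bool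
isInjective π = allF λ a → allF λ b → not ⌊ π a FinP.≟ π b ⌋ ∨ ⌊ a FinP.≟ b ⌋

allPerms : (n : ℕ) → List (Fin n → Fin n)
allPerms n = filterᵇ isInjective (allFuns (allFin n) n)

inv : {n : ℕ} → (Fin n → Fin n) → ℕ
inv {n} π = List.length (filterᵇ (λ ab → let a = Data.Product.proj₁ ab ; b = Data.Product.proj₂ ab in
                                           ⌊ a FinP.<? b ⌋ ∧ ⌊ π b FinP.<? π a ⌋)
                                 (List.cartesianProduct (allFin n) (allFin n)))

eqPerm : {n : ℕ} → (Fin n → Fin n) → (Fin n → Fin n) → Bool
eqPerm σ π = allF λ j → ⌊ σ j FinP.≟ π j ⌋

module GLn {q : ℕ} (F : FiniteField q) where
  open FiniteField F

  Mat : ℕ → Set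
  Mat n = Fin n → Fin n → Carrier

  sumF : {n : ℕ} → (Fin n → Carrier) → Carrier
  sumF {n} f = foldr _+_ 0# (map f (allFin n))

  infixl 7 _⊗_
  _⊗_ : {n : ℕ} → Mat n → Mat n → Mat n
  (A ⊗ B) r c = sumF λ k → A r k * B k c

  I : {n : ℕ} → Mat n
  I r c = if ⌊ r FinP.≟ c ⌋ then 1# else 0#

  infix 4 _≈ᴹ_
  _≈ᴹ_ : {n : ℕ} → Mat n → Mat n → Set
  A ≈ᴹ B = ∀ r c → A r c ≡ B r c

  eqMat : {n : ℕ} → Mat n → Mat n → Bool
  eqMat A B = allF λ r → allF λ c → ⌊ A r c ≟ B r c ⌋

  IsInvertible : {n : ℕ} → Mat n → Set
  IsInvertible A = ∃[ A' ] (A ⊗ A' ≈ᴹ I × A' ⊗ A ≈ᴹ I)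

  allMats : (n : ℕ) → List (Mat n)
  allMats n = allFuns (allFuns elements n) n

  isInv : {n : ℕ} → Mat n → Bool
  isInv {n} A = anyL (λ A' → eqMat (A ⊗ A') I ∧ eqMat (A' ⊗ A) I) (allMats n)

  isUpper : {n : ℕ} → Mat n → Bool
  isUpper A = allF λ r → allF λ c → not ⌊ c FinP.<? r ⌋ ∨ ⌊ A r c ≟ 0# ⌋

  isLower : {n : ℕ} → Mat n → Bool
  isLower A = allF λ r → allF λ c → not ⌊ r FinP.<? c ⌋ ∨ ⌊ A r c ≟ 0# ⌋

  inB : {n : ℕ} → Mat n → Bool
  inB b = isUpper b ∧ isInv b

  inB⁻ : {n : ℕ} → Mat n → Bool
  inB⁻ b = isLower b ∧ isInv b

  sameCoset : {n : ℕ} → Mat n → Mat n → Bool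
  sameCoset {n} g x = anyL (λ b → inB b ∧ eqMat (g ⊗ b) x) (allMats n)

  permMat : {n : ℕ} → (Fin n → Fin n) → Mat n
  permMat σ r c = if ⌊ r FinP.≟ σ c ⌋ then 1# else 0#

  inCell : {n : ℕ} → (Fin n → Fin n) → Mat n → Bool
  inCell {n} σ g = anyL (λ l → anyL (λ u →
                     inB⁻ l ∧ inB u ∧ eqMat (l ⊗ permMat σ ⊗ u) g) (allMats n)) (allMats n)

  cosetReps : (n : ℕ) → List (Mat n)
  cosetReps n = foldr (λ g acc → if anyL (sameCoset g) acc then acc else g ∷ acc)
                      [] (filterᵇ isInv (allMats n))

  -- Vectors with basis G/B: formal ℤ-combinations of cosets gB,
  -- compared by their coefficient at each coset.

  VG : ℕ → Set
  VG n = List (ℤ × Mat n)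

  coeffG : {n : ℕ} → VG n → Mat n → ℤ
  coeffG L x = sumℤ (map (λ ag → if sameCoset (Data.Product.proj₂ ag) x
                                  then Data.Product.proj₁ ag else + 0) L)

  infix 4 _≈G_
  _≈G_ : {n : ℕ} → VG n → VG n → Set
  L ≈G L' = ∀ x → IsInvertible x → coeffG L x ≡ coeffG L' x

  sMat : {m : ℕ} → Fin m → Mat (suc m)
  sMat i = permMat (swap i)

  fMat : {m : ℕ} → Fin m → Carrier → Mat (suc m)
  fMat i t r c = if ⌊ r FinP.≟ suc i ⌋ ∧ ⌊ c FinP.≟ inject₁ i ⌋ then t else I r c

  nonzeroElems : List Carrier
  nonzeroElems = filterᵇ (λ t → not ⌊ t ≟ 0# ⌋) elements

  TG : {m : ℕ} → Fin m → VG (suc m) → VG (suc m)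
  TG i = concatMap (λ ag → let a = Data.Product.proj₁ ag ; g = Data.Product.proj₂ ag in
           (a , g ⊗ sMat i) ∷ map (λ t → (a , g ⊗ fMat i t)) nonzeroElems)

  VS : ℕ → Set
  VS n = List (ℤ × (Fin n → Fin n))

  coeffS : {n : ℕ} → VS n → (Fin n → Fin n) → ℤ
  coeffS L π = sumℤ (map (λ aσ → if eqPerm (Data.Product.proj₂ aσ) π
                                  then Data.Product.proj₁ aσ else + 0) L)

  infix 4 _≈S_
  _≈S_ : {n : ℕ} → VS n → VS n → Set
  L ≈S L' = ∀ π → coeffS L π ≡ coeffS L' π

  TS : {m : ℕ} → Fin m → VS (suc m) → VS (suc m)
  TS i = concatMap (λ aπ → let a = Data.Product.proj₁ aπ ; π = Data.Product.proj₂ aπ in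
           if ⌊ π (suc i) FinP.<? π (inject₁ i) ⌋
           then (a ℤ.* + q , (λ k → π (swap i k))) ∷ []
           else (a , (λ k → π (swap i k))) ∷ (a ℤ.* (+ q ℤ.- + 1) , π) ∷ [])

  proj : {n : ℕ} → VG n → VS n
  proj {n} = concatMap (λ ag → map (λ σ → (Data.Product.proj₁ ag , σ))
                                    (filterᵇ (λ σ → inCell σ (Data.Product.proj₂ ag)) (allPerms n)))

  incl : {n : ℕ} → VS n → VG n
  incl {n} = concatMap (λ aπ → map (λ g → (Data.Product.proj₁ aπ ℤ.* (+ q) ℤ.^ inv (Data.Product.proj₂ aπ) , g))
                                    (filterᵇ (inCell (Data.Product.proj₂ aπ)) (cosetReps n)))

-- For a ∈ F put u(a) = I + a·e(i,i+1) and Y(a) = u(a)·sᵢ. Since Y(0) = sᵢ and fᵢ(t)B = Y(1/t)B, the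
-- action is gB·Tᵢ = Σₐ gY(a)B, and everything reduces to the count N(g, π) = #{a : gY(a)B ∈ [π]}.
-- If g = l·P_σ·u ∈ [σ], then u·Y(a)B = Y(φ a)B for an affine bijection φ of F, and
-- P_σ·Y(a) = (I + a·e(σ i, σ(i+1)))·P_{σsᵢ}: at a descent of σ this lies in [σsᵢ] for every a, at an
-- ascent in [σsᵢ] for a = 0 and in [σ] for a ≠ 0. So N(g, π) is the coefficient of π in σ·Tᵢ, which is
-- the claim for proj.
-- For incl, a representative g ∈ [π] with gY(a)B = xB determines a, and such an a exists iff
-- xY(a′)B = gB for some a′; hence the coefficient of xB in incl(π)·Tᵢ is q^inv(π)·N(x, π). For x ∈ [σ]
-- it remains to check q^inv(π)·c(σ, π) = c(π, σ)·q^inv(σ) for the coefficients c of Tᵢ, which follows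
-- from inv(π) = inv(πsᵢ) + 1 at a descent of π.

module Submission where

open import Data.Nat as ℕ using (ℕ; zero; suc)
import Data.Nat.Properties as ℕP
open import Data.Fin as Fin using (Fin; zero; suc; inject₁; toℕ; _<_; _≤_; _<?_; _≟_)
import Data.Fin.Properties as FinP
open import Data.Fin.Induction using (<-wellFounded; >-wellFounded)
open import Induction.WellFounded using (Acc; acc)
open import Data.Integer as ℤ using (ℤ; +_) renaming (_+_ to _+ᶻ_; _*_ to _*ᶻ_; _-_ to _-ᶻ_)
import Data.Integer.Properties as ℤP
open import Data.Integer.Tactic.RingSolver using (solve-∀)
open import Data.List using (List; []; _∷_; _++_; map; concatMap; length; foldr; filterᵇ; allFin; cartesianProduct)
import Data.List.Properties as ListP
open import Data.List.Membership.Propositional using (_∈_)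
import Data.List.Membership.Propositional.Properties as ∈P
open import Data.List.Membership.Propositional.Properties.WithK using (unique∧set⇒bag)
open import Data.List.Relation.Binary.BagAndSetEquality using (∼bag⇒↭)
open import Data.List.Relation.Binary.Permutation.Propositional as ↭ using (_↭_)
open import Data.List.Relation.Unary.Any using (here; there)
import Data.List.Relation.Unary.Any as Any
import Data.List.Relation.Unary.All as All
open import Data.List.Relation.Unary.AllPairs using (_∷_)
open import Data.List.Relation.Unary.Unique.Propositional using (Unique)
import Data.List.Relation.Unary.Unique.Propositional.Properties as Unique
import Data.Vec.Functional as VF
open import Data.Bool using (Bool; true; false; if_then_else_; _∧_; _∨_; not; T?)
open import Data.Bool.ListAction using () renaming (any to anyᵇ; all to allᵇ)
open import Data.Product using (∃-syntax; _×_; _,_; proj₁; proj₂; map₁)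
import Data.Product.Properties as ×P
open import Data.Sum using (_⊎_; inj₁; inj₂)
open import Data.Empty using (⊥; ⊥-elim)
open import Relation.Nullary using (¬_; Dec; yes; no; contradiction)
open import Relation.Nullary.Decidable using (⌊_⌋)
open import Relation.Binary.PropositionalEquality
open import Relation.Binary.Definitions using (DecidableEquality; tri<; tri≈; tri>)
open import Relation.Binary.Structures using (IsEquivalence)
open import Relation.Binary.Bundles using (Setoid)
import Relation.Binary.Reasoning.Setoid as SetoidReasoning
open import Function using (_∘_; _∘′_; id; mk⇔)
open import Function.Definitions using (Injective)
open import Algebra.Bundles using (CommutativeRing)
import Algebra.Properties.Ring as RingProperties
import Algebra.Properties.CommutativeSemigroup as CommutativeSemigroupProperties
open CommutativeSemigroupProperties ℤP.+-commutativeSemigroup using () renaming (interchange to +ᶻ-interchange)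
open import Defs

module _ {P : Set} where

  isYes-true : (d : Dec P) → P → ⌊ d ⌋ ≡ true
  isYes-true (yes _) _ = refl
  isYes-true (no ¬p) p = contradiction p ¬p

  isYes-false : (d : Dec P) → ¬ P → ⌊ d ⌋ ≡ false
  isYes-false (yes p) ¬p = contradiction p ¬p
  isYes-false (no _)  _  = refl

  isYes-true⁻ : (d : Dec P) → ⌊ d ⌋ ≡ true → P
  isYes-true⁻ (yes p) _ = p

⇔-true⇒≡ : {b c : Bool} → (b ≡ true → c ≡ true) → (c ≡ true → b ≡ true) → b ≡ c
⇔-true⇒≡ {true}  {true}  _ _ = refl
⇔-true⇒≡ {true}  {false} f _ = sym (f refl)
⇔-true⇒≡ {false} {true}  _ g = g refl
⇔-true⇒≡ {false} {false} _ _ = refl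

≢true⇒≡false : {b : Bool} → ¬ (b ≡ true) → b ≡ false
≢true⇒≡false {true}  b≢true = contradiction refl b≢true
≢true⇒≡false {false} _      = refl

∧-true⁻ : {a b : Bool} → a ∧ b ≡ true → a ≡ true × b ≡ true
∧-true⁻ {true} {true} _ = refl , refl

∧-true⁺ : {a b : Bool} → a ≡ true → b ≡ true → a ∧ b ≡ true
∧-true⁺ refl refl = refl

∨-true⁻ : {a b : Bool} → a ∨ b ≡ true → a ≡ true ⊎ b ≡ true
∨-true⁻ {true}  _ = inj₁ refl
∨-true⁻ {false} e = inj₂ e

module _ {A : Set} (p : A → Bool) where

  allᵇ-true⁻ : ∀ xs → allᵇ p xs ≡ true → ∀ {x} → x ∈ xs → p x ≡ true
  allᵇ-true⁻ (y ∷ xs) e (here refl) = proj₁ (∧-true⁻ e)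
  allᵇ-true⁻ (y ∷ xs) e (there m)   = allᵇ-true⁻ xs (proj₂ (∧-true⁻ {p y} e)) m

  allᵇ-true⁺ : ∀ xs → (∀ {x} → x ∈ xs → p x ≡ true) → allᵇ p xs ≡ true
  allᵇ-true⁺ []       _ = refl
  allᵇ-true⁺ (y ∷ xs) f = ∧-true⁺ (f (here refl)) (allᵇ-true⁺ xs (f ∘ there))

  anyᵇ-true⁻ : ∀ xs → anyᵇ p xs ≡ true → ∃[ x ] (x ∈ xs × p x ≡ true)
  anyᵇ-true⁻ (y ∷ xs) e with p y in py
  ... | true = y , here refl , py
  ... | false with anyᵇ-true⁻ xs e
  ...   | x , m , px = x , there m , px

  anyᵇ-true⁺ : ∀ {xs x} → x ∈ xs → p x ≡ true → anyᵇ p xs ≡ true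
  anyᵇ-true⁺ {y ∷ xs} (here refl) px rewrite px = refl
  anyᵇ-true⁺ {y ∷ xs} (there m)   px with p y
  ... | true  = refl
  ... | false = anyᵇ-true⁺ m px

  anyᵇ-false⁻ : ∀ xs → anyᵇ p xs ≡ false → ∀ {x} → x ∈ xs → p x ≡ false
  anyᵇ-false⁻ xs e m = ≢true⇒≡false (λ px → false≢true (trans (sym e) (anyᵇ-true⁺ m px)))
    where
    false≢true : false ≢ true
    false≢true ()

  ∈-filterᵇ⁻ : ∀ {xs x} → x ∈ filterᵇ p xs → x ∈ xs × p x ≡ true
  ∈-filterᵇ⁻ {y ∷ xs} m with p y in py
  ∈-filterᵇ⁻ {y ∷ xs} (here refl) | true = here refl , py
  ∈-filterᵇ⁻ {y ∷ xs} (there m)   | true = map₁ there (∈-filterᵇ⁻ m)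
  ∈-filterᵇ⁻ {y ∷ xs} m           | false = map₁ there (∈-filterᵇ⁻ m)

  ∈-filterᵇ⁺ : ∀ {xs x} → x ∈ xs → p x ≡ true → x ∈ filterᵇ p xs
  ∈-filterᵇ⁺ {y ∷ xs} (here refl) px rewrite px = here refl
  ∈-filterᵇ⁺ {y ∷ xs} (there m)   px with p y
  ... | true  = there (∈-filterᵇ⁺ m px)
  ... | false = ∈-filterᵇ⁺ m px

module _ {n : ℕ} where

  allF-true⁻ : (p : Fin n → Bool) → allF p ≡ true → ∀ j → p j ≡ true
  allF-true⁻ p e j = allᵇ-true⁻ p (allFin n) e (∈P.∈-allFin j)

  allF-true⁺ : (p : Fin n → Bool) → (∀ j → p j ≡ true) → allF p ≡ true
  allF-true⁺ p f = allᵇ-true⁺ p (allFin n) (λ {x} _ → f x)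

  allF-cong : {p p′ : Fin n → Bool} → (∀ j → p j ≡ p′ j) → allF p ≡ allF p′
  allF-cong e = cong (foldr _∧_ true) (ListP.map-cong e (allFin n))

allF-suc : ∀ {k} (p : Fin (suc k) → Bool) → allF p ≡ p zero ∧ allF (p ∘ suc)
allF-suc p = cong (λ l → p zero ∧ foldr _∧_ true l)
                  (trans (ListP.map-tabulate suc p) (sym (ListP.map-tabulate id (p ∘ suc))))

∑ : {A : Set} → List A → (A → ℤ) → ℤ
∑ xs f = sumℤ (map f xs)

𝟙 : Bool → ℤ
𝟙 b = if b then + 1 else + 0

𝟙-∧ : ∀ a b → 𝟙 (a ∧ b) ≡ 𝟙 a *ᶻ 𝟙 b
𝟙-∧ true  b = sym (ℤP.*-identityˡ (𝟙 b))
𝟙-∧ false b = refl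

if-then-0 : ∀ b (a : ℤ) → (if b then a else + 0) ≡ a *ᶻ 𝟙 b
if-then-0 true  a = sym (ℤP.*-identityʳ a)
if-then-0 false a = sym (ℤP.*-zeroʳ a)

module _ {A : Set} where

  ∑-++ : (xs ys : List A) (f : A → ℤ) → ∑ (xs ++ ys) f ≡ ∑ xs f +ᶻ ∑ ys f
  ∑-++ []       ys f = sym (ℤP.+-identityˡ _)
  ∑-++ (x ∷ xs) ys f = trans (cong (f x +ᶻ_) (∑-++ xs ys f)) (sym (ℤP.+-assoc (f x) _ _))

  ∑-cong-∈ : (xs : List A) {f g : A → ℤ} → (∀ {a} → a ∈ xs → f a ≡ g a) → ∑ xs f ≡ ∑ xs g
  ∑-cong-∈ []       eq = refl
  ∑-cong-∈ (x ∷ xs) eq = cong₂ _+ᶻ_ (eq (here refl)) (∑-cong-∈ xs (eq ∘ there))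

  ∑-cong : (xs : List A) {f g : A → ℤ} → (∀ a → f a ≡ g a) → ∑ xs f ≡ ∑ xs g
  ∑-cong xs eq = ∑-cong-∈ xs (λ {a} _ → eq a)

  ∑-zero : (xs : List A) (f : A → ℤ) → (∀ {a} → a ∈ xs → f a ≡ + 0) → ∑ xs f ≡ + 0
  ∑-zero []       f eq = refl
  ∑-zero (x ∷ xs) f eq = cong₂ _+ᶻ_ (eq (here refl)) (∑-zero xs f (eq ∘ there))

  ∑-+ : (xs : List A) (f g : A → ℤ) → ∑ xs (λ a → f a +ᶻ g a) ≡ ∑ xs f +ᶻ ∑ xs g
  ∑-+ []       f g = refl
  ∑-+ (x ∷ xs) f g = trans (cong (f x +ᶻ g x +ᶻ_) (∑-+ xs f g)) (+ᶻ-interchange (f x) (g x) _ _)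

  ∑-*ˡ : (xs : List A) (c : ℤ) (f : A → ℤ) → ∑ xs (λ a → c *ᶻ f a) ≡ c *ᶻ ∑ xs f
  ∑-*ˡ []       c f = sym (ℤP.*-zeroʳ c)
  ∑-*ˡ (x ∷ xs) c f = trans (cong (c *ᶻ f x +ᶻ_) (∑-*ˡ xs c f)) (sym (ℤP.*-distribˡ-+ c (f x) _))

  ∑-*ʳ : (xs : List A) (c : ℤ) (f : A → ℤ) → ∑ xs (λ a → f a *ᶻ c) ≡ ∑ xs f *ᶻ c
  ∑-*ʳ xs c f = trans (∑-cong xs (λ a → ℤP.*-comm (f a) c)) (trans (∑-*ˡ xs c f) (ℤP.*-comm c _))

  ∑-const : (xs : List A) (c : ℤ) → ∑ xs (λ _ → c) ≡ + length xs *ᶻ c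
  ∑-const []       c = sym (ℤP.*-zeroˡ c)
  ∑-const (x ∷ xs) c = begin
    c +ᶻ ∑ xs (λ _ → c)          ≡⟨ cong₂ _+ᶻ_ (sym (ℤP.*-identityˡ c)) (∑-const xs c) ⟩
    + 1 *ᶻ c +ᶻ + length xs *ᶻ c ≡⟨ sym (ℤP.*-distribʳ-+ c (+ 1) (+ length xs)) ⟩
    + suc (length xs) *ᶻ c       ∎
    where open ≡-Reasoning

  ∑-↭ : {xs ys : List A} (f : A → ℤ) → xs ↭ ys → ∑ xs f ≡ ∑ ys f
  ∑-↭ f ↭.refl          = refl
  ∑-↭ f (↭.prep x p)    = cong (f x +ᶻ_) (∑-↭ f p)
  ∑-↭ f (↭.swap x y p)  = begin
    f x +ᶻ (f y +ᶻ _)  ≡⟨ sym (ℤP.+-assoc (f x) (f y) _) ⟩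
    f x +ᶻ f y +ᶻ _    ≡⟨ cong₂ _+ᶻ_ (ℤP.+-comm (f x) (f y)) (∑-↭ f p) ⟩
    f y +ᶻ f x +ᶻ _    ≡⟨ ℤP.+-assoc (f y) (f x) _ ⟩
    f y +ᶻ (f x +ᶻ _)  ∎
    where open ≡-Reasoning
  ∑-↭ f (↭.trans p q)   = trans (∑-↭ f p) (∑-↭ f q)

  ∑-filter : (p : A → Bool) (xs : List A) (f : A → ℤ) →
             ∑ (filterᵇ p xs) f ≡ ∑ xs (λ a → if p a then f a else + 0)
  ∑-filter p []       f = refl
  ∑-filter p (x ∷ xs) f with p x
  ... | true  = cong (f x +ᶻ_) (∑-filter p xs f)
  ... | false = trans (∑-filter p xs f) (sym (ℤP.+-identityˡ _))

  length-filter : (p : A → Bool) (xs : List A) → + length (filterᵇ p xs) ≡ ∑ xs (𝟙 ∘ p)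
  length-filter p []       = refl
  length-filter p (x ∷ xs) with p x
  ... | true  = cong (+ 1 +ᶻ_) (length-filter p xs)
  ... | false = trans (length-filter p xs) (sym (ℤP.+-identityˡ _))

  ∑-single : (xs : List A) (f : A → ℤ) {a : A} → Unique xs → a ∈ xs →
             (∀ {x} → x ∈ xs → x ≢ a → f x ≡ + 0) → ∑ xs f ≡ f a
  ∑-single (x ∷ xs) f (x∉xs ∷ _) (here refl) off =
    trans (cong (f x +ᶻ_) (∑-zero xs f (λ m → off (there m) (λ e → All.lookup x∉xs m (sym e)))))
          (ℤP.+-identityʳ _)
  ∑-single (x ∷ xs) f (x∉xs ∷ u) (there m) off =
    trans (cong₂ _+ᶻ_ (off (here refl) (λ e → All.lookup x∉xs m e)) (∑-single xs f u m (off ∘ there)))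
          (ℤP.+-identityˡ _)

  ∑-reindex : {xs ys : List A} (f : A → ℤ) → Unique xs → Unique ys →
              (∀ {y} → y ∈ xs → y ∈ ys) → (∀ {y} → y ∈ ys → y ∈ xs) → ∑ xs f ≡ ∑ ys f
  ∑-reindex f ux uy to from = ∑-↭ f (∼bag⇒↭ (unique∧set⇒bag ux uy (mk⇔ to from)))

  ∑-𝟙-atMostOne : (xs : List A) (p : A → Bool) → Unique xs →
    (∀ {x y} → x ∈ xs → y ∈ xs → p x ≡ true → p y ≡ true → x ≡ y) →
    ∑ xs (𝟙 ∘ p) ≡ 𝟙 (anyᵇ p xs)
  ∑-𝟙-atMostOne xs p u unique with anyᵇ p xs in eq
  ... | false = ∑-zero xs _ (λ m → cong 𝟙 (anyᵇ-false⁻ p xs eq m))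
  ... | true with anyᵇ-true⁻ p xs eq
  ... | a , a∈xs , pa = trans (∑-single xs _ u a∈xs off) (cong 𝟙 pa)
    where
    off : ∀ {x} → x ∈ xs → x ≢ a → 𝟙 (p x) ≡ + 0
    off {x} x∈xs x≢a with p x in px
    ... | false = refl
    ... | true  = contradiction (unique x∈xs a∈xs px pa) x≢a

  ∑-pair : (_≟_ : DecidableEquality A) (xs : List A) (f : A → ℤ) {a b : A} → Unique xs →
           a ∈ xs → b ∈ xs → a ≢ b → (∀ {x} → x ∈ xs → x ≢ a → x ≢ b → f x ≡ + 0) →
           ∑ xs f ≡ f a +ᶻ f b
  ∑-pair _≟_ xs f {a} {b} u a∈xs b∈xs a≢b off =
    trans (∑-cong xs split) (trans (∑-+ xs fa fb) (cong₂ _+ᶻ_ sum-fa sum-fb))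
    where
    fa fb : A → ℤ
    fa x = if ⌊ x ≟ a ⌋ then f x else + 0
    fb x = if ⌊ x ≟ a ⌋ then + 0 else f x
    split : ∀ x → f x ≡ fa x +ᶻ fb x
    split x with x ≟ a
    ... | yes _ = sym (ℤP.+-identityʳ (f x))
    ... | no  _ = sym (ℤP.+-identityˡ (f x))
    fa-off : ∀ {x} → x ∈ xs → x ≢ a → fa x ≡ + 0
    fa-off {x} _ x≢a with x ≟ a
    ... | yes x≡a = contradiction x≡a x≢a
    ... | no  _   = refl
    fb-off : ∀ {x} → x ∈ xs → x ≢ b → fb x ≡ + 0
    fb-off {x} x∈xs x≢b with x ≟ a
    ... | yes _   = refl
    ... | no  x≢a = off x∈xs x≢a x≢b
    fa-at : fa a ≡ f a
    fa-at with a ≟ a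
    ... | yes _   = refl
    ... | no  a≢a = contradiction refl a≢a
    fb-at : fb b ≡ f b
    fb-at with b ≟ a
    ... | yes b≡a = contradiction (sym b≡a) a≢b
    ... | no  _   = refl
    sum-fa : ∑ xs fa ≡ f a
    sum-fa = trans (∑-single xs fa u a∈xs fa-off) fa-at
    sum-fb : ∑ xs fb ≡ f b
    sum-fb = trans (∑-single xs fb u b∈xs fb-off) fb-at

module _ {A B : Set} where

  ∑-map : (h : A → B) (xs : List A) (f : B → ℤ) → ∑ (map h xs) f ≡ ∑ xs (f ∘ h)
  ∑-map h []       f = refl
  ∑-map h (x ∷ xs) f = cong (f (h x) +ᶻ_) (∑-map h xs f)

  ∑-concatMap : (g : A → List B) (xs : List A) (f : B → ℤ) →
                ∑ (concatMap g xs) f ≡ ∑ xs (λ a → ∑ (g a) f)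
  ∑-concatMap g []       f = refl
  ∑-concatMap g (x ∷ xs) f =
    trans (∑-++ (g x) (concatMap g xs) f) (cong (∑ (g x) f +ᶻ_) (∑-concatMap g xs f))

  ∑-comm : (xs : List A) (ys : List B) (f : A → B → ℤ) →
           ∑ xs (λ a → ∑ ys (f a)) ≡ ∑ ys (λ b → ∑ xs (λ a → f a b))
  ∑-comm []       ys f = sym (∑-zero ys _ (λ _ → refl))
  ∑-comm (x ∷ xs) ys f =
    trans (cong (∑ ys (f x) +ᶻ_) (∑-comm xs ys f)) (sym (∑-+ ys (f x) (λ b → ∑ xs (λ a → f a b))))

∑-bijection : {A : Set} (xs : List A) (φ ψ : A → A) (f : A → ℤ) → Unique xs →
              (∀ x → x ∈ xs) → (∀ x → φ (ψ x) ≡ x) → (∀ x → ψ (φ x) ≡ x) →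
              ∑ xs (f ∘ φ) ≡ ∑ xs f
∑-bijection xs φ ψ f u complete φψ ψφ =
  trans (sym (∑-map φ xs f)) (∑-reindex f (Unique.map⁺ φ-injective u) u (λ {y} _ → complete y) onto)
  where
  φ-injective : ∀ {x y} → φ x ≡ φ y → x ≡ y
  φ-injective {x} {y} e = trans (sym (ψφ x)) (trans (cong ψ e) (ψφ y))
  onto : ∀ {y} → y ∈ xs → y ∈ map φ xs
  onto {y} _ = subst (_∈ map φ xs) (φψ y) (∈P.∈-map⁺ φ (complete (ψ y)))

∑-map-filter : {A : Set} (c : ℤ) (p : A → Bool) (xs : List A) (G : A → ℤ) →
               ∑ (map (c ,_) (filterᵇ p xs)) (λ ((a , y) : ℤ × A) → a *ᶻ G y)
               ≡ c *ᶻ ∑ xs (λ y → if p y then G y else + 0)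
∑-map-filter c p xs G = begin
  ∑ (map (c ,_) (filterᵇ p xs)) (λ (a , y) → a *ᶻ G y)
    ≡⟨ ∑-map (c ,_) (filterᵇ p xs) (λ (a , y) → a *ᶻ G y) ⟩
  ∑ (filterᵇ p xs) (λ y → c *ᶻ G y)
    ≡⟨ ∑-filter p xs (λ y → c *ᶻ G y) ⟩
  ∑ xs (λ y → if p y then c *ᶻ G y else + 0)
    ≡⟨ ∑-cong xs (λ y → pull (p y) (G y)) ⟩
  ∑ xs (λ y → c *ᶻ (if p y then G y else + 0))
    ≡⟨ ∑-*ˡ xs c (λ y → if p y then G y else + 0) ⟩
  c *ᶻ ∑ xs (λ y → if p y then G y else + 0) ∎
  where
  open ≡-Reasoning
  pull : ∀ b x → (if b then c *ᶻ x else + 0) ≡ c *ᶻ (if b then x else + 0)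
  pull true  x = refl
  pull false x = sym (ℤP.*-zeroʳ c)

module _ {m : ℕ} (i : Fin m) where

  inject₁≢suc : inject₁ i ≢ suc i
  inject₁≢suc e = ℕP.1+n≢n (sym (trans (sym (FinP.toℕ-inject₁ i)) (cong toℕ e)))

  inject₁<suc : inject₁ i < suc i
  inject₁<suc = FinP.≤̄⇒inject₁< FinP.≤-refl

  swap-inject₁ : swap i (inject₁ i) ≡ suc i
  swap-inject₁ rewrite isYes-true (inject₁ i ≟ inject₁ i) refl = refl

  swap-suc : swap i (suc i) ≡ inject₁ i
  swap-suc rewrite isYes-false (suc i ≟ inject₁ i) (inject₁≢suc ∘ sym)
                 | isYes-true (suc i ≟ suc i) refl = refl

  swap-other : ∀ {k} → k ≢ inject₁ i → k ≢ suc i → swap i k ≡ k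
  swap-other {k} k≢i k≢s rewrite isYes-false (k ≟ inject₁ i) k≢i | isYes-false (k ≟ suc i) k≢s = refl

  data SwapView (k : Fin (suc m)) : Set where
    at-inject₁ : k ≡ inject₁ i → SwapView k
    at-suc     : k ≡ suc i → SwapView k
    elsewhere  : k ≢ inject₁ i → k ≢ suc i → SwapView k

  swapView : ∀ k → SwapView k
  swapView k with k ≟ inject₁ i | k ≟ suc i
  ... | yes e   | _       = at-inject₁ e
  ... | no _    | yes e   = at-suc e
  ... | no k≢i  | no k≢s  = elsewhere k≢i k≢s

  swap-involutive : ∀ k → swap i (swap i k) ≡ k
  swap-involutive k with swapView k
  ... | at-inject₁ refl = trans (cong (swap i) swap-inject₁) swap-suc
  ... | at-suc refl     = trans (cong (swap i) swap-suc) swap-inject₁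
  ... | elsewhere k≢i k≢s = trans (cong (swap i) (swap-other k≢i k≢s)) (swap-other k≢i k≢s)

  swap-injective : Injective _≡_ _≡_ (swap i)
  swap-injective {k} {l} e = trans (sym (swap-involutive k)) (trans (cong (swap i) e) (swap-involutive l))

  ∘swap-injective : {σ : Fin (suc m) → Fin (suc m)} → Injective _≡_ _≡_ σ → Injective _≡_ _≡_ (σ ∘ swap i)
  ∘swap-injective σ-inj = swap-injective ∘ σ-inj

  private
    toℕ-suc : toℕ (suc i) ≡ suc (toℕ (inject₁ i))
    toℕ-suc = cong suc (sym (FinP.toℕ-inject₁ i))

  inject₁<⇒suc< : ∀ {k} → k ≢ suc i → inject₁ i < k → suc i < k
  inject₁<⇒suc< {k} k≢s lt = FinP.≤∧≢⇒< (subst (ℕ._≤ toℕ k) (sym toℕ-suc) lt) (k≢s ∘ sym)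

  <suc⇒<inject₁ : ∀ {k} → k ≢ inject₁ i → k < suc i → k < inject₁ i
  <suc⇒<inject₁ {k} k≢i lt = FinP.≤∧≢⇒< (ℕP.≤-pred (subst (toℕ k ℕ.<_) toℕ-suc lt)) k≢i

  swap-reflects-< : ∀ a b → (a , b) ≢ (inject₁ i , suc i) → (a , b) ≢ (suc i , inject₁ i) →
                    (swap i a < swap i b → a < b) × (a < b → swap i a < swap i b)
  swap-reflects-< a b ab≢is ab≢si with swapView a | swapView b
  ... | at-inject₁ refl | at-inject₁ refl = ⊥-elim ∘ FinP.<-irrefl refl , ⊥-elim ∘ FinP.<-irrefl refl
  ... | at-inject₁ refl | at-suc refl = contradiction refl ab≢is
  ... | at-inject₁ refl | elsewhere b≢i b≢s rewrite swap-inject₁ | swap-other b≢i b≢s =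
        FinP.<-trans inject₁<suc , inject₁<⇒suc< b≢s
  ... | at-suc refl | at-inject₁ refl = contradiction refl ab≢si
  ... | at-suc refl | at-suc refl = ⊥-elim ∘ FinP.<-irrefl refl , ⊥-elim ∘ FinP.<-irrefl refl
  ... | at-suc refl | elsewhere b≢i b≢s rewrite swap-suc | swap-other b≢i b≢s =
        inject₁<⇒suc< b≢s , FinP.<-trans inject₁<suc
  ... | elsewhere a≢i a≢s | at-inject₁ refl rewrite swap-inject₁ | swap-other a≢i a≢s =
        <suc⇒<inject₁ a≢i , (λ lt → FinP.<-trans lt inject₁<suc)
  ... | elsewhere a≢i a≢s | at-suc refl rewrite swap-suc | swap-other a≢i a≢s =
        (λ lt → FinP.<-trans lt inject₁<suc) , <suc⇒<inject₁ a≢i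
  ... | elsewhere a≢i a≢s | elsewhere b≢i b≢s rewrite swap-other a≢i a≢s | swap-other b≢i b≢s = id , id

module _ {n : ℕ} where

  eqPerm-sound : {σ π : Fin n → Fin n} → eqPerm σ π ≡ true → σ ≗ π
  eqPerm-sound {σ} {π} e j = isYes-true⁻ (σ j ≟ π j) (allF-true⁻ _ e j)

  eqPerm-complete : {σ π : Fin n → Fin n} → σ ≗ π → eqPerm σ π ≡ true
  eqPerm-complete {σ} {π} e = allF-true⁺ _ (λ j → isYes-true (σ j ≟ π j) (e j))

  eqPerm-comm : (σ π : Fin n → Fin n) → eqPerm σ π ≡ eqPerm π σ
  eqPerm-comm σ π = ⇔-true⇒≡ (λ e → eqPerm-complete (sym ∘ eqPerm-sound e))
                             (λ e → eqPerm-complete (sym ∘ eqPerm-sound e))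

  eqPerm-cong : {σ σ′ π π′ : Fin n → Fin n} → σ ≗ σ′ → π ≗ π′ → eqPerm σ π ≡ eqPerm σ′ π′
  eqPerm-cong e e′ = allF-cong (λ j → cong₂ (λ x y → ⌊ x ≟ y ⌋) (e j) (e′ j))

  isInjective-sound : {π : Fin n → Fin n} → isInjective π ≡ true → Injective _≡_ _≡_ π
  isInjective-sound {π} e {a} {b} πa≡πb with ∨-true⁻ (allF-true⁻ _ (allF-true⁻ _ e a) b)
  ... | inj₂ a≟b   = isYes-true⁻ (a ≟ b) a≟b
  ... | inj₁ ¬πa≟πb = contradiction (isYes-true (π a ≟ π b) πa≡πb) (λ t → case t ¬πa≟πb)
    where
    case : ∀ {x} → x ≡ true → not x ≡ true → ⊥
    case refl ()

  isInjective-complete : {π : Fin n → Fin n} → Injective _≡_ _≡_ π → isInjective π ≡ true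
  isInjective-complete {π} π-inj = allF-true⁺ _ (λ a → allF-true⁺ _ (λ b → pair a b))
    where
    pair : ∀ a b → not ⌊ π a ≟ π b ⌋ ∨ ⌊ a ≟ b ⌋ ≡ true
    pair a b with π a ≟ π b | a ≟ b
    ... | yes e | no a≢b = contradiction (π-inj e) a≢b
    ... | yes _ | yes _  = refl
    ... | no _  | _      = refl

  isInjective-cong : {σ σ′ : Fin n → Fin n} → σ ≗ σ′ → isInjective σ ≡ isInjective σ′
  isInjective-cong e = allF-cong (λ a → allF-cong (λ b → cong₂ (λ x y → not ⌊ x ≟ y ⌋ ∨ _) (e a) (e b)))

module _ {A : Set} (xs : List A) where

  allFuns-complete : (R : A → A → Set) → ∀ k (f : Fin k → A) → (∀ j → ∃[ x ] (x ∈ xs × R x (f j))) →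
                     ∃[ g ] (g ∈ allFuns xs k × ∀ j → R (g j) (f j))
  allFuns-complete R zero    f near = (λ ()) , here refl , (λ ())
  allFuns-complete R (suc k) f near with near zero | allFuns-complete R k (f ∘ suc) (near ∘ suc)
  ... | x , x∈xs , Rx | g , g∈ , Rg = (x VF.∷ g) , member , related
    where
    member : (x VF.∷ g) ∈ allFuns xs (suc k)
    member = ∈P.∈-concatMap⁺ (λ y → map (y VF.∷_) (allFuns xs k))
               (Any.map (λ { refl → ∈P.∈-map⁺ (x VF.∷_) g∈ }) x∈xs)
    related : ∀ j → R ((x VF.∷ g) j) (f j)
    related zero    = Rx
    related (suc j) = Rg j

  allFuns-count : (eq : A → A → Bool) → (∀ a → ∑ xs (λ x → 𝟙 (eq x a)) ≡ + 1) →
                  ∀ k (f : Fin k → A) → ∑ (allFuns xs k) (λ g → 𝟙 (allF (λ j → eq (g j) (f j)))) ≡ + 1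
  allFuns-count eq count zero    f = refl
  allFuns-count eq count (suc k) f = begin
    ∑ (allFuns xs (suc k)) G
      ≡⟨ ∑-concatMap (λ x → map (x VF.∷_) (allFuns xs k)) xs G ⟩
    ∑ xs (λ x → ∑ (map (x VF.∷_) (allFuns xs k)) G)
      ≡⟨ ∑-cong xs (λ x → ∑-map (x VF.∷_) (allFuns xs k) G) ⟩
    ∑ xs (λ x → ∑ (allFuns xs k) (λ g → G (x VF.∷ g)))
      ≡⟨ ∑-cong xs (λ x → ∑-cong (allFuns xs k) (λ g → head-and-tail x g)) ⟩
    ∑ xs (λ x → ∑ (allFuns xs k) (λ g → 𝟙 (eq x (f zero)) *ᶻ H g))
      ≡⟨ ∑-cong xs (λ x → ∑-*ˡ (allFuns xs k) (𝟙 (eq x (f zero))) H) ⟩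
    ∑ xs (λ x → 𝟙 (eq x (f zero)) *ᶻ ∑ (allFuns xs k) H)
      ≡⟨ ∑-cong xs (λ x → cong (𝟙 (eq x (f zero)) *ᶻ_) (allFuns-count eq count k (f ∘ suc))) ⟩
    ∑ xs (λ x → 𝟙 (eq x (f zero)) *ᶻ + 1)
      ≡⟨ ∑-cong xs (λ x → ℤP.*-identityʳ _) ⟩
    ∑ xs (λ x → 𝟙 (eq x (f zero)))
      ≡⟨ count (f zero) ⟩
    + 1 ∎
    where
    open ≡-Reasoning
    G : (Fin (suc k) → A) → ℤ
    G g = 𝟙 (allF (λ j → eq (g j) (f j)))
    H : (Fin k → A) → ℤ
    H g = 𝟙 (allF (λ j → eq (g j) (f (suc j))))
    head-and-tail : ∀ x g → G (x VF.∷ g) ≡ 𝟙 (eq x (f zero)) *ᶻ H g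
    head-and-tail x g = trans (cong 𝟙 (allF-suc (λ j → eq ((x VF.∷ g) j) (f j))))
                              (𝟙-∧ (eq x (f zero)) _)

allFin-count : ∀ n (a : Fin n) → ∑ (allFin n) (λ x → 𝟙 ⌊ x ≟ a ⌋) ≡ + 1
allFin-count n a = trans (∑-single (allFin n) _ (Unique.allFin⁺ n) (∈P.∈-allFin a) off)
                         (cong 𝟙 (isYes-true (a ≟ a) refl))
  where
  off : ∀ {x} → x ∈ allFin n → x ≢ a → 𝟙 ⌊ x ≟ a ⌋ ≡ + 0
  off {x} _ x≢a = cong 𝟙 (isYes-false (x ≟ a) x≢a)

allPerms-count : ∀ n (π : Fin n → Fin n) → ∑ (allPerms n) (λ σ → 𝟙 (eqPerm σ π)) ≡ 𝟙 (isInjective π)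
allPerms-count n π = begin
  ∑ (allPerms n) (λ σ → 𝟙 (eqPerm σ π))
    ≡⟨ ∑-filter isInjective funs _ ⟩
  ∑ funs (λ σ → if isInjective σ then 𝟙 (eqPerm σ π) else + 0)
    ≡⟨ ∑-cong funs only-π ⟩
  ∑ funs (λ σ → 𝟙 (isInjective π) *ᶻ 𝟙 (eqPerm σ π))
    ≡⟨ ∑-*ˡ funs (𝟙 (isInjective π)) (λ σ → 𝟙 (eqPerm σ π)) ⟩
  𝟙 (isInjective π) *ᶻ ∑ funs (λ σ → 𝟙 (eqPerm σ π))
    ≡⟨ cong (𝟙 (isInjective π) *ᶻ_) (allFuns-count (allFin n) (λ x a → ⌊ x ≟ a ⌋) (allFin-count n) n π) ⟩
  𝟙 (isInjective π) *ᶻ + 1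
    ≡⟨ ℤP.*-identityʳ _ ⟩
  𝟙 (isInjective π) ∎
  where
  open ≡-Reasoning
  funs = allFuns (allFin n) n
  only-π : ∀ σ → (if isInjective σ then 𝟙 (eqPerm σ π) else + 0) ≡ 𝟙 (isInjective π) *ᶻ 𝟙 (eqPerm σ π)
  only-π σ with eqPerm σ π in e
  ... | true  = trans (cong 𝟙 (isInjective-cong {σ = σ} {σ′ = π} (eqPerm-sound e)))
                      (sym (ℤP.*-identityʳ (𝟙 (isInjective π))))
  ... | false = trans (if-then-0 (isInjective σ) (+ 0)) (sym (ℤP.*-zeroʳ (𝟙 (isInjective π))))

-ᶻ-+ᶻ-cancel : ∀ x y → x -ᶻ y +ᶻ y ≡ x
-ᶻ-+ᶻ-cancel = solve-∀

pairs : (n : ℕ) → List (Fin n × Fin n)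
pairs n = cartesianProduct (allFin n) (allFin n)

pairs-unique : ∀ {n} → Unique (pairs n)
pairs-unique {n} = Unique.cartesianProduct⁺ (Unique.allFin⁺ n) (Unique.allFin⁺ n)

pairs-complete : ∀ {n} (ab : Fin n × Fin n) → ab ∈ pairs n
pairs-complete (a , b) = ∈P.∈-cartesianProduct⁺ (∈P.∈-allFin a) (∈P.∈-allFin b)

isInversion : ∀ {n} → (Fin n → Fin n) → Fin n × Fin n → Bool
isInversion π (a , b) = ⌊ a <? b ⌋ ∧ ⌊ π b <? π a ⌋

inv≡∑ : ∀ {n} (π : Fin n → Fin n) → + inv π ≡ ∑ (pairs n) (𝟙 ∘ isInversion π)
inv≡∑ {n} π = length-filter (isInversion π) (pairs n)

inv-cong : ∀ {n} {π π′ : Fin n → Fin n} → π ≗ π′ → inv π ≡ inv π′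
inv-cong {n} {π} {π′} e = ℤP.+-injective (begin
  + inv π
    ≡⟨ inv≡∑ π ⟩
  ∑ (pairs n) (𝟙 ∘ isInversion π)
    ≡⟨ ∑-cong (pairs n) (λ (a , b) → cong₂ (λ x y → 𝟙 (⌊ a <? b ⌋ ∧ ⌊ x <? y ⌋)) (e b) (e a)) ⟩
  ∑ (pairs n) (𝟙 ∘ isInversion π′)
    ≡⟨ inv≡∑ π′ ⟨
  + inv π′                            ∎)
  where open ≡-Reasoning

module _ {m : ℕ} (i : Fin m) (π : Fin (suc m) → Fin (suc m)) (descent : π (suc i) < π (inject₁ i)) where
  private
    n = suc m
    I = inject₁ i
    S = suc i
    s = swap i
    s×s : Fin n × Fin n → Fin n × Fin n
    s×s (a , b) = s a , s b
    f g : Fin n × Fin n → ℤ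
    f = 𝟙 ∘ isInversion π
    g (a , b) = 𝟙 (⌊ s a <? s b ⌋ ∧ ⌊ π b <? π a ⌋)

    g≡inversions-of-π∘s : ∀ ab → g ab ≡ 𝟙 (isInversion (π ∘ s) (s×s ab))
    g≡inversions-of-π∘s (a , b) =
      cong₂ (λ x y → 𝟙 (⌊ s a <? s b ⌋ ∧ ⌊ π x <? π y ⌋)) (sym (swap-involutive i b)) (sym (swap-involutive i a))

    ∑g≡inv : ∑ (pairs n) g ≡ + inv (π ∘ s)
    ∑g≡inv = begin
      ∑ (pairs n) g
        ≡⟨ ∑-cong (pairs n) g≡inversions-of-π∘s ⟩
      ∑ (pairs n) (𝟙 ∘ isInversion (π ∘ s) ∘ s×s)
        ≡⟨ ∑-bijection (pairs n) s×s s×s (𝟙 ∘ isInversion (π ∘ s)) pairs-unique pairs-complete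
                        s×s-involutive s×s-involutive ⟩
      ∑ (pairs n) (𝟙 ∘ isInversion (π ∘ s))
        ≡⟨ inv≡∑ (π ∘ s) ⟨
      + inv (π ∘ s) ∎
      where
      open ≡-Reasoning
      s×s-involutive : ∀ ab → s×s (s×s ab) ≡ ab
      s×s-involutive (a , b) = cong₂ _,_ (swap-involutive i a) (swap-involutive i b)

    f≡g-elsewhere : ∀ {ab} → ab ≢ (I , S) → ab ≢ (S , I) → f ab ≡ g ab
    f≡g-elsewhere {a , b} ab≢IS ab≢SI with swap-reflects-< i a b ab≢IS ab≢SI
    ... | from , to with s a <? s b | a <? b
    ...   | yes _  | yes _ = refl
    ...   | no _   | no _  = refl
    ...   | yes lt | no ¬lt = contradiction (from lt) ¬lt
    ...   | no ¬lt | yes lt = contradiction (to lt) ¬lt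

    S≮I : ¬ (S < I)
    S≮I lt = FinP.<-asym lt (inject₁<suc i)

    f-IS : f (I , S) ≡ + 1
    f-IS = cong₂ (λ x y → 𝟙 (x ∧ y)) (isYes-true (I <? S) (inject₁<suc i)) (isYes-true (π S <? π I) descent)

    g-IS : g (I , S) ≡ + 0
    g-IS = cong (λ x → 𝟙 (x ∧ ⌊ π S <? π I ⌋))
                (trans (cong₂ (λ x y → ⌊ x <? y ⌋) (swap-inject₁ i) (swap-suc i)) (isYes-false (S <? I) S≮I))

    f-SI : f (S , I) ≡ + 0
    f-SI = cong (λ x → 𝟙 (x ∧ ⌊ π I <? π S ⌋)) (isYes-false (S <? I) S≮I)

    g-SI : g (S , I) ≡ + 0
    g-SI = cong₂ (λ x y → 𝟙 (x ∧ y))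
                 (trans (cong₂ (λ x y → ⌊ x <? y ⌋) (swap-suc i) (swap-inject₁ i)) (isYes-true (I <? S) (inject₁<suc i)))
                 (isYes-false (π I <? π S) (FinP.<-asym descent))

  inv-descent : inv π ≡ suc (inv (π ∘ swap i))
  inv-descent = ℤP.+-injective (begin
    + inv π                                    ≡⟨ inv≡∑ π ⟩
    ∑ (pairs n) f                              ≡⟨ ∑-cong (pairs n) (λ ab → sym (-ᶻ-+ᶻ-cancel (f ab) (g ab))) ⟩
    ∑ (pairs n) (λ ab → h ab +ᶻ g ab)          ≡⟨ ∑-+ (pairs n) h g ⟩
    ∑ (pairs n) h +ᶻ ∑ (pairs n) g             ≡⟨ cong₂ _+ᶻ_ ∑h≡1 ∑g≡inv ⟩
    + 1 +ᶻ + inv (π ∘ s)                       ∎)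
    where
    open ≡-Reasoning
    h : Fin n × Fin n → ℤ
    h ab = f ab -ᶻ g ab
    ∑h≡1 : ∑ (pairs n) h ≡ + 1
    ∑h≡1 = begin
      ∑ (pairs n) h
        ≡⟨ ∑-pair (×P.≡-dec _≟_ _≟_) (pairs n) h pairs-unique
            (pairs-complete _) (pairs-complete _) (inject₁≢suc i ∘ cong proj₁)
            (λ {ab} _ n₁ n₂ → trans (cong (f ab -ᶻ_) (sym (f≡g-elsewhere n₁ n₂))) (ℤP.+-inverseʳ (f ab))) ⟩
      h (I , S) +ᶻ h (S , I)
        ≡⟨ cong₂ _+ᶻ_ (cong₂ _-ᶻ_ f-IS g-IS) (cong₂ _-ᶻ_ f-SI g-SI) ⟩
      + 1 ∎

module _ {n : ℕ} {σ τ : Fin n → Fin n} (σ-inj : Injective _≡_ _≡_ σ) where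

  preimage-below⇒≗ : (∀ c → ∃[ k ] (k Fin.≤ c × τ k ≡ σ c)) → σ ≗ τ
  preimage-below⇒≗ below c = trans (sym (proj₂ (proj₂ (below c)))) (cong τ (witness≡ c (<-wellFounded c)))
    where
    witness≡ : ∀ c → Acc Fin._<_ c → proj₁ (below c) ≡ c
    witness≡ c (acc smaller) with below c | FinP.<-cmp (proj₁ (below c)) c
    ... | k , k≤c , τk≡σc | tri≈ _ k≡c _ = k≡c
    ... | k , k≤c , τk≡σc | tri> _ _ c<k = contradiction k≤c (ℕP.<⇒≱ c<k)
    ... | k , k≤c , τk≡σc | tri< k<c _ _ = contradiction (σ-inj σk≡σc) (FinP.<⇒≢ k<c)
      where
      σk≡σc : σ k ≡ σ c
      σk≡σc = trans (sym (subst (λ z → τ z ≡ σ k) (witness≡ k (smaller k<c)) (proj₂ (proj₂ (below k))))) τk≡σc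

allPerms-injective : ∀ {n} {σ : Fin n → Fin n} → σ ∈ allPerms n → Injective _≡_ _≡_ σ
allPerms-injective {n} σ∈ = isInjective-sound (proj₂ (∈-filterᵇ⁻ isInjective {allFuns (allFin n) n} σ∈))

allPerms-complete : ∀ {n} (σ : Fin n → Fin n) → Injective _≡_ _≡_ σ → ∃[ σ′ ] (σ′ ∈ allPerms n × σ′ ≗ σ)
allPerms-complete {n} σ σ-inj with allFuns-complete (allFin n) _≡_ n σ (λ j → σ j , ∈P.∈-allFin (σ j) , refl)
... | σ′ , σ′∈ , σ′≗σ =
  σ′ , ∈-filterᵇ⁺ isInjective σ′∈ (trans (isInjective-cong σ′≗σ) (isInjective-complete σ-inj)) , σ′≗σ

-- Defs.cosetReps n is greedyReps sameCoset applied to the invertible matrices.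
greedyReps : {A : Set} → (A → A → Bool) → List A → List A
greedyReps R = foldr (λ g acc → if anyᵇ (R g) acc then acc else g ∷ acc) []

∑-𝟙≡1⇒anyᵇ : {A : Set} (p : A → Bool) (xs : List A) → ∑ xs (𝟙 ∘ p) ≡ + 1 → anyᵇ p xs ≡ true
∑-𝟙≡1⇒anyᵇ p xs sum≡1 with anyᵇ p xs in found
... | true  = refl
... | false = contradiction (trans (sym (∑-zero xs _ (λ m → cong 𝟙 (anyᵇ-false⁻ p xs found m)))) sum≡1) (λ ())

module _ {A : Set} (R : A → A → Bool)
         (R-refl : ∀ {x} → R x x ≡ true)
         (R-sym : ∀ {x y} → R x y ≡ true → R y x ≡ true)
         (R-trans : ∀ {x y z} → R x y ≡ true → R y z ≡ true → R x z ≡ true) where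

  greedyReps-⊆ : ∀ L {a} → a ∈ greedyReps R L → a ∈ L
  greedyReps-⊆ (g ∷ L) a∈ with anyᵇ (R g) (greedyReps R L)
  greedyReps-⊆ (g ∷ L) a∈          | true  = there (greedyReps-⊆ L a∈)
  greedyReps-⊆ (g ∷ L) (here refl) | false = here refl
  greedyReps-⊆ (g ∷ L) (there a∈)  | false = there (greedyReps-⊆ L a∈)

  greedyReps-count : ∀ L x → ∑ (greedyReps R L) (λ a → 𝟙 (R a x)) ≡ 𝟙 (anyᵇ (λ y → R y x) L)
  greedyReps-count []      x = refl
  greedyReps-count (g ∷ L) x with anyᵇ (R g) (greedyReps R L) in g-covered
  ... | true  = trans (greedyReps-count L x) (cong 𝟙 (⇔-true⇒≡ inj₂-∨ covered))
    where
    inj₂-∨ : anyᵇ (λ y → R y x) L ≡ true → R g x ∨ anyᵇ (λ y → R y x) L ≡ true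
    inj₂-∨ e = let (y , y∈L , yx) = anyᵇ-true⁻ _ L e in anyᵇ-true⁺ (λ y → R y x) {g ∷ L} (there y∈L) yx
    covered : R g x ∨ anyᵇ (λ y → R y x) L ≡ true → anyᵇ (λ y → R y x) L ≡ true
    covered e with ∨-true⁻ {R g x} e
    ... | inj₂ e′ = e′
    ... | inj₁ gx with anyᵇ-true⁻ (R g) (greedyReps R L) g-covered
    ...   | a , a∈ , ga = anyᵇ-true⁺ (λ y → R y x) (greedyReps-⊆ L a∈) (R-trans (R-sym ga) gx)
  ... | false = by-cases (R g x) refl
    where
    reps = greedyReps R L
    by-cases : ∀ b → R g x ≡ b → 𝟙 b +ᶻ ∑ reps (λ a → 𝟙 (R a x)) ≡ 𝟙 (b ∨ anyᵇ (λ y → R y x) L)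
    by-cases false _  = trans (ℤP.+-identityˡ _) (greedyReps-count L x)
    by-cases true  gx = cong (+ 1 +ᶻ_) (trans (greedyReps-count L x) (cong 𝟙 L-uncovered))
      where
      L-uncovered : anyᵇ (λ y → R y x) L ≡ false
      L-uncovered = ≢true⇒≡false λ e →
        let (y , y∈L , yx) = anyᵇ-true⁻ _ L e
            (a , a∈ , ay) = anyᵇ-true⁻ _ reps (∑-𝟙≡1⇒anyᵇ (λ a → R a y) reps
                              (trans (greedyReps-count L y) (cong 𝟙 (anyᵇ-true⁺ (λ z → R z y) y∈L R-refl))))
            g-covers-a = anyᵇ-true⁺ (R g) a∈ (R-trans gx (R-trans (R-sym yx) (R-sym ay)))
        in contradiction (trans (sym g-covers-a) g-covered) (λ ())

module Matrices {q : ℕ} (F : FiniteField q) where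

  open FiniteField F public renaming (_≟_ to _≟ᶠ_)
  open GLn F public

  ring : CommutativeRing _ _
  ring = record { isCommutativeRing = isCommutativeRing }

  open CommutativeRing ring public
    using (+-assoc; +-comm; +-identityˡ; +-identityʳ; *-assoc; *-comm; *-identityˡ; *-identityʳ;
           distribˡ; distribʳ; zeroˡ; zeroʳ; -‿inverseˡ; -‿inverseʳ; +-commutativeSemigroup)
  open RingProperties (CommutativeRing.ring ring) public using (-‿distribˡ-*)
  open CommutativeSemigroupProperties +-commutativeSemigroup using (interchange)

  _⁻¹ : ∀ x → x ≢ 0# → Carrier
  x ⁻¹ = λ x≢0 → proj₁ (inverse x x≢0)

  *-inverseʳ : ∀ x (x≢0 : x ≢ 0#) → x * (x ⁻¹) x≢0 ≡ 1#
  *-inverseʳ x x≢0 = proj₂ (inverse x x≢0)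

  *-inverseˡ : ∀ x (x≢0 : x ≢ 0#) → (x ⁻¹) x≢0 * x ≡ 1#
  *-inverseˡ x x≢0 = trans (*-comm _ x) (*-inverseʳ x x≢0)

  *-cancelˡ-0 : ∀ x y → x ≢ 0# → x * y ≡ 0# → y ≡ 0#
  *-cancelˡ-0 x y x≢0 xy≡0 = begin
    y                        ≡⟨ *-identityˡ y ⟨
    1# * y                   ≡⟨ cong (_* y) (*-inverseˡ x x≢0) ⟨
    (x ⁻¹) x≢0 * x * y       ≡⟨ *-assoc _ x y ⟩
    (x ⁻¹) x≢0 * (x * y)     ≡⟨ cong ((x ⁻¹) x≢0 *_) xy≡0 ⟩
    (x ⁻¹) x≢0 * 0#          ≡⟨ zeroʳ _ ⟩
    0#                       ∎
    where open ≡-Reasoning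

  unit⇒≢0 : ∀ x y → x * y ≡ 1# → x ≢ 0#
  unit⇒≢0 x y xy≡1 refl = 0≢1 (trans (sym (zeroˡ y)) xy≡1)

  sumF-suc : ∀ {n} (f : Fin (suc n) → Carrier) → sumF f ≡ f zero + sumF (f ∘ suc)
  sumF-suc f = cong (λ l → f zero + foldr _+_ 0# l)
                    (trans (ListP.map-tabulate suc f) (sym (ListP.map-tabulate id (f ∘ suc))))

  sumF-cong : ∀ {n} {f g : Fin n → Carrier} → (∀ k → f k ≡ g k) → sumF f ≡ sumF g
  sumF-cong {n} eq = cong (foldr _+_ 0#) (ListP.map-cong eq (allFin n))

  sumF-zero : ∀ {n} (f : Fin n → Carrier) → (∀ k → f k ≡ 0#) → sumF f ≡ 0#
  sumF-zero {zero}  f eq = refl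
  sumF-zero {suc n} f eq =
    trans (sumF-suc f) (trans (cong₂ _+_ (eq zero) (sumF-zero (f ∘ suc) (eq ∘ suc))) (+-identityʳ 0#))

  sumF-single : ∀ {n} (f : Fin n → Carrier) (a : Fin n) → (∀ k → k ≢ a → f k ≡ 0#) → sumF f ≡ f a
  sumF-single {suc n} f zero    off = trans (sumF-suc f)
    (trans (cong (_+_ (f zero)) (sumF-zero (f ∘ suc) (λ k → off (suc k) (λ ())))) (+-identityʳ _))
  sumF-single {suc n} f (suc a) off = trans (sumF-suc f)
    (trans (cong₂ _+_ (off zero (λ ()))
                      (sumF-single (f ∘ suc) a (λ k k≢a → off (suc k) (k≢a ∘ FinP.suc-injective))))
           (+-identityˡ _))

  sumF-+ : ∀ {n} (f g : Fin n → Carrier) → sumF (λ k → f k + g k) ≡ sumF f + sumF g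
  sumF-+ {zero}  f g = sym (+-identityʳ 0#)
  sumF-+ {suc n} f g = begin
    sumF (λ k → f k + g k)
      ≡⟨ sumF-suc (λ k → f k + g k) ⟩
    f zero + g zero + sumF (λ k → f (suc k) + g (suc k))
      ≡⟨ cong (_+_ (f zero + g zero)) (sumF-+ (f ∘ suc) (g ∘ suc)) ⟩
    f zero + g zero + (sumF (f ∘ suc) + sumF (g ∘ suc))
      ≡⟨ interchange (f zero) (g zero) _ _ ⟩
    f zero + sumF (f ∘ suc) + (g zero + sumF (g ∘ suc))
      ≡⟨ cong₂ _+_ (sumF-suc f) (sumF-suc g) ⟨
    sumF f + sumF g ∎
    where open ≡-Reasoning

  sumF-*ˡ : ∀ {n} (c : Carrier) (f : Fin n → Carrier) → sumF (λ k → c * f k) ≡ c * sumF f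
  sumF-*ˡ {zero}  c f = sym (zeroʳ c)
  sumF-*ˡ {suc n} c f = begin
    sumF (λ k → c * f k)               ≡⟨ sumF-suc (λ k → c * f k) ⟩
    c * f zero + sumF (λ k → c * f (suc k)) ≡⟨ cong (_+_ (c * f zero)) (sumF-*ˡ c (f ∘ suc)) ⟩
    c * f zero + c * sumF (f ∘ suc)    ≡⟨ distribˡ c _ _ ⟨
    c * (f zero + sumF (f ∘ suc))      ≡⟨ cong (c *_) (sumF-suc f) ⟨
    c * sumF f                         ∎
    where open ≡-Reasoning

  sumF-*ʳ : ∀ {n} (c : Carrier) (f : Fin n → Carrier) → sumF (λ k → f k * c) ≡ sumF f * c
  sumF-*ʳ c f = trans (sumF-cong (λ k → *-comm (f k) c)) (trans (sumF-*ˡ c f) (*-comm c _))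

  sumF-comm : ∀ {m n} (f : Fin m → Fin n → Carrier) →
              sumF (λ j → sumF (f j)) ≡ sumF (λ k → sumF (λ j → f j k))
  sumF-comm {zero}  {n} f = sym (sumF-zero {n} (λ _ → 0#) (λ _ → refl))
  sumF-comm {suc m}     f = begin
    sumF (λ j → sumF (f j))
      ≡⟨ sumF-suc (λ j → sumF (f j)) ⟩
    sumF (f zero) + sumF (λ j → sumF (f (suc j)))
      ≡⟨ cong (_+_ (sumF (f zero))) (sumF-comm (f ∘ suc)) ⟩
    sumF (f zero) + sumF (λ k → sumF (λ j → f (suc j) k))
      ≡⟨ sumF-+ (f zero) _ ⟨
    sumF (λ k → f zero k + sumF (λ j → f (suc j) k))
      ≡⟨ sumF-cong (λ k → sumF-suc (λ j → f j k)) ⟨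
    sumF (λ k → sumF (λ j → f j k)) ∎
    where open ≡-Reasoning

  sumF≢0⇒∃≢0 : ∀ {n} (f : Fin n → Carrier) → sumF f ≢ 0# → ∃[ k ] f k ≢ 0#
  sumF≢0⇒∃≢0 {zero}  f sum≢0 = contradiction refl sum≢0
  sumF≢0⇒∃≢0 {suc n} f sum≢0 with f zero ≟ᶠ 0#
  ... | no f0≢0 = zero , f0≢0
  ... | yes f0≡0 with sumF≢0⇒∃≢0 (f ∘ suc) (λ rest≡0 →
                        sum≢0 (trans (sumF-suc f) (trans (cong₂ _+_ f0≡0 rest≡0) (+-identityʳ 0#))))
  ...   | k , fk≢0 = suc k , fk≢0

  ≈ᴹ-isEquivalence : ∀ {n} → IsEquivalence (_≈ᴹ_ {n})
  ≈ᴹ-isEquivalence = record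
    { refl  = λ _ _ → refl
    ; sym   = λ e r c → sym (e r c)
    ; trans = λ e f r c → trans (e r c) (f r c)
    }

  ≈ᴹ-setoid : ℕ → Setoid _ _
  ≈ᴹ-setoid n = record { isEquivalence = ≈ᴹ-isEquivalence {n} }

  module ≈ᴹ {n : ℕ} = IsEquivalence (≈ᴹ-isEquivalence {n})
  module ≈ᴹ-Reasoning {n : ℕ} = SetoidReasoning (≈ᴹ-setoid n)

  ⊗-cong : ∀ {n} {A A′ B B′ : Mat n} → A ≈ᴹ A′ → B ≈ᴹ B′ → A ⊗ B ≈ᴹ A′ ⊗ B′
  ⊗-cong e f r c = sumF-cong (λ k → cong₂ _*_ (e r k) (f k c))

  ⊗-congˡ : ∀ {n} {A A′ : Mat n} (B : Mat n) → A ≈ᴹ A′ → A ⊗ B ≈ᴹ A′ ⊗ B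
  ⊗-congˡ B e = ⊗-cong e ≈ᴹ.refl

  ⊗-congʳ : ∀ {n} (A : Mat n) {B B′ : Mat n} → B ≈ᴹ B′ → A ⊗ B ≈ᴹ A ⊗ B′
  ⊗-congʳ A e = ⊗-cong ≈ᴹ.refl e

  ⊗-assoc : ∀ {n} (A B C : Mat n) → (A ⊗ B) ⊗ C ≈ᴹ A ⊗ (B ⊗ C)
  ⊗-assoc A B C r c = begin
    sumF (λ k → sumF (λ j → A r j * B j k) * C k c)
      ≡⟨ sumF-cong (λ k → sumF-*ʳ (C k c) (λ j → A r j * B j k)) ⟨
    sumF (λ k → sumF (λ j → A r j * B j k * C k c))
      ≡⟨ sumF-comm (λ k j → A r j * B j k * C k c) ⟩
    sumF (λ j → sumF (λ k → A r j * B j k * C k c))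
      ≡⟨ sumF-cong (λ j → sumF-cong (λ k → *-assoc (A r j) (B j k) (C k c))) ⟩
    sumF (λ j → sumF (λ k → A r j * (B j k * C k c)))
      ≡⟨ sumF-cong (λ j → sumF-*ˡ (A r j) (λ k → B j k * C k c)) ⟩
    sumF (λ j → A r j * sumF (λ k → B j k * C k c)) ∎
    where open ≡-Reasoning

  I-diag : ∀ {n} (r : Fin n) → I r r ≡ 1#
  I-diag r = cong (if_then 1# else 0#) (isYes-true (r ≟ r) refl)

  I-off : ∀ {n} {r c : Fin n} → r ≢ c → I r c ≡ 0#
  I-off {r = r} {c} r≢c = cong (if_then 1# else 0#) (isYes-false (r ≟ c) r≢c)

  ⊗-identityˡ : ∀ {n} (A : Mat n) → I ⊗ A ≈ᴹ A
  ⊗-identityˡ A r c = trans (sumF-single _ r (λ k k≢r → trans (cong (_* A k c) (I-off (k≢r ∘ sym))) (zeroˡ _)))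
                            (trans (cong (_* A r c) (I-diag r)) (*-identityˡ _))

  ⊗-identityʳ : ∀ {n} (A : Mat n) → A ⊗ I ≈ᴹ A
  ⊗-identityʳ A r c = trans (sumF-single _ c (λ k k≢c → trans (cong (A r k *_) (I-off k≢c)) (zeroʳ _)))
                            (trans (cong (A r c *_) (I-diag c)) (*-identityʳ _))

  ⊗-permMat : ∀ {n} (A : Mat n) (σ : Fin n → Fin n) r c → (A ⊗ permMat σ) r c ≡ A r (σ c)
  ⊗-permMat A σ r c =
    trans (sumF-single _ (σ c) (λ k k≢σc → trans (cong (A r k *_) (I-off k≢σc)) (zeroʳ _)))
          (trans (cong (A r (σ c) *_) (I-diag (σ c))) (*-identityʳ _))

  permMat-⊗-permMat : ∀ {n} (σ τ : Fin n → Fin n) → permMat σ ⊗ permMat τ ≈ᴹ permMat (σ ∘ τ)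
  permMat-⊗-permMat σ τ = ⊗-permMat (permMat σ) τ

  permMat-cong : ∀ {n} {σ τ : Fin n → Fin n} → σ ≗ τ → permMat σ ≈ᴹ permMat τ
  permMat-cong e r c = cong (λ z → I r z) (e c)

  _ᵀ : ∀ {n} → Mat n → Mat n
  (A ᵀ) r c = A c r

  ⊗-ᵀ : ∀ {n} (A B : Mat n) → (A ⊗ B) ᵀ ≈ᴹ (B ᵀ) ⊗ (A ᵀ)
  ⊗-ᵀ A B r c = sumF-cong (λ k → *-comm (A c k) (B k r))

  Iᵀ : ∀ {n} → (I {n}) ᵀ ≈ᴹ I
  Iᵀ r c with r ≟ c
  ... | yes refl = I-diag r
  ... | no r≢c   = I-off (r≢c ∘ sym)

  ⊗-cancelˡ : ∀ {n} {g A B : Mat n} → IsInvertible g → g ⊗ A ≈ᴹ g ⊗ B → A ≈ᴹ B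
  ⊗-cancelˡ {g = g} {A} {B} (g′ , _ , g′g≈I) e = begin
    A              ≈⟨ ⊗-identityˡ A ⟨
    I ⊗ A          ≈⟨ ⊗-congˡ A g′g≈I ⟨
    (g′ ⊗ g) ⊗ A   ≈⟨ ⊗-assoc g′ g A ⟩
    g′ ⊗ (g ⊗ A)   ≈⟨ ⊗-congʳ g′ e ⟩
    g′ ⊗ (g ⊗ B)   ≈⟨ ⊗-assoc g′ g B ⟨
    (g′ ⊗ g) ⊗ B   ≈⟨ ⊗-congˡ B g′g≈I ⟩
    I ⊗ B          ≈⟨ ⊗-identityˡ B ⟩
    B              ∎
    where open ≈ᴹ-Reasoning

  Upper : ∀ {n} → Mat n → Set
  Upper A = ∀ r c → c < r → A r c ≡ 0#

  Lower : ∀ {n} → Mat n → Set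
  Lower A = ∀ r c → r < c → A r c ≡ 0#

  Upper-cong : ∀ {n} {A B : Mat n} → A ≈ᴹ B → Upper A → Upper B
  Upper-cong e u r c lt = trans (sym (e r c)) (u r c lt)

  Lower-cong : ∀ {n} {A B : Mat n} → A ≈ᴹ B → Lower A → Lower B
  Lower-cong e l r c lt = trans (sym (e r c)) (l r c lt)

  Upper-I : ∀ {n} → Upper (I {n})
  Upper-I r c c<r = I-off (FinP.<⇒≢ c<r ∘ sym)

  Lower-I : ∀ {n} → Lower (I {n})
  Lower-I r c r<c = I-off (FinP.<⇒≢ r<c)

  Upper-⊗ : ∀ {n} {A B : Mat n} → Upper A → Upper B → Upper (A ⊗ B)
  Upper-⊗ {A = A} {B} uA uB r c c<r = sumF-zero _ term≡0
    where
    term≡0 : ∀ k → A r k * B k c ≡ 0#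
    term≡0 k with FinP.<-cmp k r
    ... | tri< k<r _ _  = trans (cong (_* B k c) (uA r k k<r)) (zeroˡ _)
    ... | tri≈ _ refl _ = trans (cong (A r k *_) (uB k c c<r)) (zeroʳ _)
    ... | tri> _ _ r<k  = trans (cong (A r k *_) (uB k c (FinP.<-trans c<r r<k))) (zeroʳ _)

  Upper-ᵀ : ∀ {n} {A : Mat n} → Lower A → Upper (A ᵀ)
  Upper-ᵀ l r c = l c r

  Lower-⊗ : ∀ {n} {A B : Mat n} → Lower A → Lower B → Lower (A ⊗ B)
  Lower-⊗ {A = A} {B} lA lB r c r<c =
    trans (⊗-ᵀ A B c r) (Upper-⊗ (Upper-ᵀ lB) (Upper-ᵀ lA) c r r<c)

  Invertible-cong : ∀ {n} {A B : Mat n} → A ≈ᴹ B → IsInvertible A → IsInvertible B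
  Invertible-cong e (A′ , AA′ , A′A) =
    A′ , ≈ᴹ.trans (⊗-congˡ A′ (≈ᴹ.sym e)) AA′ , ≈ᴹ.trans (⊗-congʳ A′ (≈ᴹ.sym e)) A′A

  Invertible-I : ∀ {n} → IsInvertible (I {n})
  Invertible-I = I , ⊗-identityʳ I , ⊗-identityʳ I

  Invertible-⊗ : ∀ {n} {A B : Mat n} → IsInvertible A → IsInvertible B → IsInvertible (A ⊗ B)
  Invertible-⊗ {A = A} {B} (A′ , AA′ , A′A) (B′ , BB′ , B′B) =
    B′ ⊗ A′ , cancel A B B′ A′ BB′ AA′ , cancel B′ A′ A B A′A B′B
    where
    cancel : ∀ X Y Y′ X′ → Y ⊗ Y′ ≈ᴹ I → X ⊗ X′ ≈ᴹ I → (X ⊗ Y) ⊗ (Y′ ⊗ X′) ≈ᴹ I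
    cancel X Y Y′ X′ YY′ XX′ = begin
      (X ⊗ Y) ⊗ (Y′ ⊗ X′)  ≈⟨ ⊗-assoc X Y (Y′ ⊗ X′) ⟩
      X ⊗ (Y ⊗ (Y′ ⊗ X′))  ≈⟨ ⊗-congʳ X (⊗-assoc Y Y′ X′) ⟨
      X ⊗ ((Y ⊗ Y′) ⊗ X′)  ≈⟨ ⊗-congʳ X (⊗-congˡ X′ YY′) ⟩
      X ⊗ (I ⊗ X′)         ≈⟨ ⊗-congʳ X (⊗-identityˡ X′) ⟩
      X ⊗ X′               ≈⟨ XX′ ⟩
      I                    ∎
      where open ≈ᴹ-Reasoning

  Invertible-inverse : ∀ {n} {A : Mat n} (inv : IsInvertible A) → IsInvertible (proj₁ inv)
  Invertible-inverse {A = A} (A′ , AA′ , A′A) = A , A′A , AA′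

  Invertible-ᵀ : ∀ {n} {A : Mat n} → IsInvertible A → IsInvertible (A ᵀ)
  Invertible-ᵀ (A′ , AA′ , A′A) = A′ ᵀ , transpose-of A′A , transpose-of AA′
    where
    transpose-of : ∀ {X Y} → Y ⊗ X ≈ᴹ I → (X ᵀ) ⊗ (Y ᵀ) ≈ᴹ I
    transpose-of {X} {Y} YX r c = trans (sym (⊗-ᵀ Y X r c)) (trans (YX c r) (Iᵀ r c))

  module _ {n : ℕ} {u v : Mat n} (u-upper : Upper u) (uv≈I : u ⊗ v ≈ᴹ I) where

    private
      RowFacts : Fin n → Set
      RowFacts r = (∀ c → c < r → v r c ≡ 0#) × (u r r * v r r ≡ 1#)

      rowFacts : ∀ r → Acc Fin._>_ r → RowFacts r
      rowFacts r (acc below) = v-row , diag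
        where
        v-lower-rows : ∀ {r′} → r < r′ → ∀ c → c < r′ → v r′ c ≡ 0#
        v-lower-rows r<r′ = proj₁ (rowFacts _ (below r<r′))
        row-r : ∀ c → c ≤ r → u r r * v r c ≡ I r c
        row-r c c≤r = trans (sym (sumF-single (λ k → u r k * v k c) r off)) (uv≈I r c)
          where
          off : ∀ k → k ≢ r → u r k * v k c ≡ 0#
          off k k≢r with FinP.<-cmp k r
          ... | tri< k<r _ _ = trans (cong (_* v k c) (u-upper r k k<r)) (zeroˡ _)
          ... | tri≈ _ k≡r _ = contradiction k≡r k≢r
          ... | tri> _ _ r<k = trans (cong (u r k *_) (v-lower-rows r<k c (ℕP.≤-<-trans c≤r r<k))) (zeroʳ _)
        diag : u r r * v r r ≡ 1#
        diag = trans (row-r r FinP.≤-refl) (I-diag r)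
        v-row : ∀ c → c < r → v r c ≡ 0#
        v-row c c<r = *-cancelˡ-0 (u r r) (v r c) (unit⇒≢0 _ _ diag)
                        (trans (row-r c (ℕP.<⇒≤ c<r)) (I-off (FinP.<⇒≢ c<r ∘ sym)))

    Upper-rightInverse : Upper v
    Upper-rightInverse r = proj₁ (rowFacts r (>-wellFounded r))

    Upper-diag-unit : ∀ r → u r r * v r r ≡ 1#
    Upper-diag-unit r = proj₂ (rowFacts r (>-wellFounded r))

  Upper-inverse : ∀ {n} {u : Mat n} → Upper u → (inv : IsInvertible u) → Upper (proj₁ inv)
  Upper-inverse u-upper (_ , uv≈I , _) = Upper-rightInverse u-upper uv≈I

  Upper-diag≢0 : ∀ {n} {u : Mat n} → Upper u → IsInvertible u → ∀ r → u r r ≢ 0#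
  Upper-diag≢0 u-upper (_ , uv≈I , _) r = unit⇒≢0 _ _ (Upper-diag-unit u-upper uv≈I r)

  Lower-inverse : ∀ {n} {l : Mat n} → Lower l → (inv : IsInvertible l) → Lower (proj₁ inv)
  Lower-inverse l-lower inv r c = Upper-inverse (Upper-ᵀ l-lower) (Invertible-ᵀ inv) c r

  Lower-diag≢0 : ∀ {n} {l : Mat n} → Lower l → IsInvertible l → ∀ r → l r r ≢ 0#
  Lower-diag≢0 l-lower inv = Upper-diag≢0 (Upper-ᵀ l-lower) (Invertible-ᵀ inv)

  if-≡ : ∀ {n} {A : Set} {r a : Fin n} {x y : A} → r ≡ a → (if ⌊ r ≟ a ⌋ then x else y) ≡ x
  if-≡ {r = r} {a} e = cong (if_then _ else _) (isYes-true (r ≟ a) e)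

  if-≢ : ∀ {n} {A : Set} {r a : Fin n} {x y : A} → r ≢ a → (if ⌊ r ≟ a ⌋ then x else y) ≡ y
  if-≢ {r = r} {a} ne = cong (if_then _ else _) (isYes-false (r ≟ a) ne)

  transvection : ∀ {n} → Fin n → Fin n → Carrier → Mat n
  transvection a b t r c = I r c + (if ⌊ r ≟ a ⌋ then (if ⌊ c ≟ b ⌋ then t else 0#) else 0#)

  transvection-⊗ : ∀ {n} (a b : Fin n) t (A : Mat n) r c →
    (transvection a b t ⊗ A) r c ≡ A r c + (if ⌊ r ≟ a ⌋ then t * A b c else 0#)
  transvection-⊗ {n} a b t A r c = begin
    sumF (λ k → (I r k + D k) * A k c)            ≡⟨ sumF-cong (λ k → distribʳ (A k c) (I r k) (D k)) ⟩
    sumF (λ k → I r k * A k c + D k * A k c)      ≡⟨ sumF-+ (λ k → I r k * A k c) (λ k → D k * A k c) ⟩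
    (I ⊗ A) r c + sumF (λ k → D k * A k c)        ≡⟨ cong₂ _+_ (⊗-identityˡ A r c) row-a ⟩
    A r c + (if ⌊ r ≟ a ⌋ then t * A b c else 0#) ∎
    where
    open ≡-Reasoning
    D : Fin n → Carrier
    D k = if ⌊ r ≟ a ⌋ then (if ⌊ k ≟ b ⌋ then t else 0#) else 0#
    row-a : sumF (λ k → D k * A k c) ≡ (if ⌊ r ≟ a ⌋ then t * A b c else 0#)
    row-a with r ≟ a
    ... | no _  = sumF-zero _ (λ k → zeroˡ (A k c))
    ... | yes _ = trans (sumF-single _ b (λ k k≢b → trans (cong (_* A k c) (if-≢ k≢b)) (zeroˡ _)))
                        (cong (_* A b c) (if-≡ {r = b} refl))

  ⊗-transvection : ∀ {n} (a b : Fin n) t (A : Mat n) r c →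
    (A ⊗ transvection a b t) r c ≡ A r c + (if ⌊ c ≟ b ⌋ then A r a * t else 0#)
  ⊗-transvection {n} a b t A r c = begin
    sumF (λ k → A r k * (I k c + D k))            ≡⟨ sumF-cong (λ k → distribˡ (A r k) (I k c) (D k)) ⟩
    sumF (λ k → A r k * I k c + A r k * D k)      ≡⟨ sumF-+ (λ k → A r k * I k c) (λ k → A r k * D k) ⟩
    (A ⊗ I) r c + sumF (λ k → A r k * D k)        ≡⟨ cong₂ _+_ (⊗-identityʳ A r c) column-b ⟩
    A r c + (if ⌊ c ≟ b ⌋ then A r a * t else 0#) ∎
    where
    open ≡-Reasoning
    D : Fin n → Carrier
    D k = if ⌊ k ≟ a ⌋ then (if ⌊ c ≟ b ⌋ then t else 0#) else 0#
    column-b : sumF (λ k → A r k * D k) ≡ (if ⌊ c ≟ b ⌋ then A r a * t else 0#)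
    column-b with c ≟ b
    ... | yes _ = trans (sumF-single _ a (λ k k≢a → trans (cong (A r k *_) (if-≢ k≢a)) (zeroʳ _)))
                        (cong (A r a *_) (if-≡ {r = a} refl))
    ... | no _  = sumF-zero _ (λ k → trans (cong (A r k *_) (if-same (⌊ k ≟ a ⌋))) (zeroʳ _))
      where
      if-same : ∀ b → (if b then 0# else 0#) ≡ 0#
      if-same true  = refl
      if-same false = refl

  transvection-0 : ∀ {n} (a b : Fin n) → transvection a b 0# ≈ᴹ I
  transvection-0 a b r c = trans (cong (_+_ (I r c)) off) (+-identityʳ _)
    where
    off : (if ⌊ r ≟ a ⌋ then (if ⌊ c ≟ b ⌋ then 0# else 0#) else 0#) ≡ 0#
    off with ⌊ r ≟ a ⌋ | ⌊ c ≟ b ⌋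
    ... | true  | true  = refl
    ... | true  | false = refl
    ... | false | _     = refl

  transvection-+ : ∀ {n} (a b : Fin n) → a ≢ b → ∀ t t′ →
                   transvection a b t ⊗ transvection a b t′ ≈ᴹ transvection a b (t + t′)
  transvection-+ a b a≢b t t′ r c = trans (transvection-⊗ a b t (transvection a b t′) r c) entry
    where
    row-b : ∀ {x} → transvection a b t′ b x ≡ I b x
    row-b = trans (cong (_+_ (I _ _)) (if-≢ (a≢b ∘ sym))) (+-identityʳ _)
    entry : transvection a b t′ r c + (if ⌊ r ≟ a ⌋ then t * transvection a b t′ b c else 0#)
            ≡ transvection a b (t + t′) r c
    entry rewrite row-b {c} with r ≟ a | c ≟ b
    ... | yes refl | yes refl = begin
      I r c + t′ + t * I c c  ≡⟨ cong (λ z → I r c + t′ + t * z) (I-diag c) ⟩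
      I r c + t′ + t * 1#     ≡⟨ cong (_+_ (I r c + t′)) (*-identityʳ t) ⟩
      I r c + t′ + t          ≡⟨ +-assoc _ t′ t ⟩
      I r c + (t′ + t)        ≡⟨ cong (_+_ (I r c)) (+-comm t′ t) ⟩
      I r c + (t + t′)        ∎
      where open ≡-Reasoning
    ... | yes refl | no c≢b =
      trans (cong (_+_ (I r c + 0#)) (trans (cong (t *_) (I-off (c≢b ∘ sym))) (zeroʳ t))) (+-identityʳ _)
    ... | no _     | _      = +-identityʳ _

  Invertible-transvection : ∀ {n} (a b : Fin n) → a ≢ b → ∀ t → IsInvertible (transvection a b t)
  Invertible-transvection a b a≢b t =
    transvection a b (- t) , cancels t (- t) (-‿inverseʳ t) , cancels (- t) t (-‿inverseˡ t)
    where
    cancels : ∀ x y → x + y ≡ 0# → transvection a b x ⊗ transvection a b y ≈ᴹ I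
    cancels x y x+y≡0 = ≈ᴹ.trans (transvection-+ a b a≢b x y)
                          (≈ᴹ.trans (λ r c → cong (λ z → transvection a b z r c) x+y≡0) (transvection-0 a b))

  private
    transvection-off : ∀ {n} {a b r c : Fin n} {t} → (r ≡ a → c ≡ b → ⊥) → transvection a b t r c ≡ I r c
    transvection-off {a = a} {b} {r} {c} not-ab with r ≟ a | c ≟ b
    ... | yes r≡a | yes c≡b = contradiction c≡b (not-ab r≡a)
    ... | yes _   | no _    = +-identityʳ _
    ... | no _    | _       = +-identityʳ _

  Lower-transvection : ∀ {n} (a b : Fin n) → b < a → ∀ t → Lower (transvection a b t)
  Lower-transvection a b b<a t r c r<c =
    trans (transvection-off (λ { refl refl → FinP.<-asym b<a r<c })) (Lower-I r c r<c)

  Upper-transvection : ∀ {n} (a b : Fin n) → a < b → ∀ t → Upper (transvection a b t)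
  Upper-transvection a b a<b t r c c<r =
    trans (transvection-off (λ { refl refl → FinP.<-asym a<b c<r })) (Upper-I r c c<r)

  transvection-at : ∀ {n} (a b : Fin n) t → transvection a b t a b ≡ I a b + t
  transvection-at a b t = cong (_+_ (I a b)) (trans (if-≡ {r = a} refl) (if-≡ {r = b} refl))

  transvection-offRow : ∀ {n} (a b : Fin n) t {r} c → r ≢ a → transvection a b t r c ≡ I r c
  transvection-offRow a b t c r≢a = transvection-off (λ r≡a _ → r≢a r≡a)

  transvection-offColumn : ∀ {n} (a b : Fin n) t r {c} → c ≢ b → transvection a b t r c ≡ I r c
  transvection-offColumn a b t r c≢b = transvection-off (λ _ c≡b → c≢b c≡b)

  permMat-⊗-transvection : ∀ {n} (σ : Fin n → Fin n) → Injective _≡_ _≡_ σ → ∀ a b t →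
    permMat σ ⊗ transvection a b t ≈ᴹ transvection (σ a) (σ b) t ⊗ permMat σ
  permMat-⊗-transvection σ σ-inj a b t r k =
    trans (⊗-transvection a b t (permMat σ) r k) (trans entry (sym (⊗-permMat (transvection (σ a) (σ b) t) σ r k)))
    where
    entry : permMat σ r k + (if ⌊ k ≟ b ⌋ then permMat σ r a * t else 0#) ≡ transvection (σ a) (σ b) t r (σ k)
    entry with k ≟ b
    ... | yes refl rewrite isYes-true (σ k ≟ σ k) refl with r ≟ σ a
    ...   | yes _ = cong (_+_ (I r (σ k))) (*-identityˡ t)
    ...   | no _  = cong (_+_ (I r (σ k))) (zeroˡ t)
    entry | no k≢b rewrite isYes-false (σ k ≟ σ b) (k≢b ∘ σ-inj) with ⌊ r ≟ σ a ⌋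
    ...   | true  = refl
    ...   | false = refl

module BruhatCells {q : ℕ} (F : FiniteField q) where

  open Matrices F

  Cell : ∀ {n} → (Fin n → Fin n) → Mat n → Set
  Cell σ g = ∃[ l ] ∃[ u ] (Lower l × IsInvertible l × Upper u × IsInvertible u × (l ⊗ permMat σ ⊗ u ≈ᴹ g))

  infix 4 _∼ᴮ_
  _∼ᴮ_ : ∀ {n} → Mat n → Mat n → Set
  g ∼ᴮ x = ∃[ b ] (Upper b × IsInvertible b × (g ⊗ b ≈ᴹ x))

  ≈ᴹ⇒∼ᴮ : ∀ {n} {g x : Mat n} → g ≈ᴹ x → g ∼ᴮ x
  ≈ᴹ⇒∼ᴮ e = I , Upper-I , Invertible-I , ≈ᴹ.trans (⊗-identityʳ _) e

  ∼ᴮ-refl : ∀ {n} {g : Mat n} → g ∼ᴮ g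
  ∼ᴮ-refl = ≈ᴹ⇒∼ᴮ ≈ᴹ.refl

  ∼ᴮ-sym : ∀ {n} {g x : Mat n} → g ∼ᴮ x → x ∼ᴮ g
  ∼ᴮ-sym {g = g} {x} (b , b-upper , b-inv@(b′ , bb′≈I , _) , gb≈x) =
    b′ , Upper-inverse b-upper b-inv , Invertible-inverse b-inv , (begin
      x ⊗ b′          ≈⟨ ⊗-congˡ b′ gb≈x ⟨
      (g ⊗ b) ⊗ b′    ≈⟨ ⊗-assoc g b b′ ⟩
      g ⊗ (b ⊗ b′)    ≈⟨ ⊗-congʳ g bb′≈I ⟩
      g ⊗ I           ≈⟨ ⊗-identityʳ g ⟩
      g               ∎)
    where open ≈ᴹ-Reasoning

  ∼ᴮ-trans : ∀ {n} {g x y : Mat n} → g ∼ᴮ x → x ∼ᴮ y → g ∼ᴮ y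
  ∼ᴮ-trans {g = g} (b , b-upper , b-inv , gb≈x) (b₂ , b₂-upper , b₂-inv , xb₂≈y) =
    b ⊗ b₂ , Upper-⊗ b-upper b₂-upper , Invertible-⊗ b-inv b₂-inv ,
    ≈ᴹ.trans (≈ᴹ.sym (⊗-assoc g b b₂)) (≈ᴹ.trans (⊗-congˡ b₂ gb≈x) xb₂≈y)

  ∼ᴮ-⊗ˡ : ∀ {n} (h : Mat n) {g x : Mat n} → g ∼ᴮ x → h ⊗ g ∼ᴮ h ⊗ x
  ∼ᴮ-⊗ˡ h {g} (b , b-upper , b-inv , gb≈x) = b , b-upper , b-inv , ≈ᴹ.trans (⊗-assoc h g b) (⊗-congʳ h gb≈x)

  Cell-cong : ∀ {n} {σ} {g g′ : Mat n} → g ≈ᴹ g′ → Cell σ g → Cell σ g′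
  Cell-cong e (l , u , l-lower , l-inv , u-upper , u-inv , lPu≈g) =
    l , u , l-lower , l-inv , u-upper , u-inv , ≈ᴹ.trans lPu≈g e

  Cell-≗ : ∀ {n} {σ τ : Fin n → Fin n} {g : Mat n} → σ ≗ τ → Cell σ g → Cell τ g
  Cell-≗ σ≗τ (l , u , l-lower , l-inv , u-upper , u-inv , lPu≈g) =
    l , u , l-lower , l-inv , u-upper , u-inv ,
    ≈ᴹ.trans (⊗-congˡ u (⊗-congʳ l (permMat-cong (sym ∘ σ≗τ)))) lPu≈g

  Cell-∼ᴮ : ∀ {n} {σ} {g x : Mat n} → Cell σ g → g ∼ᴮ x → Cell σ x
  Cell-∼ᴮ {σ = σ} (l , u , l-lower , l-inv , u-upper , u-inv , lPu≈g) (b , b-upper , b-inv , gb≈x) =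
    l , u ⊗ b , l-lower , l-inv , Upper-⊗ u-upper b-upper , Invertible-⊗ u-inv b-inv ,
    ≈ᴹ.trans (≈ᴹ.sym (⊗-assoc (l ⊗ permMat σ) u b)) (≈ᴹ.trans (⊗-congˡ b lPu≈g) gb≈x)

  Cell-lower⊗ : ∀ {n} {σ} {l′ g : Mat n} → Lower l′ → IsInvertible l′ → Cell σ g → Cell σ (l′ ⊗ g)
  Cell-lower⊗ {σ = σ} {l′} l′-lower l′-inv (l , u , l-lower , l-inv , u-upper , u-inv , lPu≈g) =
    l′ ⊗ l , u , Lower-⊗ l′-lower l-lower , Invertible-⊗ l′-inv l-inv , u-upper , u-inv ,
    ≈ᴹ.trans (⊗-congˡ u (⊗-assoc l′ l (permMat σ))) (≈ᴹ.trans (⊗-assoc l′ (l ⊗ permMat σ) u) (⊗-congʳ l′ lPu≈g))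

  Cell-lower⊗⁻ : ∀ {n} {σ} {l′ g : Mat n} → Lower l′ → IsInvertible l′ → Cell σ (l′ ⊗ g) → Cell σ g
  Cell-lower⊗⁻ {l′ = l′} {g} l′-lower l′-inv@(l″ , _ , l″l′≈I) c =
    Cell-cong (≈ᴹ.trans (≈ᴹ.sym (⊗-assoc l″ l′ g)) (≈ᴹ.trans (⊗-congˡ g l″l′≈I) (⊗-identityˡ g)))
              (Cell-lower⊗ (Lower-inverse l′-lower l′-inv) (Invertible-inverse l′-inv) c)

  Cell-permMat : ∀ {n} (σ : Fin n → Fin n) → Cell σ (permMat σ)
  Cell-permMat σ = I , I , Lower-I , Invertible-I , Upper-I , Invertible-I ,
                   ≈ᴹ.trans (⊗-identityʳ _) (⊗-identityˡ _)

  diag-⊗-permMat≈permMat-⊗-upper⇒≗ : ∀ {n} {σ τ : Fin n → Fin n} {L U : Mat n} → Injective _≡_ _≡_ σ →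
    (∀ r → L r r ≢ 0#) → Upper U → L ⊗ permMat σ ≈ᴹ permMat τ ⊗ U → σ ≗ τ
  diag-⊗-permMat≈permMat-⊗-upper⇒≗ {σ = σ} {τ} {L} {U} σ-inj L-diag U-upper LP≈PU =
    preimage-below⇒≗ σ-inj preimage
    where
    preimage : ∀ c → ∃[ k ] (k ≤ c × τ k ≡ σ c)
    preimage c with sumF≢0⇒∃≢0 (λ k → permMat τ (σ c) k * U k c)
                      (λ sum≡0 → L-diag (σ c) (trans (sym (⊗-permMat L σ (σ c) c)) (trans (LP≈PU (σ c) c) sum≡0)))
    ... | k , term≢0 = k , k≤c , sym σc≡τk
      where
      σc≡τk : σ c ≡ τ k
      σc≡τk with σ c ≟ τ k
      ... | yes e = e
      ... | no _  = contradiction (zeroˡ (U k c)) term≢0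
      k≤c : k ≤ c
      k≤c with FinP.<-cmp c k
      ... | tri< c<k _ _ = contradiction (trans (cong (_ *_) (U-upper k c c<k)) (zeroʳ _)) term≢0
      ... | tri≈ _ refl _ = FinP.≤-refl
      ... | tri> _ _ k<c = ℕP.<⇒≤ k<c

  Cell-unique : ∀ {n} {σ τ : Fin n → Fin n} {g : Mat n} → Injective _≡_ _≡_ σ → Cell σ g → Cell τ g → σ ≗ τ
  Cell-unique {σ = σ} {τ} {g} σ-inj (l , u , l-lower , l-inv , u-upper , u-inv , lPu≈g)
                                    (l′ , u′ , l′-lower , l′-inv@(l′⁻¹ , _ , l′⁻¹l′≈I) , u′-upper , u′-inv , l′Pu′≈g) =
    diag-⊗-permMat≈permMat-⊗-upper⇒≗ σ-inj
      (Lower-diag≢0 (Lower-⊗ (Lower-inverse l′-lower l′-inv) l-lower) (Invertible-⊗ (Invertible-inverse l′-inv) l-inv))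
      (Upper-⊗ u′-upper (Upper-inverse u-upper u-inv))
      LP≈PU
    where
    u⁻¹ = proj₁ u-inv
    LP≈PU : (l′⁻¹ ⊗ l) ⊗ permMat σ ≈ᴹ permMat τ ⊗ (u′ ⊗ u⁻¹)
    LP≈PU = begin
      (l′⁻¹ ⊗ l) ⊗ permMat σ
        ≈⟨ ⊗-assoc l′⁻¹ l (permMat σ) ⟩
      l′⁻¹ ⊗ (l ⊗ permMat σ)
        ≈⟨ ⊗-congʳ l′⁻¹ (⊗-identityʳ _) ⟨
      l′⁻¹ ⊗ ((l ⊗ permMat σ) ⊗ I)
        ≈⟨ ⊗-congʳ l′⁻¹ (⊗-congʳ _ (proj₁ (proj₂ u-inv))) ⟨
      l′⁻¹ ⊗ ((l ⊗ permMat σ) ⊗ (u ⊗ u⁻¹))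
        ≈⟨ ⊗-congʳ l′⁻¹ (⊗-assoc _ u u⁻¹) ⟨
      l′⁻¹ ⊗ ((l ⊗ permMat σ ⊗ u) ⊗ u⁻¹)
        ≈⟨ ⊗-congʳ l′⁻¹ (⊗-congˡ u⁻¹ (≈ᴹ.trans lPu≈g (≈ᴹ.sym l′Pu′≈g))) ⟩
      l′⁻¹ ⊗ ((l′ ⊗ permMat τ ⊗ u′) ⊗ u⁻¹)
        ≈⟨ ⊗-congʳ l′⁻¹ (⊗-assoc _ u′ u⁻¹) ⟩
      l′⁻¹ ⊗ ((l′ ⊗ permMat τ) ⊗ (u′ ⊗ u⁻¹))
        ≈⟨ ⊗-assoc l′⁻¹ _ _ ⟨
      (l′⁻¹ ⊗ (l′ ⊗ permMat τ)) ⊗ (u′ ⊗ u⁻¹)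
        ≈⟨ ⊗-congˡ _ (⊗-assoc l′⁻¹ l′ _) ⟨
      ((l′⁻¹ ⊗ l′) ⊗ permMat τ) ⊗ (u′ ⊗ u⁻¹)
        ≈⟨ ⊗-congˡ _ (⊗-congˡ _ l′⁻¹l′≈I) ⟩
      (I ⊗ permMat τ) ⊗ (u′ ⊗ u⁻¹)
        ≈⟨ ⊗-congˡ _ (⊗-identityˡ _) ⟩
      permMat τ ⊗ (u′ ⊗ u⁻¹) ∎
      where open ≈ᴹ-Reasoning

module Decidability {q : ℕ} (F : FiniteField q) where

  open Matrices F
  open BruhatCells F

  eqMat-sound : ∀ {n} {A B : Mat n} → eqMat A B ≡ true → A ≈ᴹ B
  eqMat-sound {A = A} {B} e r c = isYes-true⁻ (A r c ≟ᶠ B r c) (allF-true⁻ _ (allF-true⁻ _ e r) c)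

  eqMat-complete : ∀ {n} {A B : Mat n} → A ≈ᴹ B → eqMat A B ≡ true
  eqMat-complete {A = A} {B} e = allF-true⁺ _ (λ r → allF-true⁺ _ (λ c → isYes-true (A r c ≟ᶠ B r c) (e r c)))

  private
    implication-sound : ∀ {P : Set} {Q : Set} (p : Dec P) (q : Dec Q) →
                        not ⌊ p ⌋ ∨ ⌊ q ⌋ ≡ true → P → Q
    implication-sound (yes _) (yes y) _ _ = y
    implication-sound (no ¬x) _       _ x = contradiction x ¬x

    implication-complete : ∀ {P : Set} {Q : Set} (p : Dec P) (q : Dec Q) →
                           (P → Q) → not ⌊ p ⌋ ∨ ⌊ q ⌋ ≡ true
    implication-complete (yes x) (yes _) _   = refl
    implication-complete (yes x) (no ¬y) x⇒y = contradiction (x⇒y x) ¬y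
    implication-complete (no _)  _       _   = refl

  isUpper-sound : ∀ {n} {A : Mat n} → isUpper A ≡ true → Upper A
  isUpper-sound {A = A} e r c = implication-sound (c <? r) (A r c ≟ᶠ 0#) (allF-true⁻ _ (allF-true⁻ _ e r) c)

  isUpper-complete : ∀ {n} {A : Mat n} → Upper A → isUpper A ≡ true
  isUpper-complete {A = A} u =
    allF-true⁺ _ (λ r → allF-true⁺ _ (λ c → implication-complete (c <? r) (A r c ≟ᶠ 0#) (u r c)))

  isLower-sound : ∀ {n} {A : Mat n} → isLower A ≡ true → Lower A
  isLower-sound {A = A} e r c = implication-sound (r <? c) (A r c ≟ᶠ 0#) (allF-true⁻ _ (allF-true⁻ _ e r) c)

  isLower-complete : ∀ {n} {A : Mat n} → Lower A → isLower A ≡ true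
  isLower-complete {A = A} l =
    allF-true⁺ _ (λ r → allF-true⁺ _ (λ c → implication-complete (r <? c) (A r c ≟ᶠ 0#) (l r c)))

  allMats-complete : ∀ {n} (A : Mat n) → ∃[ A′ ] (A′ ∈ allMats n × A′ ≈ᴹ A)
  allMats-complete {n} A = allFuns-complete (allFuns elements n) (λ x y → x ≗ y) n A row
    where
    row : ∀ r → ∃[ x ] (x ∈ allFuns elements n × x ≗ A r)
    row r = allFuns-complete elements _≡_ n (A r) (λ c → A r c , complete (A r c) , refl)

  isInv-sound : ∀ {n} {A : Mat n} → isInv A ≡ true → IsInvertible A
  isInv-sound {n} {A} e with anyᵇ-true⁻ _ (allMats n) e
  ... | A′ , _ , both with ∧-true⁻ both
  ...   | AA′ , A′A = A′ , eqMat-sound AA′ , eqMat-sound A′A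

  isInv-complete : ∀ {n} {A : Mat n} → IsInvertible A → isInv A ≡ true
  isInv-complete {n} {A} (A′ , AA′ , A′A) with allMats-complete A′
  ... | A″ , A″∈ , A″≈A′ = anyᵇ-true⁺ _ A″∈
        (∧-true⁺ (eqMat-complete (≈ᴹ.trans (⊗-congʳ A A″≈A′) AA′))
                 (eqMat-complete (≈ᴹ.trans (⊗-congˡ A A″≈A′) A′A)))

  inB-sound : ∀ {n} {b : Mat n} → inB b ≡ true → Upper b × IsInvertible b
  inB-sound e = isUpper-sound (proj₁ (∧-true⁻ e)) , isInv-sound (proj₂ (∧-true⁻ e))

  inB-complete : ∀ {n} {b : Mat n} → Upper b → IsInvertible b → inB b ≡ true
  inB-complete u i = ∧-true⁺ (isUpper-complete u) (isInv-complete i)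

  inB⁻-sound : ∀ {n} {b : Mat n} → inB⁻ b ≡ true → Lower b × IsInvertible b
  inB⁻-sound e = isLower-sound (proj₁ (∧-true⁻ e)) , isInv-sound (proj₂ (∧-true⁻ e))

  inB⁻-complete : ∀ {n} {b : Mat n} → Lower b → IsInvertible b → inB⁻ b ≡ true
  inB⁻-complete l i = ∧-true⁺ (isLower-complete l) (isInv-complete i)

  sameCoset-sound : ∀ {n} {g x : Mat n} → sameCoset g x ≡ true → g ∼ᴮ x
  sameCoset-sound {n} e with anyᵇ-true⁻ _ (allMats n) e
  ... | b , _ , both with ∧-true⁻ both
  ...   | b∈B , gb≈x = b , proj₁ (inB-sound b∈B) , proj₂ (inB-sound b∈B) , eqMat-sound gb≈x

  sameCoset-complete : ∀ {n} {g x : Mat n} → g ∼ᴮ x → sameCoset g x ≡ true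
  sameCoset-complete {g = g} (b , b-upper , b-inv , gb≈x) with allMats-complete b
  ... | b′ , b′∈ , b′≈b = anyᵇ-true⁺ _ b′∈
        (∧-true⁺ (inB-complete (Upper-cong (≈ᴹ.sym b′≈b) b-upper) (Invertible-cong (≈ᴹ.sym b′≈b) b-inv))
                 (eqMat-complete (≈ᴹ.trans (⊗-congʳ g b′≈b) gb≈x)))

  inCell-sound : ∀ {n} {σ} {g : Mat n} → inCell σ g ≡ true → Cell σ g
  inCell-sound {n} e with anyᵇ-true⁻ _ (allMats n) e
  ... | l , _ , e′ with anyᵇ-true⁻ _ (allMats n) e′
  ...   | u , _ , all-three with ∧-true⁻ all-three
  ...     | l∈B⁻ , rest with ∧-true⁻ rest
  ...       | u∈B , lPu≈g = l , u , proj₁ (inB⁻-sound l∈B⁻) , proj₂ (inB⁻-sound l∈B⁻) ,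
                            proj₁ (inB-sound u∈B) , proj₂ (inB-sound u∈B) , eqMat-sound lPu≈g

  inCell-complete : ∀ {n} {σ} {g : Mat n} → Cell σ g → inCell σ g ≡ true
  inCell-complete {σ = σ} (l , u , l-lower , l-inv , u-upper , u-inv , lPu≈g)
    with allMats-complete l | allMats-complete u
  ... | l′ , l′∈ , l′≈l | u′ , u′∈ , u′≈u = anyᵇ-true⁺ _ l′∈ (anyᵇ-true⁺ _ u′∈
        (∧-true⁺ (inB⁻-complete (Lower-cong (≈ᴹ.sym l′≈l) l-lower) (Invertible-cong (≈ᴹ.sym l′≈l) l-inv))
        (∧-true⁺ (inB-complete (Upper-cong (≈ᴹ.sym u′≈u) u-upper) (Invertible-cong (≈ᴹ.sym u′≈u) u-inv))
                 (eqMat-complete (≈ᴹ.trans (⊗-cong (⊗-congˡ (permMat σ) l′≈l) u′≈u) lPu≈g)))))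

  inCell-≡ : ∀ {n} {σ σ′} {g g′ : Mat n} → (Cell σ g → Cell σ′ g′) → (Cell σ′ g′ → Cell σ g) →
             inCell σ g ≡ inCell σ′ g′
  inCell-≡ to from = ⇔-true⇒≡ (inCell-complete ∘′ to ∘′ inCell-sound)
                              (inCell-complete ∘′ from ∘′ inCell-sound)

  sameCoset-≡ : ∀ {n} {g x g′ x′ : Mat n} → (g ∼ᴮ x → g′ ∼ᴮ x′) → (g′ ∼ᴮ x′ → g ∼ᴮ x) →
                sameCoset g x ≡ sameCoset g′ x′
  sameCoset-≡ to from = ⇔-true⇒≡ (sameCoset-complete ∘′ to ∘′ sameCoset-sound)
                                 (sameCoset-complete ∘′ from ∘′ sameCoset-sound)

  Cell-dec : ∀ {n} (x : Mat n) →
             (∃[ σ ] (Injective _≡_ _≡_ σ × Cell σ x)) ⊎ (∀ σ → Injective _≡_ _≡_ σ → ¬ Cell σ x)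
  Cell-dec {n} x with anyᵇ (λ σ → inCell σ x) (allPerms n) in found
  ... | true with anyᵇ-true⁻ _ (allPerms n) found
  ...   | σ , σ∈ , σ-cell = inj₁ (σ , allPerms-injective σ∈ , inCell-sound σ-cell)
  Cell-dec {n} x | false = inj₂ none
    where
    none : ∀ σ → Injective _≡_ _≡_ σ → ¬ Cell σ x
    none σ σ-inj σ-cell with allPerms-complete σ σ-inj
    ... | σ′ , σ′∈ , σ′≗σ = contradiction (trans (sym (inCell-complete (Cell-≗ (sym ∘ σ′≗σ) σ-cell)))
                                                 (anyᵇ-false⁻ _ (allPerms n) found σ′∈)) (λ ())

  inCell-exact : ∀ {n} {τ : Fin n → Fin n} {X : Mat n} → Injective _≡_ _≡_ τ → Cell τ X →
                 ∀ π → inCell π X ≡ eqPerm τ π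
  inCell-exact τ-inj τ-cell π = ⇔-true⇒≡ (λ e → eqPerm-complete (Cell-unique τ-inj τ-cell (inCell-sound e)))
                                          (λ e → inCell-complete (Cell-≗ (eqPerm-sound e) τ-cell))

  inCell-∼ᴮ : ∀ {n} {π} {g x : Mat n} → g ∼ᴮ x → inCell π g ≡ inCell π x
  inCell-∼ᴮ g∼x = inCell-≡ (λ c → Cell-∼ᴮ c g∼x) (λ c → Cell-∼ᴮ c (∼ᴮ-sym g∼x))

  inCell-lower⊗ : ∀ {n} {π} {l g : Mat n} → Lower l → IsInvertible l → inCell π (l ⊗ g) ≡ inCell π g
  inCell-lower⊗ l-lower l-inv = inCell-≡ (Cell-lower⊗⁻ l-lower l-inv) (Cell-lower⊗ l-lower l-inv)

module FieldSums {q : ℕ} (F : FiniteField q) where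

  open Matrices F

  recip : Carrier → Carrier
  recip t with t ≟ᶠ 0#
  ... | yes _   = 0#
  ... | no t≢0  = (t ⁻¹) t≢0

  recip-inverseʳ : ∀ t → t ≢ 0# → t * recip t ≡ 1#
  recip-inverseʳ t t≢0 with t ≟ᶠ 0#
  ... | yes t≡0 = contradiction t≡0 t≢0
  ... | no t≢0′ = *-inverseʳ t t≢0′

  recip-inverseˡ : ∀ t → t ≢ 0# → recip t * t ≡ 1#
  recip-inverseˡ t t≢0 = trans (*-comm _ t) (recip-inverseʳ t t≢0)

  private
    inverse-unique : ∀ u t y → u * t ≡ 1# → u * y ≡ 1# → y ≡ t
    inverse-unique u t y ut≡1 uy≡1 = begin
      y              ≡⟨ *-identityˡ y ⟨
      1# * y         ≡⟨ cong (_* y) (trans (*-comm t u) ut≡1) ⟨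
      t * u * y      ≡⟨ *-assoc t u y ⟩
      t * (u * y)    ≡⟨ cong (t *_) uy≡1 ⟩
      t * 1#         ≡⟨ *-identityʳ t ⟩
      t              ∎
      where open ≡-Reasoning

  recip-0 : recip 0# ≡ 0#
  recip-0 with 0# ≟ᶠ 0#
  ... | yes _   = refl
  ... | no 0≢0  = contradiction refl 0≢0

  recip-involutive : ∀ t → recip (recip t) ≡ t
  recip-involutive t with t ≟ᶠ 0#
  ... | yes refl = recip-0
  ... | no t≢0 = inverse-unique ((t ⁻¹) t≢0) t _ (*-inverseˡ t t≢0)
                                (recip-inverseʳ _ (unit⇒≢0 _ _ (*-inverseˡ t t≢0)))

  ∑-recip : (G : Carrier → ℤ) → ∑ elements (G ∘ recip) ≡ ∑ elements G
  ∑-recip G = ∑-bijection elements recip recip G unique complete recip-involutive recip-involutive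

  nonzeroElems-≢0 : ∀ {t} → t ∈ nonzeroElems → t ≢ 0#
  nonzeroElems-≢0 {t} t∈ with t ≟ᶠ 0# | proj₂ (∈-filterᵇ⁻ (λ t → not ⌊ t ≟ᶠ 0# ⌋) {elements} t∈)
  ... | no t≢0 | _ = t≢0

  ∈-nonzeroElems : ∀ {t} → t ≢ 0# → t ∈ nonzeroElems
  ∈-nonzeroElems {t} t≢0 = ∈-filterᵇ⁺ _ (complete t) (cong not (isYes-false (t ≟ᶠ 0#) t≢0))

  ∑-elements : (G : Carrier → ℤ) → ∑ elements G ≡ G 0# +ᶻ ∑ nonzeroElems G
  ∑-elements G = ∑-reindex G unique (All.tabulate (λ t∈ 0≡t → nonzeroElems-≢0 t∈ (sym 0≡t)) ∷ nonzero-unique)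
                   (λ {t} _ → zero-or-not t) (λ {t} _ → complete t)
    where
    nonzero-unique : Unique nonzeroElems
    nonzero-unique = Unique.filter⁺ (T? ∘ (λ t → not ⌊ t ≟ᶠ 0# ⌋)) unique
    zero-or-not : ∀ t → t ∈ 0# ∷ nonzeroElems
    zero-or-not t with t ≟ᶠ 0#
    ... | yes t≡0 = here t≡0
    ... | no t≢0  = there (∈-nonzeroElems t≢0)

  length-nonzeroElems : + length nonzeroElems ≡ + q -ᶻ + 1
  length-nonzeroElems = trans (1+y-1≡y (+ length nonzeroElems)) (cong (_-ᶻ + 1) (sym q≡1+length))
    where
    open ≡-Reasoning
    1+y-1≡y : ∀ y → y ≡ + 1 +ᶻ y -ᶻ + 1
    1+y-1≡y = solve-∀
    count : ∀ xs → ∑ xs (λ (_ : Carrier) → + 1) ≡ + length xs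
    count xs = trans (∑-const xs (+ 1)) (ℤP.*-identityʳ _)
    q≡1+length : + q ≡ + 1 +ᶻ + length nonzeroElems
    q≡1+length = begin
      + q                                       ≡⟨ cong +_ card ⟨
      + length elements                         ≡⟨ count elements ⟨
      ∑ elements (λ _ → + 1)                    ≡⟨ ∑-elements (λ _ → + 1) ⟩
      + 1 +ᶻ ∑ nonzeroElems (λ _ → + 1)         ≡⟨ cong (+ 1 +ᶻ_) (count nonzeroElems) ⟩
      + 1 +ᶻ + length nonzeroElems              ∎

module SimpleReflection {q : ℕ} (F : FiniteField q) {m : ℕ} (i : Fin m) where

  open Matrices F
  open BruhatCells F

  private
    n = suc m
    I′ = inject₁ i
    S = suc i
    S≢I : S ≢ I′
    S≢I = inject₁≢suc i ∘ sym

  fMat≈transvection : ∀ t → fMat i t ≈ᴹ transvection S I′ t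
  fMat≈transvection t r c with r ≟ S | c ≟ I′
  ... | yes refl | yes refl = sym (trans (cong (_+ t) (I-off S≢I)) (+-identityˡ t))
  ... | yes refl | no _     = sym (+-identityʳ _)
  ... | no _     | yes _    = sym (+-identityʳ _)
  ... | no _     | no _     = sym (+-identityʳ _)

  sMat-⊗ : ∀ (A : Mat n) r c → (sMat i ⊗ A) r c ≡ A (swap i r) c
  sMat-⊗ A r c = trans (sumF-single _ (swap i r) off) (trans (cong (_* A (swap i r) c) one) (*-identityˡ _))
    where
    off : ∀ k → k ≢ swap i r → sMat i r k * A k c ≡ 0#
    off k k≢sr = trans (cong (_* A k c) (I-off (λ r≡sk →
                   k≢sr (trans (sym (swap-involutive i k)) (cong (swap i) (sym r≡sk))))))
                       (zeroˡ _)
    one : sMat i r (swap i r) ≡ 1#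
    one = trans (cong (I r) (swap-involutive i r)) (I-diag r)

  sMat-involutive : sMat i ⊗ sMat i ≈ᴹ I
  sMat-involutive r c = trans (permMat-⊗-permMat (swap i) (swap i) r c) (cong (I r) (swap-involutive i c))

  u : Carrier → Mat n
  u a = transvection I′ S a

  Y : Carrier → Mat n
  Y a = u a ⊗ sMat i

  Y⁻¹ : Carrier → Mat n
  Y⁻¹ a = sMat i ⊗ u (- a)

  Upper-u : ∀ a → Upper (u a)
  Upper-u = Upper-transvection I′ S (inject₁<suc i)

  Invertible-u : ∀ a → IsInvertible (u a)
  Invertible-u = Invertible-transvection I′ S (inject₁≢suc i)

  u-inverse : ∀ a → u a ⊗ u (- a) ≈ᴹ I × u (- a) ⊗ u a ≈ᴹ I
  u-inverse a = proj₂ (Invertible-u a)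

  Y⊗Y⁻¹ : ∀ a → Y a ⊗ Y⁻¹ a ≈ᴹ I
  Y⊗Y⁻¹ a = begin
    (u a ⊗ sMat i) ⊗ (sMat i ⊗ u (- a))   ≈⟨ ⊗-assoc (u a) (sMat i) _ ⟩
    u a ⊗ (sMat i ⊗ (sMat i ⊗ u (- a)))   ≈⟨ ⊗-congʳ (u a) (⊗-assoc (sMat i) (sMat i) _) ⟨
    u a ⊗ ((sMat i ⊗ sMat i) ⊗ u (- a))   ≈⟨ ⊗-congʳ (u a) (⊗-congˡ (u (- a)) sMat-involutive) ⟩
    u a ⊗ (I ⊗ u (- a))                   ≈⟨ ⊗-congʳ (u a) (⊗-identityˡ _) ⟩
    u a ⊗ u (- a)                         ≈⟨ proj₁ (u-inverse a) ⟩
    I                                     ∎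
    where open ≈ᴹ-Reasoning

  Y⁻¹⊗Y : ∀ a → Y⁻¹ a ⊗ Y a ≈ᴹ I
  Y⁻¹⊗Y a = begin
    (sMat i ⊗ u (- a)) ⊗ (u a ⊗ sMat i)   ≈⟨ ⊗-assoc (sMat i) (u (- a)) _ ⟩
    sMat i ⊗ (u (- a) ⊗ (u a ⊗ sMat i))   ≈⟨ ⊗-congʳ (sMat i) (⊗-assoc (u (- a)) (u a) _) ⟨
    sMat i ⊗ ((u (- a) ⊗ u a) ⊗ sMat i)   ≈⟨ ⊗-congʳ (sMat i) (⊗-congˡ (sMat i) (proj₂ (u-inverse a))) ⟩
    sMat i ⊗ (I ⊗ sMat i)                 ≈⟨ ⊗-congʳ (sMat i) (⊗-identityˡ _) ⟩
    sMat i ⊗ sMat i                       ≈⟨ sMat-involutive ⟩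
    I                                     ∎
    where open ≈ᴹ-Reasoning

  Invertible-Y : ∀ a → IsInvertible (Y a)
  Invertible-Y a = Y⁻¹ a , Y⊗Y⁻¹ a , Y⁻¹⊗Y a

  Y-0 : Y 0# ≈ᴹ sMat i
  Y-0 = ≈ᴹ.trans (⊗-congˡ (sMat i) (transvection-0 I′ S)) (⊗-identityˡ _)

  Y0∼ᴮY⁻¹ : ∀ a → Y 0# ∼ᴮ Y⁻¹ a
  Y0∼ᴮY⁻¹ a = u (- a) , Upper-u (- a) , Invertible-u (- a) , ⊗-congˡ (u (- a)) Y-0

  private
    Y⁻¹-⊗ : ∀ a (X : Mat n) r c →
            (Y⁻¹ a ⊗ X) r c ≡ X (swap i r) c + (if ⌊ swap i r ≟ I′ ⌋ then - a * X S c else 0#)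
    Y⁻¹-⊗ a X r c = trans (⊗-assoc (sMat i) (u (- a)) X r c)
                          (trans (sMat-⊗ (u (- a) ⊗ X) r c) (transvection-⊗ I′ S (- a) X (swap i r) c))

    ⊗-Y : ∀ a (X : Mat n) r c →
          (X ⊗ Y a) r c ≡ X r (swap i c) + (if ⌊ swap i c ≟ S ⌋ then X r I′ * a else 0#)
    ⊗-Y a X r c = trans (≈ᴹ.sym (⊗-assoc X (u a) (sMat i)) r c)
                        (trans (⊗-permMat (X ⊗ u a) (swap i) r c) (⊗-transvection I′ S a X r (swap i c)))

  module _ (a : Carrier) (X : Mat n) where

    Y⁻¹-⊗-inject₁ : ∀ c → (Y⁻¹ a ⊗ X) I′ c ≡ X S c
    Y⁻¹-⊗-inject₁ c = trans (Y⁻¹-⊗ a X I′ c)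
      (trans (cong (λ z → X z c + (if ⌊ z ≟ I′ ⌋ then - a * X S c else 0#)) (swap-inject₁ i))
             (trans (cong (_+_ (X S c)) (if-≢ S≢I)) (+-identityʳ _)))

    Y⁻¹-⊗-suc : ∀ c → (Y⁻¹ a ⊗ X) S c ≡ X I′ c + - a * X S c
    Y⁻¹-⊗-suc c = trans (Y⁻¹-⊗ a X S c)
      (trans (cong (λ z → X z c + (if ⌊ z ≟ I′ ⌋ then - a * X S c else 0#)) (swap-suc i))
             (cong (_+_ (X I′ c)) (if-≡ {r = I′} refl)))

    Y⁻¹-⊗-other : ∀ {r} c → r ≢ I′ → r ≢ S → (Y⁻¹ a ⊗ X) r c ≡ X r c
    Y⁻¹-⊗-other {r} c r≢I r≢S = trans (Y⁻¹-⊗ a X r c)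
      (trans (cong (λ z → X z c + (if ⌊ z ≟ I′ ⌋ then - a * X S c else 0#)) (swap-other i r≢I r≢S))
             (trans (cong (_+_ (X r c)) (if-≢ r≢I)) (+-identityʳ _)))

    ⊗-Y-inject₁ : ∀ r → (X ⊗ Y a) r I′ ≡ X r S + X r I′ * a
    ⊗-Y-inject₁ r = trans (⊗-Y a X r I′)
      (trans (cong (λ z → X r z + (if ⌊ z ≟ S ⌋ then X r I′ * a else 0#)) (swap-inject₁ i))
             (cong (_+_ (X r S)) (if-≡ {r = S} refl)))

    ⊗-Y-suc : ∀ r → (X ⊗ Y a) r S ≡ X r I′
    ⊗-Y-suc r = trans (⊗-Y a X r S)
      (trans (cong (λ z → X r z + (if ⌊ z ≟ S ⌋ then X r I′ * a else 0#)) (swap-suc i))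
             (trans (cong (_+_ (X r I′)) (if-≢ (inject₁≢suc i))) (+-identityʳ _)))

    ⊗-Y-other : ∀ r {c} → c ≢ I′ → c ≢ S → (X ⊗ Y a) r c ≡ X r c
    ⊗-Y-other r {c} c≢I c≢S = trans (⊗-Y a X r c)
      (trans (cong (λ z → X r z + (if ⌊ z ≟ S ⌋ then X r I′ * a else 0#)) (swap-other i c≢I c≢S))
             (trans (cong (_+_ (X r c)) (if-≢ c≢S)) (+-identityʳ _)))

  -- Y⁻¹ a ⊗ X is X with rows i and i + 1 exchanged after subtracting a·(row i + 1) from row i,
  -- so its triangularity only involves the entry (i + 1, i) of X.
  UpperOffCorner : Mat n → Set
  UpperOffCorner X = ∀ r c → c < r → (r , c) ≢ (S , I′) → X r c ≡ 0#

  Upper-Y⁻¹-⊗ : ∀ a (X : Mat n) → UpperOffCorner X → X I′ I′ ≡ a * X S I′ → Upper (Y⁻¹ a ⊗ X)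
  Upper-Y⁻¹-⊗ a X off corner r c c<r with swapView i r
  ... | at-inject₁ refl = trans (Y⁻¹-⊗-inject₁ a X c)
                                (off S c (FinP.<-trans c<r (inject₁<suc i)) (λ e → FinP.<⇒≢ c<r (cong proj₂ e)))
  ... | elsewhere r≢I r≢S = trans (Y⁻¹-⊗-other a X c r≢I r≢S) (off r c c<r (r≢S ∘ cong proj₁))
  ... | at-suc refl with c ≟ I′
  ...   | yes refl = begin
    (Y⁻¹ a ⊗ X) S I′               ≡⟨ Y⁻¹-⊗-suc a X I′ ⟩
    X I′ I′ + - a * X S I′         ≡⟨ cong₂ _+_ corner (sym (-‿distribˡ-* a (X S I′))) ⟩
    a * X S I′ + - (a * X S I′)    ≡⟨ -‿inverseʳ _ ⟩
    0#                             ∎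
    where open ≡-Reasoning
  ...   | no c≢I = begin
    (Y⁻¹ a ⊗ X) S c                ≡⟨ Y⁻¹-⊗-suc a X c ⟩
    X I′ c + - a * X S c           ≡⟨ cong₂ (λ x y → x + - a * y) (off I′ c c<I (inject₁≢suc i ∘ cong proj₁))
                                                                   (off S c c<r (c≢I ∘ cong proj₂)) ⟩
    0# + - a * 0#                  ≡⟨ +-identityˡ _ ⟩
    - a * 0#                       ≡⟨ zeroʳ _ ⟩
    0#                             ∎
    where
    open ≡-Reasoning
    c<I : c < I′
    c<I = <suc⇒<inject₁ i c≢I c<r

  Y∼ᴮ : ∀ a {X : Mat n} → IsInvertible X → UpperOffCorner X → X I′ I′ ≡ a * X S I′ → Y a ∼ᴮ X
  Y∼ᴮ a {X} X-inv off corner =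
    Y⁻¹ a ⊗ X , Upper-Y⁻¹-⊗ a X off corner , Invertible-⊗ (Y a , Y⁻¹⊗Y a , Y⊗Y⁻¹ a) X-inv ,
    ≈ᴹ.trans (≈ᴹ.sym (⊗-assoc (Y a) (Y⁻¹ a) X)) (≈ᴹ.trans (⊗-congˡ X (Y⊗Y⁻¹ a)) (⊗-identityˡ X))

  Y-injective : ∀ a a′ {b : Mat n} → Upper b → Y a ⊗ b ≈ᴹ Y a′ → a ≡ a′
  Y-injective a a′ {b} b-upper Yb≈Y′ = sym (begin
    a′                      ≡⟨ +-identityʳ a′ ⟨
    a′ + 0#                 ≡⟨ cong (_+_ a′) (-‿inverseˡ a) ⟨
    a′ + (- a + a)          ≡⟨ +-assoc a′ (- a) a ⟨
    a′ + - a + a            ≡⟨ cong (_+ a) corner≡0 ⟩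
    0# + a                  ≡⟨ +-identityˡ a ⟩
    a                       ∎)
    where
    open ≡-Reasoning
    b≈ : b ≈ᴹ Y⁻¹ a ⊗ Y a′
    b≈ = ⊗-cancelˡ (Invertible-Y a) (≈ᴹ.trans Yb≈Y′ (≈ᴹ.sym (≈ᴹ.trans (≈ᴹ.sym (⊗-assoc (Y a) (Y⁻¹ a) (Y a′)))
                                                   (≈ᴹ.trans (⊗-congˡ (Y a′) (Y⊗Y⁻¹ a)) (⊗-identityˡ (Y a′))))))
    Y′-corner : Y a′ I′ I′ ≡ a′
    Y′-corner = trans (⊗-permMat (u a′) (swap i) I′ I′)
                      (trans (cong (u a′ I′) (swap-inject₁ i))
                             (trans (transvection-at I′ S a′)
                                    (trans (cong (_+ a′) (I-off (inject₁≢suc i))) (+-identityˡ a′))))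
    Y′-diag : Y a′ S I′ ≡ 1#
    Y′-diag = trans (⊗-permMat (u a′) (swap i) S I′)
                    (trans (cong (u a′ S) (swap-inject₁ i)) (trans (transvection-offRow I′ S a′ S S≢I) (I-diag S)))
    corner≡0 : a′ + - a ≡ 0#
    corner≡0 = begin
      a′ + - a                        ≡⟨ cong (_+_ a′) (*-identityʳ (- a)) ⟨
      a′ + - a * 1#                   ≡⟨ cong₂ (λ x y → x + - a * y) Y′-corner Y′-diag ⟨
      Y a′ I′ I′ + - a * Y a′ S I′    ≡⟨ Y⁻¹-⊗-suc a (Y a′) I′ ⟨
      (Y⁻¹ a ⊗ Y a′) S I′             ≡⟨ b≈ S I′ ⟨
      b S I′                          ≡⟨ b-upper S I′ (inject₁<suc i) ⟩
      0#                              ∎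

  Y∼ᴮfMat : ∀ a t → a * t ≡ 1# → Y a ∼ᴮ fMat i t
  Y∼ᴮfMat a t at≡1 = Y∼ᴮ a f-inv off (trans f-II (trans (sym at≡1) (cong (a *_) (sym f-SI))))
    where
    f-inv : IsInvertible (fMat i t)
    f-inv = Invertible-cong (≈ᴹ.sym (fMat≈transvection t)) (Invertible-transvection S I′ S≢I t)
    off : UpperOffCorner (fMat i t)
    off r c c<r rc≢SI = trans (fMat≈transvection t r c) (trans (offCorner (r ≟ S)) (I-off (FinP.<⇒≢ c<r ∘ sym)))
      where
      offCorner : Dec (r ≡ S) → transvection S I′ t r c ≡ I r c
      offCorner (yes refl) = transvection-offColumn S I′ t r (λ c≡I → rc≢SI (cong (S ,_) c≡I))
      offCorner (no r≢S)   = transvection-offRow S I′ t c r≢S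
    f-II : fMat i t I′ I′ ≡ 1#
    f-II = trans (fMat≈transvection t I′ I′) (trans (transvection-offRow S I′ t I′ (inject₁≢suc i)) (I-diag I′))
    f-SI : fMat i t S I′ ≡ t
    f-SI = trans (fMat≈transvection t S I′)
                 (trans (transvection-at S I′ t) (trans (cong (_+ t) (I-off S≢I)) (+-identityˡ t)))

  module _ {b : Mat n} (b-upper : Upper b) (b-inv : IsInvertible b) where

    private
      α = b I′ I′
      β = b I′ S
      d = b S S
      α≢0 : α ≢ 0#
      α≢0 = Upper-diag≢0 b-upper b-inv I′
      d≢0 : d ≢ 0#
      d≢0 = Upper-diag≢0 b-upper b-inv S
      α⁻¹ = (α ⁻¹) α≢0
      d⁻¹ = (d ⁻¹) d≢0

      *-cancelʳ : ∀ x y (y≢0 : y ≢ 0#) → x * y * (y ⁻¹) y≢0 ≡ x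
      *-cancelʳ x y y≢0 = trans (*-assoc x y _) (trans (cong (x *_) (*-inverseʳ y y≢0)) (*-identityʳ x))

      *-cancelʳ′ : ∀ x y (y≢0 : y ≢ 0#) → x * (y ⁻¹) y≢0 * y ≡ x
      *-cancelʳ′ x y y≢0 = trans (*-assoc x _ y) (trans (cong (x *_) (*-inverseˡ y y≢0)) (*-identityʳ x))

      +-cancelʳ : ∀ x y → x + - y + y ≡ x
      +-cancelʳ x y = trans (+-assoc x (- y) y) (trans (cong (_+_ x) (-‿inverseˡ y)) (+-identityʳ x))

      +-cancelʳ′ : ∀ x y → x + y + - y ≡ x
      +-cancelʳ′ x y = trans (+-assoc x y (- y)) (trans (cong (_+_ x) (-‿inverseʳ y)) (+-identityʳ x))

    -- On rows and columns i, i + 1 the matrix b is [[α, β], [0, d]], and b ⊗ Y t ∈ Y (φ t) B.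
    φ : Carrier → Carrier
    φ t = (α * t + β) * d⁻¹

    φ⁻¹ : Carrier → Carrier
    φ⁻¹ y = (y * d + - β) * α⁻¹

    φ∘φ⁻¹ : ∀ y → φ (φ⁻¹ y) ≡ y
    φ∘φ⁻¹ y = begin
      (α * ((y * d + - β) * α⁻¹) + β) * d⁻¹
        ≡⟨ cong (λ z → (z + β) * d⁻¹) (trans (*-comm α _) (*-cancelʳ′ _ α α≢0)) ⟩
      (y * d + - β + β) * d⁻¹
        ≡⟨ cong (_* d⁻¹) (+-cancelʳ (y * d) β) ⟩
      y * d * d⁻¹
        ≡⟨ *-cancelʳ y d d≢0 ⟩
      y ∎
      where open ≡-Reasoning

    φ⁻¹∘φ : ∀ t → φ⁻¹ (φ t) ≡ t
    φ⁻¹∘φ t = begin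
      ((α * t + β) * d⁻¹ * d + - β) * α⁻¹     ≡⟨ cong (λ z → (z + - β) * α⁻¹) (*-cancelʳ′ _ d d≢0) ⟩
      (α * t + β + - β) * α⁻¹                 ≡⟨ cong (_* α⁻¹) (+-cancelʳ′ (α * t) β) ⟩
      α * t * α⁻¹                             ≡⟨ cong (_* α⁻¹) (*-comm α t) ⟩
      t * α * α⁻¹                             ≡⟨ *-cancelʳ t α α≢0 ⟩
      t                                       ∎
      where open ≡-Reasoning

    Y∼ᴮupper⊗Y : ∀ t → Y (φ t) ∼ᴮ b ⊗ Y t
    Y∼ᴮupper⊗Y t = Y∼ᴮ (φ t) (Invertible-⊗ b-inv (Invertible-Y t)) off corner
      where
      off : UpperOffCorner (b ⊗ Y t)
      off r c c<r rc≢SI with swapView i c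
      ... | at-inject₁ refl = trans (⊗-Y-inject₁ t b r)
              (trans (cong₂ (λ x y → x + y * t) (b-upper r S S<r) (b-upper r I′ c<r))
                     (trans (+-identityˡ _) (zeroˡ t)))
        where
        S<r : S < r
        S<r = inject₁<⇒suc< i (λ r≡S → rc≢SI (cong (_, I′) r≡S)) c<r
      ... | at-suc refl = trans (⊗-Y-suc t b r) (b-upper r I′ (FinP.<-trans (inject₁<suc i) c<r))
      ... | elsewhere c≢I c≢S = trans (⊗-Y-other t b r c≢I c≢S) (b-upper r c c<r)
      corner : (b ⊗ Y t) I′ I′ ≡ φ t * (b ⊗ Y t) S I′
      corner = begin
        (b ⊗ Y t) I′ I′              ≡⟨ ⊗-Y-inject₁ t b I′ ⟩
        β + α * t                    ≡⟨ +-comm β (α * t) ⟩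
        α * t + β                    ≡⟨ *-cancelʳ′ (α * t + β) d d≢0 ⟨
        φ t * d                      ≡⟨ cong (φ t *_) d≡ ⟩
        φ t * (b ⊗ Y t) S I′         ∎
        where
        open ≡-Reasoning
        d≡ : d ≡ (b ⊗ Y t) S I′
        d≡ = sym (trans (⊗-Y-inject₁ t b S)
                        (trans (cong (λ z → d + z * t) (b-upper S I′ (inject₁<suc i)))
                               (trans (cong (_+_ d) (zeroˡ t)) (+-identityʳ d))))

  module _ (σ : Fin n → Fin n) (σ-inj : Injective _≡_ _≡_ σ) where

    permMat-⊗-Y : ∀ a → permMat σ ⊗ Y a ≈ᴹ transvection (σ I′) (σ S) a ⊗ permMat (σ ∘ swap i)
    permMat-⊗-Y a = begin
      permMat σ ⊗ (u a ⊗ sMat i)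
        ≈⟨ ⊗-assoc (permMat σ) (u a) (sMat i) ⟨
      (permMat σ ⊗ u a) ⊗ sMat i
        ≈⟨ ⊗-congˡ (sMat i) (permMat-⊗-transvection σ σ-inj I′ S a) ⟩
      (transvection (σ I′) (σ S) a ⊗ permMat σ) ⊗ sMat i
        ≈⟨ ⊗-assoc _ (permMat σ) (sMat i) ⟩
      transvection (σ I′) (σ S) a ⊗ (permMat σ ⊗ sMat i)
        ≈⟨ ⊗-congʳ _ (permMat-⊗-permMat σ (swap i)) ⟩
      transvection (σ I′) (σ S) a ⊗ permMat (σ ∘ swap i) ∎
      where open ≈ᴹ-Reasoning

    Cell-permMat⊗Y-descent : σ S < σ I′ → ∀ a → Cell (σ ∘ swap i) (permMat σ ⊗ Y a)
    Cell-permMat⊗Y-descent descent a = Cell-cong (≈ᴹ.sym (permMat-⊗-Y a))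
      (Cell-lower⊗ (Lower-transvection _ _ descent a) (Invertible-transvection _ _ (inject₁≢suc i ∘ σ-inj) a)
                   (Cell-permMat (σ ∘ swap i)))

    Cell-permMat⊗Y-0 : Cell (σ ∘ swap i) (permMat σ ⊗ Y 0#)
    Cell-permMat⊗Y-0 = Cell-cong (≈ᴹ.sym (≈ᴹ.trans (⊗-congʳ (permMat σ) Y-0) (permMat-⊗-permMat σ (swap i))))
                                 (Cell-permMat (σ ∘ swap i))

    Cell-permMat⊗fMat-ascent : σ I′ < σ S → ∀ t → Cell σ (permMat σ ⊗ fMat i t)
    Cell-permMat⊗fMat-ascent ascent t =
      Cell-cong (≈ᴹ.sym (≈ᴹ.trans (⊗-congʳ (permMat σ) (fMat≈transvection t))
                                  (permMat-⊗-transvection σ σ-inj S I′ t)))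
        (Cell-lower⊗ (Lower-transvection _ _ ascent t) (Invertible-transvection _ _ (S≢I ∘ σ-inj) t) (Cell-permMat σ))

    Cell-permMat⊗Y-ascent : σ I′ < σ S → ∀ a → a ≢ 0# → Cell σ (permMat σ ⊗ Y a)
    Cell-permMat⊗Y-ascent ascent a a≢0 =
      Cell-∼ᴮ (Cell-permMat⊗fMat-ascent ascent ((a ⁻¹) a≢0))
              (∼ᴮ-⊗ˡ (permMat σ) (∼ᴮ-sym (Y∼ᴮfMat a _ (*-inverseʳ a a≢0))))

    Cell-permMat⊗Y : ∀ a → ∃[ τ ] (Injective _≡_ _≡_ τ × Cell τ (permMat σ ⊗ Y a))
    Cell-permMat⊗Y a with FinP.<-cmp (σ S) (σ I′) | a ≟ᶠ 0#
    ... | tri< descent _ _ | _        = σ ∘ swap i , ∘swap-injective i σ-inj , Cell-permMat⊗Y-descent descent a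
    ... | _                | yes refl = σ ∘ swap i , ∘swap-injective i σ-inj , Cell-permMat⊗Y-0
    ... | tri≈ _ σS≡σI _   | no _     = contradiction (σ-inj σS≡σI) S≢I
    ... | tri> _ _ ascent  | no a≢0   = σ , σ-inj , Cell-permMat⊗Y-ascent ascent a a≢0

module CellCounts {q : ℕ} (F : FiniteField q) {m : ℕ} (i : Fin m) where

  open Matrices F
  open BruhatCells F
  open Decidability F
  open FieldSums F
  open SimpleReflection F i

  private
    n = suc m
    I′ = inject₁ i
    S = suc i

  Perm : Set
  Perm = Fin n → Fin n

  -- Tᵢ f σ pairs f with σ·Tᵢ, so Tcoeff σ π is the coefficient of π in σ·Tᵢ.
  Tᵢ : (Perm → ℤ) → Perm → ℤ
  Tᵢ f σ = if ⌊ σ S <? σ I′ ⌋ then + q *ᶻ f (σ ∘ swap i) else f (σ ∘ swap i) +ᶻ (+ q -ᶻ + 1) *ᶻ f σ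

  Tcoeff : Perm → Perm → ℤ
  Tcoeff σ π = Tᵢ (λ ρ → 𝟙 (eqPerm ρ π)) σ

  cellCount : Mat n → Perm → ℤ
  cellCount x π = ∑ elements (λ a → 𝟙 (inCell π (x ⊗ Y a)))

  cellCount-permMat : ∀ {σ} → Injective _≡_ _≡_ σ → ∀ π → cellCount (permMat σ) π ≡ Tcoeff σ π
  cellCount-permMat {σ} σ-inj π with σ S <? σ I′
  ... | yes descent = begin
    ∑ elements (λ a → 𝟙 (inCell π (permMat σ ⊗ Y a)))
      ≡⟨ ∑-cong elements (λ a → cong 𝟙 (inCell-exact σs-inj (Cell-permMat⊗Y-descent σ σ-inj descent a) π)) ⟩
    ∑ elements (λ _ → 𝟙 (eqPerm (σ ∘ swap i) π))
      ≡⟨ ∑-const elements _ ⟩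
    + length elements *ᶻ 𝟙 (eqPerm (σ ∘ swap i) π)
      ≡⟨ cong (λ k → + k *ᶻ 𝟙 (eqPerm (σ ∘ swap i) π)) card ⟩
    + q *ᶻ 𝟙 (eqPerm (σ ∘ swap i) π) ∎
    where
    open ≡-Reasoning
    σs-inj = ∘swap-injective i σ-inj
  ... | no ¬descent = begin
    ∑ elements (λ a → 𝟙 (inCell π (permMat σ ⊗ Y a)))
      ≡⟨ ∑-elements _ ⟩
    𝟙 (inCell π (permMat σ ⊗ Y 0#)) +ᶻ ∑ nonzeroElems (λ a → 𝟙 (inCell π (permMat σ ⊗ Y a)))
      ≡⟨ cong₂ _+ᶻ_ (cong 𝟙 (inCell-exact σs-inj (Cell-permMat⊗Y-0 σ σ-inj) π))
                    (∑-cong-∈ nonzeroElems (λ a∈ → cong 𝟙 (inCell-exact σ-inj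
                      (Cell-permMat⊗Y-ascent σ σ-inj ascent _ (nonzeroElems-≢0 a∈)) π))) ⟩
    𝟙 (eqPerm (σ ∘ swap i) π) +ᶻ ∑ nonzeroElems (λ _ → 𝟙 (eqPerm σ π))
      ≡⟨ cong (𝟙 (eqPerm (σ ∘ swap i) π) +ᶻ_)
              (trans (∑-const nonzeroElems _) (cong (_*ᶻ 𝟙 (eqPerm σ π)) length-nonzeroElems)) ⟩
    𝟙 (eqPerm (σ ∘ swap i) π) +ᶻ (+ q -ᶻ + 1) *ᶻ 𝟙 (eqPerm σ π) ∎
    where
    open ≡-Reasoning
    σs-inj = ∘swap-injective i σ-inj
    ascent : σ I′ < σ S
    ascent with FinP.<-cmp (σ I′) (σ S)
    ... | tri< lt _ _ = lt
    ... | tri≈ _ e _  = contradiction (σ-inj e) (inject₁≢suc i)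
    ... | tri> _ _ gt = contradiction gt ¬descent

  module _ {x : Mat n} {σ : Perm} (σ-cell : Cell σ x) where

    private
      l = proj₁ σ-cell
      u′ = proj₁ (proj₂ σ-cell)
      l-lower = proj₁ (proj₂ (proj₂ σ-cell))
      l-inv = proj₁ (proj₂ (proj₂ (proj₂ σ-cell)))
      u′-upper = proj₁ (proj₂ (proj₂ (proj₂ (proj₂ σ-cell))))
      u′-inv = proj₁ (proj₂ (proj₂ (proj₂ (proj₂ (proj₂ σ-cell)))))
      lPu′≈x = proj₂ (proj₂ (proj₂ (proj₂ (proj₂ (proj₂ σ-cell)))))

      x⊗Y≈ : ∀ a → x ⊗ Y a ≈ᴹ l ⊗ (permMat σ ⊗ (u′ ⊗ Y a))
      x⊗Y≈ a = ≈ᴹ.trans (⊗-congˡ (Y a) (≈ᴹ.sym lPu′≈x))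
                 (≈ᴹ.trans (⊗-assoc (l ⊗ permMat σ) u′ (Y a)) (⊗-assoc l (permMat σ) (u′ ⊗ Y a)))

      φ′ = φ u′-upper u′-inv

    inCell-⊗Y-transport : ∀ π a → inCell π (x ⊗ Y a) ≡ inCell π (permMat σ ⊗ Y (φ′ a))
    inCell-⊗Y-transport π a = begin
      inCell π (x ⊗ Y a)
        ≡⟨ inCell-∼ᴮ (≈ᴹ⇒∼ᴮ (x⊗Y≈ a)) ⟩
      inCell π (l ⊗ (permMat σ ⊗ (u′ ⊗ Y a)))
        ≡⟨ inCell-lower⊗ l-lower l-inv ⟩
      inCell π (permMat σ ⊗ (u′ ⊗ Y a))
        ≡⟨ inCell-∼ᴮ (∼ᴮ-⊗ˡ (permMat σ) (Y∼ᴮupper⊗Y u′-upper u′-inv a)) ⟨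
      inCell π (permMat σ ⊗ Y (φ′ a)) ∎
      where open ≡-Reasoning

    Cell-⊗Y : Injective _≡_ _≡_ σ → ∀ a → ∃[ τ ] (Injective _≡_ _≡_ τ × Cell τ (x ⊗ Y a))
    Cell-⊗Y σ-inj a with Cell-permMat⊗Y σ σ-inj (φ′ a)
    ... | τ , τ-inj , τ-cell = τ , τ-inj ,
          Cell-cong (≈ᴹ.sym (x⊗Y≈ a)) (Cell-lower⊗ l-lower l-inv
            (Cell-∼ᴮ τ-cell (∼ᴮ-⊗ˡ (permMat σ) (Y∼ᴮupper⊗Y u′-upper u′-inv a))))

    cellCount-Cell : Injective _≡_ _≡_ σ → ∀ π → cellCount x π ≡ Tcoeff σ π
    cellCount-Cell σ-inj π = begin
      ∑ elements (λ a → 𝟙 (inCell π (x ⊗ Y a)))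
        ≡⟨ ∑-cong elements (cong 𝟙 ∘ inCell-⊗Y-transport π) ⟩
      ∑ elements (λ a → 𝟙 (inCell π (permMat σ ⊗ Y (φ′ a))))
        ≡⟨ ∑-bijection elements _ _ _ unique complete
            (φ∘φ⁻¹ u′-upper u′-inv) (φ⁻¹∘φ u′-upper u′-inv) ⟩
      cellCount (permMat σ) π
        ≡⟨ cellCount-permMat σ-inj π ⟩
      Tcoeff σ π ∎
      where open ≡-Reasoning

  noCell-⊗Y : ∀ {x} → (∀ σ → Injective _≡_ _≡_ σ → ¬ Cell σ x) →
              ∀ a {π} → Injective _≡_ _≡_ π → ¬ Cell π (x ⊗ Y a)
  noCell-⊗Y {x} none a {π} π-inj π-cell =
    none (proj₁ next) (proj₁ (proj₂ next))
         (Cell-cong x⊗Y⊗Y⁻¹≈x (Cell-∼ᴮ (proj₂ (proj₂ next)) (∼ᴮ-⊗ˡ (x ⊗ Y a) (Y0∼ᴮY⁻¹ a))))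
    where
    next : ∃[ τ ] (Injective _≡_ _≡_ τ × Cell τ ((x ⊗ Y a) ⊗ Y 0#))
    next = Cell-⊗Y π-cell π-inj 0#
    x⊗Y⊗Y⁻¹≈x : (x ⊗ Y a) ⊗ Y⁻¹ a ≈ᴹ x
    x⊗Y⊗Y⁻¹≈x = ≈ᴹ.trans (⊗-assoc x (Y a) (Y⁻¹ a)) (≈ᴹ.trans (⊗-congʳ x (Y⊗Y⁻¹ a)) (⊗-identityʳ x))

  cellCount-noCell : ∀ {x} → (∀ σ → Injective _≡_ _≡_ σ → ¬ Cell σ x) →
                     ∀ {π} → Injective _≡_ _≡_ π → cellCount x π ≡ + 0
  cellCount-noCell {x} none {π} π-inj = ∑-zero elements (λ a → 𝟙 (inCell π (x ⊗ Y a)))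
    (λ {a} _ → cong 𝟙 (≢true⇒≡false (λ e → noCell-⊗Y none a π-inj (inCell-sound {σ = π} {g = x ⊗ Y a} e))))

  Tcoeff-cong : ∀ {σ σ′} π → σ ≗ σ′ → Tcoeff σ π ≡ Tcoeff σ′ π
  Tcoeff-cong {σ} {σ′} π σ≗σ′
    rewrite σ≗σ′ S | σ≗σ′ I′
          | eqPerm-cong {σ = σ ∘ swap i} {σ′ = σ′ ∘ swap i} {π = π} (σ≗σ′ ∘ swap i) (λ _ → refl)
          | eqPerm-cong {σ = σ} {σ′ = σ′} {π = π} σ≗σ′ (λ _ → refl) = refl

  Tcoeff-congʳ : ∀ σ {π π′} → π ≗ π′ → Tcoeff σ π ≡ Tcoeff σ π′
  Tcoeff-congʳ σ {π} {π′} π≗π′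
    rewrite eqPerm-cong {σ = σ ∘ swap i} {π = π} {π′ = π′} (λ _ → refl) π≗π′
          | eqPerm-cong {σ = σ} {π = π} {π′ = π′} (λ _ → refl) π≗π′ = refl

  Tcoeff-off : ∀ σ π → eqPerm (σ ∘ swap i) π ≡ false → eqPerm σ π ≡ false → Tcoeff σ π ≡ + 0
  Tcoeff-off σ π σs≢π σ≢π rewrite σs≢π | σ≢π with ⌊ σ S <? σ I′ ⌋
  ... | true  = ℤP.*-zeroʳ (+ q)
  ... | false = trans (ℤP.+-identityˡ _) (ℤP.*-zeroʳ (+ q -ᶻ + 1))

  Tcoeff-swap : ∀ {σ} → Injective _≡_ _≡_ σ → Tcoeff σ (σ ∘ swap i) ≡ (if ⌊ σ S <? σ I′ ⌋ then + q else + 1)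
  Tcoeff-swap {σ} σ-inj
    rewrite eqPerm-complete {σ = σ ∘ swap i} {π = σ ∘ swap i} (λ _ → refl)
          | ≢true⇒≡false {eqPerm σ (σ ∘ swap i)}
              (λ e → inject₁≢suc i (σ-inj (trans (eqPerm-sound e I′) (cong σ (swap-inject₁ i)))))
    with ⌊ σ S <? σ I′ ⌋
  ... | true  = ℤP.*-identityʳ (+ q)
  ... | false = trans (cong (+ 1 +ᶻ_) (ℤP.*-zeroʳ (+ q -ᶻ + 1))) (ℤP.+-identityʳ (+ 1))

  private
    Q : ℤ
    Q = + q

    1·qP≡P·q : ∀ (Q P : ℤ) → + 1 *ᶻ (Q *ᶻ P) ≡ P *ᶻ (Q *ᶻ + 1)
    1·qP≡P·q = solve-∀

  private
    Tcoeff-swap-back : ∀ {π} → Injective _≡_ _≡_ π → Tcoeff (π ∘ swap i) π ≡ (if ⌊ π I′ <? π S ⌋ then Q else + 1)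
    Tcoeff-swap-back {π} π-inj = begin
      Tcoeff (π ∘ swap i) π
        ≡⟨ Tcoeff-congʳ (π ∘ swap i) (λ k → cong π (sym (swap-involutive i k))) ⟩
      Tcoeff (π ∘ swap i) (π ∘ swap i ∘ swap i)
        ≡⟨ Tcoeff-swap (∘swap-injective i π-inj) ⟩
      (if ⌊ π (swap i S) <? π (swap i I′) ⌋ then Q else + 1)
        ≡⟨ cong₂ (λ x y → if ⌊ π x <? π y ⌋ then Q else + 1) (swap-suc i) (swap-inject₁ i) ⟩
      (if ⌊ π I′ <? π S ⌋ then Q else + 1) ∎
      where open ≡-Reasoning

  Tcoeff-symmetric-swap : ∀ {π} → Injective _≡_ _≡_ π →
    Tcoeff π (π ∘ swap i) *ᶻ Q ℤ.^ inv (π ∘ swap i) ≡ Q ℤ.^ inv π *ᶻ Tcoeff (π ∘ swap i) π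
  Tcoeff-symmetric-swap {π} π-inj with FinP.<-cmp (π S) (π I′)
  ... | tri< descent _ ¬ascent = begin
    Tcoeff π (π ∘ swap i) *ᶻ Q ℤ.^ inv (π ∘ swap i)
      ≡⟨ cong (_*ᶻ Q ℤ.^ inv (π ∘ swap i))
              (trans (Tcoeff-swap π-inj) (cong (if_then Q else + 1) (isYes-true (π S <? π I′) descent))) ⟩
    Q *ᶻ Q ℤ.^ inv (π ∘ swap i)
      ≡⟨ ℤP.*-identityʳ _ ⟨
    Q *ᶻ Q ℤ.^ inv (π ∘ swap i) *ᶻ + 1
      ≡⟨ cong₂ _*ᶻ_ (cong (Q ℤ.^_) (inv-descent i π descent))
          (trans (Tcoeff-swap-back π-inj)
          (cong (if_then Q else + 1) (isYes-false (π I′ <? π S) ¬ascent))) ⟨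
    Q ℤ.^ inv π *ᶻ Tcoeff (π ∘ swap i) π                  ∎
    where open ≡-Reasoning
  ... | tri≈ _ π-S≡π-I _ = contradiction (π-inj π-S≡π-I) (inject₁≢suc i ∘ sym)
  ... | tri> ¬descent _ ascent = begin
    Tcoeff π (π ∘ swap i) *ᶻ Q ℤ.^ inv (π ∘ swap i)
      ≡⟨ cong₂ _*ᶻ_ (trans (Tcoeff-swap π-inj) (cong (if_then Q else + 1) (isYes-false (π S <? π I′) ¬descent)))
          (cong (Q ℤ.^_) inv-πs) ⟩
    + 1 *ᶻ (Q *ᶻ Q ℤ.^ inv π)
      ≡⟨ 1·qP≡P·q Q _ ⟩
    Q ℤ.^ inv π *ᶻ (Q *ᶻ + 1)
      ≡⟨ cong (Q ℤ.^ inv π *ᶻ_) (ℤP.*-identityʳ Q) ⟩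
    Q ℤ.^ inv π *ᶻ Q
      ≡⟨ cong (Q ℤ.^ inv π *ᶻ_) (sym (trans (Tcoeff-swap-back π-inj)
          (cong (if_then Q else + 1) (isYes-true (π I′ <? π S) ascent)))) ⟩
    Q ℤ.^ inv π *ᶻ Tcoeff (π ∘ swap i) π                  ∎
    where
    open ≡-Reasoning
    πs-descent : (π ∘ swap i) S < (π ∘ swap i) I′
    πs-descent = subst₂ _<_ (cong π (sym (swap-suc i))) (cong π (sym (swap-inject₁ i))) ascent
    inv-πs : inv (π ∘ swap i) ≡ suc (inv π)
    inv-πs = trans (inv-descent i (π ∘ swap i) πs-descent) (cong suc (inv-cong (cong π ∘ swap-involutive i)))

  -- Tᵢ is self-adjoint for the form with ⟨σ, σ⟩ = q ^ inv σ.
  Tcoeff-symmetric : ∀ σ {π} → Injective _≡_ _≡_ π → Tcoeff π σ *ᶻ Q ℤ.^ inv σ ≡ Q ℤ.^ inv π *ᶻ Tcoeff σ π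
  Tcoeff-symmetric σ {π} π-inj = by-cases (eqPerm σ π) refl (eqPerm σ (π ∘ swap i)) refl
    where
    open ≡-Reasoning
    by-cases : ∀ b → eqPerm σ π ≡ b → ∀ b′ → eqPerm σ (π ∘ swap i) ≡ b′ →
               Tcoeff π σ *ᶻ Q ℤ.^ inv σ ≡ Q ℤ.^ inv π *ᶻ Tcoeff σ π
    by-cases true σ=π _ _ = begin
      Tcoeff π σ *ᶻ Q ℤ.^ inv σ      ≡⟨ cong₂ (λ t k → t *ᶻ Q ℤ.^ k) (Tcoeff-congʳ π σ≗π) (inv-cong σ≗π) ⟩
      Tcoeff π π *ᶻ Q ℤ.^ inv π      ≡⟨ ℤP.*-comm (Tcoeff π π) _ ⟩
      Q ℤ.^ inv π *ᶻ Tcoeff π π      ≡⟨ cong (Q ℤ.^ inv π *ᶻ_) (Tcoeff-cong π σ≗π) ⟨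
      Q ℤ.^ inv π *ᶻ Tcoeff σ π      ∎
      where σ≗π = eqPerm-sound σ=π
    by-cases false _ true σ=πs = begin
      Tcoeff π σ *ᶻ Q ℤ.^ inv σ
        ≡⟨ cong₂ (λ t k → t *ᶻ Q ℤ.^ k) (Tcoeff-congʳ π σ≗πs) (inv-cong σ≗πs) ⟩
      Tcoeff π (π ∘ swap i) *ᶻ Q ℤ.^ inv (π ∘ swap i)
        ≡⟨ Tcoeff-symmetric-swap π-inj ⟩
      Q ℤ.^ inv π *ᶻ Tcoeff (π ∘ swap i) π
        ≡⟨ cong (Q ℤ.^ inv π *ᶻ_) (Tcoeff-cong π σ≗πs) ⟨
      Q ℤ.^ inv π *ᶻ Tcoeff σ π ∎
      where σ≗πs = eqPerm-sound σ=πs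
    by-cases false σ≠π false σ≠πs = begin
      Tcoeff π σ *ᶻ Q ℤ.^ inv σ
        ≡⟨ cong (_*ᶻ Q ℤ.^ inv σ) (Tcoeff-off π σ (trans (eqPerm-comm (π ∘ swap i) σ) σ≠πs)
            (trans (eqPerm-comm π σ) σ≠π)) ⟩
      + 0 *ᶻ Q ℤ.^ inv σ
        ≡⟨ ℤP.*-zeroˡ (Q ℤ.^ inv σ) ⟩
      + 0
        ≡⟨ ℤP.*-zeroʳ (Q ℤ.^ inv π) ⟨
      Q ℤ.^ inv π *ᶻ + 0
        ≡⟨ cong (Q ℤ.^ inv π *ᶻ_) (Tcoeff-off σ π σs≠π σ≠π) ⟨
      Q ℤ.^ inv π *ᶻ Tcoeff σ π ∎
      where
      σs≠π : eqPerm (σ ∘ swap i) π ≡ false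
      σs≠π = ≢true⇒≡false (λ e → true≢false (trans (sym (eqPerm-complete (λ k →
               trans (cong σ (sym (swap-involutive i k))) (eqPerm-sound e (swap i k))))) σ≠πs))
        where
        true≢false : true ≢ false
        true≢false ()

  Tᵢ-cong : ∀ {f g} σ → (∀ ρ → f ρ ≡ g ρ) → Tᵢ f σ ≡ Tᵢ g σ
  Tᵢ-cong {f} {g} σ f≗g = cong₂ (λ x y → if ⌊ σ S <? σ I′ ⌋ then + q *ᶻ x else x +ᶻ (+ q -ᶻ + 1) *ᶻ y)
                               (f≗g (σ ∘ swap i)) (f≗g σ)

  Tᵢ-*ʳ : ∀ f c σ → Tᵢ (λ ρ → f ρ *ᶻ c) σ ≡ Tᵢ f σ *ᶻ c
  Tᵢ-*ʳ f c σ = by-cases ⌊ σ S <? σ I′ ⌋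
    where
    by-cases : ∀ b → (if b then Q *ᶻ (f (σ ∘ swap i) *ᶻ c) else f (σ ∘ swap i) *ᶻ c +ᶻ (Q -ᶻ + 1) *ᶻ (f σ *ᶻ c))
                   ≡ (if b then Q *ᶻ f (σ ∘ swap i) else f (σ ∘ swap i) +ᶻ (Q -ᶻ + 1) *ᶻ f σ) *ᶻ c
    by-cases true  = sym (ℤP.*-assoc Q _ c)
    by-cases false = distribute Q (f (σ ∘ swap i)) (f σ) c
      where
      distribute : ∀ Q x y c → x *ᶻ c +ᶻ (Q -ᶻ + 1) *ᶻ (y *ᶻ c) ≡ (x +ᶻ (Q -ᶻ + 1) *ᶻ y) *ᶻ c
      distribute = solve-∀

  Tᵢ-zero : ∀ f σ → f (σ ∘ swap i) ≡ + 0 → f σ ≡ + 0 → Tᵢ f σ ≡ + 0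
  Tᵢ-zero f σ fσs≡0 fσ≡0 = by-cases ⌊ σ S <? σ I′ ⌋
    where
    by-cases : ∀ b → (if b then Q *ᶻ f (σ ∘ swap i) else f (σ ∘ swap i) +ᶻ (Q -ᶻ + 1) *ᶻ f σ) ≡ + 0
    by-cases true  = trans (cong (Q *ᶻ_) fσs≡0) (ℤP.*-zeroʳ Q)
    by-cases false = trans (cong₂ (λ x y → x +ᶻ (Q -ᶻ + 1) *ᶻ y) fσs≡0 fσ≡0)
                           (trans (ℤP.+-identityˡ _) (ℤP.*-zeroʳ (Q -ᶻ + 1)))

module Coefficients {q : ℕ} (F : FiniteField q) where

  open Matrices F
  open BruhatCells F
  open Decidability F

  coeffS≡∑ : ∀ {n} (L : VS n) π → coeffS L π ≡ ∑ L (λ (a , σ) → a *ᶻ 𝟙 (eqPerm σ π))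
  coeffS≡∑ L π = ∑-cong L (λ (a , σ) → if-then-0 (eqPerm σ π) a)

  coeffG≡∑ : ∀ {n} (L : VG n) x → coeffG L x ≡ ∑ L (λ (a , g) → a *ᶻ 𝟙 (sameCoset g x))
  coeffG≡∑ L x = ∑-cong L (λ (a , g) → if-then-0 (sameCoset g x) a)

  cellSum : ∀ {n} → ((Fin n → Fin n) → ℤ) → Mat n → ℤ
  cellSum {n} f g = ∑ (allPerms n) (λ σ → if inCell σ g then f σ else + 0)

  ∑-proj : ∀ {n} (f : (Fin n → Fin n) → ℤ) (L : VG n) →
           ∑ (proj L) (λ (a , σ) → a *ᶻ f σ) ≡ ∑ L (λ (a , g) → a *ᶻ cellSum f g)
  ∑-proj {n} f L = trans (∑-concatMap cellBlock L (λ (a , σ) → a *ᶻ f σ)) (∑-cong L block)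
    where
    cellBlock : ℤ × Mat n → VS n
    cellBlock (a , g) = map (a ,_) (filterᵇ (λ σ → inCell σ g) (allPerms n))
    block : ∀ ((a , g) : ℤ × Mat n) → ∑ (cellBlock (a , g)) (λ (a , σ) → a *ᶻ f σ) ≡ a *ᶻ cellSum f g
    block (a , g) = ∑-map-filter a (λ σ → inCell σ g) (allPerms n) f

  cellSum-Cell : ∀ {n} (f : (Fin n → Fin n) → ℤ) → (∀ {σ τ} → σ ≗ τ → f σ ≡ f τ) →
                 ∀ {τ g} → Injective _≡_ _≡_ τ → Cell τ g → cellSum f g ≡ f τ
  cellSum-Cell {n} f f-cong {τ} {g} τ-inj τ-cell = begin
    ∑ (allPerms n) (λ σ → if inCell σ g then f σ else + 0)
      ≡⟨ ∑-cong (allPerms n) only-τ ⟩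
    ∑ (allPerms n) (λ σ → 𝟙 (eqPerm σ τ) *ᶻ f τ)
      ≡⟨ ∑-*ʳ (allPerms n) (f τ) (λ σ → 𝟙 (eqPerm σ τ)) ⟩
    ∑ (allPerms n) (λ σ → 𝟙 (eqPerm σ τ)) *ᶻ f τ
      ≡⟨ cong (_*ᶻ f τ) (trans (allPerms-count n τ) (cong 𝟙 (isInjective-complete τ-inj))) ⟩
    + 1 *ᶻ f τ
      ≡⟨ ℤP.*-identityˡ (f τ) ⟩
    f τ ∎
    where
    open ≡-Reasoning
    only-τ : ∀ σ → (if inCell σ g then f σ else + 0) ≡ 𝟙 (eqPerm σ τ) *ᶻ f τ
    only-τ σ = trans (cong (if_then f σ else + 0) (trans (inCell-exact τ-inj τ-cell σ) (eqPerm-comm τ σ)))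
                     (by-cases (eqPerm σ τ) refl)
      where
      by-cases : ∀ b → eqPerm σ τ ≡ b → (if b then f σ else + 0) ≡ 𝟙 b *ᶻ f τ
      by-cases true  σ=τ = trans (f-cong (eqPerm-sound σ=τ)) (sym (ℤP.*-identityˡ (f τ)))
      by-cases false _   = sym (ℤP.*-zeroˡ (f τ))

  cellSum-noCell : ∀ {n} (f : (Fin n → Fin n) → ℤ) {g : Mat n} →
                   (∀ σ → Injective _≡_ _≡_ σ → ¬ Cell σ g) → cellSum f g ≡ + 0
  cellSum-noCell {n} f {g} none = ∑-zero (allPerms n) (λ σ → if inCell σ g then f σ else + 0) (λ {σ} σ∈ →
    cong (if_then f σ else + 0)
                                    (≢true⇒≡false (λ e → none σ (allPerms-injective σ∈) (inCell-sound e))))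

  sameCoset-refl : ∀ {n} {g : Mat n} → sameCoset g g ≡ true
  sameCoset-refl {g = g} = sameCoset-complete {g = g} {x = g} ∼ᴮ-refl

  sameCoset-sym : ∀ {n} {g x : Mat n} → sameCoset g x ≡ true → sameCoset x g ≡ true
  sameCoset-sym {g = g} {x} e = sameCoset-complete {g = x} {x = g} (∼ᴮ-sym (sameCoset-sound e))

  sameCoset-trans : ∀ {n} {g x y : Mat n} → sameCoset g x ≡ true → sameCoset x y ≡ true → sameCoset g y ≡ true
  sameCoset-trans {g = g} {x} {y} e e′ =
    sameCoset-complete {g = g} {x = y} (∼ᴮ-trans (sameCoset-sound e) (sameCoset-sound e′))

  sameCoset-comm : ∀ {n} (g x : Mat n) → sameCoset g x ≡ sameCoset x g
  sameCoset-comm g x = ⇔-true⇒≡ (sameCoset-sym {g = g} {x}) (sameCoset-sym {g = x} {g})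

  cosetReps-⊆ : ∀ {n} {g : Mat n} → g ∈ cosetReps n → g ∈ filterᵇ isInv (allMats n)
  cosetReps-⊆ {n} = greedyReps-⊆ (sameCoset {n}) (λ {g} → sameCoset-refl {n} {g})
                      (λ {g} {x} → sameCoset-sym {n} {g} {x}) (λ {g} {x} {y} → sameCoset-trans {n} {g} {x} {y})
                      (filterᵇ isInv (allMats n))

  cosetReps-classes : ∀ {n} (x : Mat n) →
    ∑ (cosetReps n) (λ g → 𝟙 (sameCoset g x)) ≡ 𝟙 (anyᵇ (λ y → sameCoset y x) (filterᵇ isInv (allMats n)))
  cosetReps-classes {n} = greedyReps-count (sameCoset {n}) (λ {g} → sameCoset-refl {n} {g})
                            (λ {g} {x} → sameCoset-sym {n} {g} {x}) (λ {g} {x} {y} → sameCoset-trans {n} {g} {x} {y})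
                            (filterᵇ isInv (allMats n))

  cosetReps-invertible : ∀ {n} {g : Mat n} → g ∈ cosetReps n → IsInvertible g
  cosetReps-invertible {n} g∈ = isInv-sound (proj₂ (∈-filterᵇ⁻ isInv {allMats n} (cosetReps-⊆ g∈)))

  cosetReps-count : ∀ {n} {x : Mat n} → IsInvertible x → ∑ (cosetReps n) (λ g → 𝟙 (sameCoset g x)) ≡ + 1
  cosetReps-count {n} {x} x-inv with allMats-complete x
  ... | x′ , x′∈ , x′≈x = trans (cosetReps-classes x)
          (cong 𝟙 (anyᵇ-true⁺ (λ y → sameCoset y x)
                             (∈-filterᵇ⁺ isInv x′∈ (isInv-complete (Invertible-cong (≈ᴹ.sym x′≈x) x-inv)))
                             (sameCoset-complete {g = x′} {x = x} (≈ᴹ⇒∼ᴮ x′≈x))))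

  cosetReps-cell : ∀ {n} {x : Mat n} → IsInvertible x → ∀ ρ →
                   ∑ (cosetReps n) (λ g → if inCell ρ g then 𝟙 (sameCoset g x) else + 0) ≡ 𝟙 (inCell ρ x)
  cosetReps-cell {n} {x} x-inv ρ = begin
    ∑ (cosetReps n) (λ g → if inCell ρ g then 𝟙 (sameCoset g x) else + 0)
      ≡⟨ ∑-cong (cosetReps n) (λ g → by-cases g (sameCoset g x) refl) ⟩
    ∑ (cosetReps n) (λ g → 𝟙 (inCell ρ x) *ᶻ 𝟙 (sameCoset g x))
      ≡⟨ ∑-*ˡ (cosetReps n) (𝟙 (inCell ρ x)) (λ g → 𝟙 (sameCoset g x)) ⟩
    𝟙 (inCell ρ x) *ᶻ ∑ (cosetReps n) (λ g → 𝟙 (sameCoset g x))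
      ≡⟨ cong (𝟙 (inCell ρ x) *ᶻ_) (cosetReps-count x-inv) ⟩
    𝟙 (inCell ρ x) *ᶻ + 1
      ≡⟨ ℤP.*-identityʳ _ ⟩
    𝟙 (inCell ρ x) ∎
    where
    open ≡-Reasoning
    by-cases : ∀ g b → sameCoset g x ≡ b → (if inCell ρ g then 𝟙 b else + 0) ≡ 𝟙 (inCell ρ x) *ᶻ 𝟙 b
    by-cases g true  g∼x = trans (cong (if_then + 1 else + 0) (inCell-∼ᴮ {π = ρ} (sameCoset-sound {g = g} {x = x} g∼x)))
                                 (sym (ℤP.*-identityʳ (𝟙 (inCell ρ x))))
    by-cases g false _   = trans (if-then-0 (inCell ρ g) (+ 0))
                                 (trans (ℤP.*-zeroˡ (𝟙 (inCell ρ g))) (sym (ℤP.*-zeroʳ (𝟙 (inCell ρ x)))))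

  ∑-incl : ∀ {n} (G : Mat n → ℤ) (L : VS n) →
           ∑ (incl L) (λ (a , g) → a *ᶻ G g)
           ≡ ∑ L (λ (a , ρ) → (a *ᶻ (+ q) ℤ.^ inv ρ) *ᶻ ∑ (cosetReps n) (λ g → if inCell ρ g then G g else + 0))
  ∑-incl {n} G L = trans (∑-concatMap cellBlock L (λ (a , g) → a *ᶻ G g)) (∑-cong L block)
    where
    cellBlock : ℤ × (Fin n → Fin n) → VG n
    cellBlock (a , ρ) = map ((a *ᶻ (+ q) ℤ.^ inv ρ) ,_) (filterᵇ (inCell ρ) (cosetReps n))
    block : ∀ ((a , ρ) : ℤ × (Fin n → Fin n)) → ∑ (cellBlock (a , ρ)) (λ (a , g) → a *ᶻ G g)
            ≡ (a *ᶻ (+ q) ℤ.^ inv ρ) *ᶻ ∑ (cosetReps n) (λ g → if inCell ρ g then G g else + 0)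
    block (a , ρ) = ∑-map-filter (a *ᶻ (+ q) ℤ.^ inv ρ) (inCell ρ) (cosetReps n) G

  coeffG-incl : ∀ {n} (L : VS n) {x : Mat n} → IsInvertible x →
                coeffG (incl L) x ≡ ∑ L (λ (a , ρ) → a *ᶻ ((+ q) ℤ.^ inv ρ *ᶻ 𝟙 (inCell ρ x)))
  coeffG-incl {n} L {x} x-inv = begin
    coeffG (incl L) x
      ≡⟨ coeffG≡∑ (incl L) x ⟩
    ∑ (incl L) (λ (a , g) → a *ᶻ 𝟙 (sameCoset g x))
      ≡⟨ ∑-incl (λ g → 𝟙 (sameCoset g x)) L ⟩
    ∑ L (λ (a , ρ) → (a *ᶻ (+ q) ℤ.^ inv ρ) *ᶻ
          ∑ (cosetReps n) (λ g → if inCell ρ g then 𝟙 (sameCoset g x) else + 0))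
          ≡⟨ ∑-cong L (λ (a , ρ) → trans (cong ((a *ᶻ (+ q) ℤ.^ inv ρ) *ᶻ_) (cosetReps-cell x-inv ρ))
          (ℤP.*-assoc a _ _)) ⟩
    ∑ L (λ (a , ρ) → a *ᶻ ((+ q) ℤ.^ inv ρ *ᶻ 𝟙 (inCell ρ x)))                   ∎
    where open ≡-Reasoning

module HeckeAction {q : ℕ} (F : FiniteField q) {m : ℕ} (i : Fin m) where

  open Matrices F
  open BruhatCells F
  open Decidability F
  open FieldSums F
  open SimpleReflection F i
  open CellCounts F i
  open Coefficients F

  private
    n = suc m

  ∑-TS : ∀ (f : Perm → ℤ) (L : VS n) → ∑ (TS i L) (λ (a , ρ) → a *ᶻ f ρ) ≡ ∑ L (λ (a , σ) → a *ᶻ Tᵢ f σ)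
  ∑-TS f L = trans (∑-concatMap block L (λ (a , ρ) → a *ᶻ f ρ))
                   (∑-cong L (λ (a , σ) → block-sum a σ ⌊ σ (suc i) <? σ (inject₁ i) ⌋))
    where
    block : ℤ × Perm → VS n
    block (a , σ) = if ⌊ σ (suc i) <? σ (inject₁ i) ⌋
                    then (a *ᶻ + q , σ ∘ swap i) ∷ []
                    else (a , σ ∘ swap i) ∷ (a *ᶻ (+ q -ᶻ + 1) , σ) ∷ []
    block-sum : ∀ a σ b → ∑ (if b then (a *ᶻ + q , σ ∘ swap i) ∷ [] else (a , σ ∘ swap i) ∷ (a *ᶻ (+ q -ᶻ + 1) , σ) ∷ [])
                            (λ (a , ρ) → a *ᶻ f ρ)
                          ≡ a *ᶻ (if b then + q *ᶻ f (σ ∘ swap i) else f (σ ∘ swap i) +ᶻ (+ q -ᶻ + 1) *ᶻ f σ)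
    block-sum a σ true  = descent-identity a (+ q) (f (σ ∘ swap i))
      where
      descent-identity : ∀ a Q x → a *ᶻ Q *ᶻ x +ᶻ + 0 ≡ a *ᶻ (Q *ᶻ x)
      descent-identity = solve-∀
    block-sum a σ false = ascent-identity a (+ q) (f (σ ∘ swap i)) (f σ)
      where
      ascent-identity : ∀ a Q x y → a *ᶻ x +ᶻ (a *ᶻ (Q -ᶻ + 1) *ᶻ y +ᶻ + 0) ≡ a *ᶻ (x +ᶻ (Q -ᶻ + 1) *ᶻ y)
      ascent-identity = solve-∀

  module _ (G : Mat n → ℤ) (G-resp : ∀ {A B} → A ∼ᴮ B → G A ≡ G B) where

    ∑-Y : ∀ g → ∑ elements (λ t → G (g ⊗ Y t)) ≡ G (g ⊗ sMat i) +ᶻ ∑ nonzeroElems (λ t → G (g ⊗ fMat i t))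
    ∑-Y g = begin
      ∑ elements (λ t → G (g ⊗ Y t))
        ≡⟨ ∑-recip (λ t → G (g ⊗ Y t)) ⟨
      ∑ elements (λ t → G (g ⊗ Y (recip t)))
        ≡⟨ ∑-elements (λ t → G (g ⊗ Y (recip t))) ⟩
      G (g ⊗ Y (recip 0#)) +ᶻ ∑ nonzeroElems (λ t → G (g ⊗ Y (recip t)))
        ≡⟨ cong₂ _+ᶻ_ at-0 (∑-cong-∈ nonzeroElems at-nonzero) ⟩
      G (g ⊗ sMat i) +ᶻ ∑ nonzeroElems (λ t → G (g ⊗ fMat i t)) ∎
      where
      open ≡-Reasoning
      at-0 : G (g ⊗ Y (recip 0#)) ≡ G (g ⊗ sMat i)
      at-0 = G-resp (≈ᴹ⇒∼ᴮ (⊗-congʳ g (≈ᴹ.trans (≈ᴹ.reflexive (cong Y recip-0)) Y-0)))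
      at-nonzero : ∀ {t} → t ∈ nonzeroElems → G (g ⊗ Y (recip t)) ≡ G (g ⊗ fMat i t)
      at-nonzero {t} t∈ = G-resp (∼ᴮ-⊗ˡ g (Y∼ᴮfMat (recip t) t (recip-inverseˡ t (nonzeroElems-≢0 t∈))))

    ∑-TG : ∀ (L : VG n) →
           ∑ (TG i L) (λ (a , g) → a *ᶻ G g) ≡ ∑ L (λ (a , g) → a *ᶻ ∑ elements (λ t → G (g ⊗ Y t)))
    ∑-TG L = trans (∑-concatMap block L (λ (a , g) → a *ᶻ G g)) (∑-cong L block-sum)
      where
      block : ℤ × Mat n → VG n
      block (a , g) = (a , g ⊗ sMat i) ∷ map (λ t → (a , g ⊗ fMat i t)) nonzeroElems
      block-sum : ∀ ((a , g) : ℤ × Mat n) →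
                  ∑ (block (a , g)) (λ (a , g) → a *ᶻ G g) ≡ a *ᶻ ∑ elements (λ t → G (g ⊗ Y t))
      block-sum (a , g) = begin
        a *ᶻ G (g ⊗ sMat i) +ᶻ ∑ (map (λ t → (a , g ⊗ fMat i t)) nonzeroElems) (λ (a , g) → a *ᶻ G g)
          ≡⟨ cong (a *ᶻ G (g ⊗ sMat i) +ᶻ_) (trans (∑-map (λ t → (a , g ⊗ fMat i t)) nonzeroElems (λ (a , g) → a *ᶻ G g))
                                                  (∑-*ˡ nonzeroElems a (λ t → G (g ⊗ fMat i t)))) ⟩
        a *ᶻ G (g ⊗ sMat i) +ᶻ a *ᶻ ∑ nonzeroElems (λ t → G (g ⊗ fMat i t))
          ≡⟨ ℤP.*-distribˡ-+ a (G (g ⊗ sMat i)) _ ⟨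
        a *ᶻ (G (g ⊗ sMat i) +ᶻ ∑ nonzeroElems (λ t → G (g ⊗ fMat i t)))
          ≡⟨ cong (a *ᶻ_) (∑-Y g) ⟨
        a *ᶻ ∑ elements (λ t → G (g ⊗ Y t)) ∎
        where open ≡-Reasoning

  ⊗Y-∼ᴮ-unique : ∀ {g x : Mat n} → IsInvertible g → ∀ {t t′} → g ⊗ Y t ∼ᴮ x → g ⊗ Y t′ ∼ᴮ x → t ≡ t′
  ⊗Y-∼ᴮ-unique {g} g-inv {t} {t′} gYt∼x gYt′∼x =
    Y-injective t t′ b-upper (⊗-cancelˡ g-inv (≈ᴹ.trans (≈ᴹ.sym (⊗-assoc g (Y t) b)) gYtb≈gYt′))
    where
    gYt∼gYt′ : g ⊗ Y t ∼ᴮ g ⊗ Y t′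
    gYt∼gYt′ = ∼ᴮ-trans gYt∼x (∼ᴮ-sym gYt′∼x)
    b = proj₁ gYt∼gYt′
    b-upper = proj₁ (proj₂ gYt∼gYt′)
    gYtb≈gYt′ = proj₂ (proj₂ (proj₂ gYt∼gYt′))

  ⊗Y-∼ᴮ-swap : ∀ {g x : Mat n} {t} → g ⊗ Y t ∼ᴮ x → ∃[ t′ ] (x ⊗ Y t′ ∼ᴮ g)
  ⊗Y-∼ᴮ-swap {g} {x} {t} gYt∼x =
    φ b-upper b-inv 0# ,
    ∼ᴮ-trans (∼ᴮ-⊗ˡ x (∼ᴮ-trans (Y∼ᴮupper⊗Y b-upper b-inv 0#) (∼ᴮ-⊗ˡ b (Y0∼ᴮY⁻¹ t)))) (≈ᴹ⇒∼ᴮ x⊗b⊗Y⁻¹≈g)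
    where
    x∼gYt : x ∼ᴮ g ⊗ Y t
    x∼gYt = ∼ᴮ-sym gYt∼x
    b = proj₁ x∼gYt
    b-upper = proj₁ (proj₂ x∼gYt)
    b-inv = proj₁ (proj₂ (proj₂ x∼gYt))
    xb≈gYt = proj₂ (proj₂ (proj₂ x∼gYt))
    x⊗b⊗Y⁻¹≈g : x ⊗ (b ⊗ Y⁻¹ t) ≈ᴹ g
    x⊗b⊗Y⁻¹≈g = begin
      x ⊗ (b ⊗ Y⁻¹ t)      ≈⟨ ⊗-assoc x b (Y⁻¹ t) ⟨
      (x ⊗ b) ⊗ Y⁻¹ t      ≈⟨ ⊗-congˡ (Y⁻¹ t) xb≈gYt ⟩
      (g ⊗ Y t) ⊗ Y⁻¹ t    ≈⟨ ⊗-assoc g (Y t) (Y⁻¹ t) ⟩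
      g ⊗ (Y t ⊗ Y⁻¹ t)    ≈⟨ ⊗-congʳ g (Y⊗Y⁻¹ t) ⟩
      g ⊗ I                ≈⟨ ⊗-identityʳ g ⟩
      g                    ∎
      where open ≈ᴹ-Reasoning

  -- Both sides are 0 or 1: the coset of g ⊗ Y t determines t, and g ⊗ Y t ∈ xB for some t iff
  -- x ⊗ Y t′ ∈ gB for some t′.
  ∑-⊗Y-sameCoset-comm : ∀ {g x : Mat n} → IsInvertible g → IsInvertible x →
    ∑ elements (λ t → 𝟙 (sameCoset (g ⊗ Y t) x)) ≡ ∑ elements (λ t → 𝟙 (sameCoset (x ⊗ Y t) g))
  ∑-⊗Y-sameCoset-comm {g} {x} g-inv x-inv = begin
    ∑ elements (λ t → 𝟙 (sameCoset (g ⊗ Y t) x))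
      ≡⟨ ∑-𝟙-atMostOne elements (λ t → sameCoset (g ⊗ Y t) x) unique (at-most-one g-inv) ⟩
    𝟙 (anyᵇ (λ t → sameCoset (g ⊗ Y t) x) elements)
      ≡⟨ cong 𝟙 (⇔-true⇒≡ (swapped g x) (swapped x g)) ⟩
    𝟙 (anyᵇ (λ t → sameCoset (x ⊗ Y t) g) elements)
      ≡⟨ ∑-𝟙-atMostOne elements (λ t → sameCoset (x ⊗ Y t) g) unique (at-most-one x-inv) ⟨
    ∑ elements (λ t → 𝟙 (sameCoset (x ⊗ Y t) g)) ∎
    where
    open ≡-Reasoning
    at-most-one : ∀ {g x} → IsInvertible g → ∀ {t t′} → t ∈ elements → t′ ∈ elements →
                  sameCoset (g ⊗ Y t) x ≡ true → sameCoset (g ⊗ Y t′) x ≡ true → t ≡ t′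
    at-most-one {g} {x} g-inv {t} {t′} _ _ e e′ =
      ⊗Y-∼ᴮ-unique g-inv (sameCoset-sound {g = g ⊗ Y t} {x = x} e) (sameCoset-sound {g = g ⊗ Y t′} {x = x} e′)
    swapped : ∀ g x → anyᵇ (λ t → sameCoset (g ⊗ Y t) x) elements ≡ true →
                      anyᵇ (λ t → sameCoset (x ⊗ Y t) g) elements ≡ true
    swapped g x e = anyᵇ-true⁺ (λ t → sameCoset (x ⊗ Y t) g) (complete (proj₁ swapped-witness))
                               (sameCoset-complete {g = x ⊗ Y (proj₁ swapped-witness)} {x = g} (proj₂ swapped-witness))
      where
      found = anyᵇ-true⁻ (λ t → sameCoset (g ⊗ Y t) x) elements e
      swapped-witness : ∃[ t′ ] (x ⊗ Y t′ ∼ᴮ g)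
      swapped-witness = ⊗Y-∼ᴮ-swap (sameCoset-sound {g = g ⊗ Y (proj₁ found)} {x = x} (proj₂ (proj₂ found)))

  cellSum-∼ᴮ : ∀ (f : Perm → ℤ) {A B : Mat n} → A ∼ᴮ B → cellSum f A ≡ cellSum f B
  cellSum-∼ᴮ f A∼B = ∑-cong (allPerms n) (λ σ → cong (if_then f σ else + 0) (inCell-∼ᴮ {π = σ} A∼B))

  ∑-cosetReps-⊗Y : ∀ {x : Mat n} → IsInvertible x → ∀ π →
    ∑ (cosetReps n) (λ g → if inCell π g then ∑ elements (λ t → 𝟙 (sameCoset (g ⊗ Y t) x)) else + 0) ≡ cellCount x π
  ∑-cosetReps-⊗Y {x} x-inv π = begin
    ∑ (cosetReps n) (λ g → if inCell π g then ∑ elements (λ t → 𝟙 (sameCoset (g ⊗ Y t) x)) else + 0)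
      ≡⟨ ∑-cong-∈ (cosetReps n) (λ {g} g∈ → cong (λ z → if inCell π g then z else + 0)
                                                    (∑-⊗Y-sameCoset-comm (cosetReps-invertible g∈) x-inv)) ⟩
    ∑ (cosetReps n) (λ g → if inCell π g then ∑ elements (λ t → 𝟙 (sameCoset (x ⊗ Y t) g)) else + 0)
      ≡⟨ ∑-cong (cosetReps n) (λ g → push-if (inCell π g) g) ⟩
    ∑ (cosetReps n) (λ g → ∑ elements (λ t → if inCell π g then 𝟙 (sameCoset g (x ⊗ Y t)) else + 0))
      ≡⟨ ∑-comm (cosetReps n) elements (λ g t → if inCell π g then 𝟙 (sameCoset g (x ⊗ Y t)) else + 0) ⟩
    ∑ elements (λ t → ∑ (cosetReps n) (λ g → if inCell π g then 𝟙 (sameCoset g (x ⊗ Y t)) else + 0))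
      ≡⟨ ∑-cong elements (λ t → cosetReps-cell (Invertible-⊗ x-inv (Invertible-Y t)) π) ⟩
    cellCount x π ∎
    where
    open ≡-Reasoning
    push-if : ∀ b g → (if b then ∑ elements (λ t → 𝟙 (sameCoset (x ⊗ Y t) g)) else + 0)
                      ≡ ∑ elements (λ t → if b then 𝟙 (sameCoset g (x ⊗ Y t)) else + 0)
    push-if true  g = ∑-cong elements (λ t → cong 𝟙 (sameCoset-comm (x ⊗ Y t) g))
    push-if false g = sym (∑-zero elements (λ _ → + 0) (λ _ → refl))

module Intertwining {q : ℕ} (F : FiniteField q) {m : ℕ} (i : Fin m) where

  open Matrices F
  open BruhatCells F
  open Decidability F
  open SimpleReflection F i
  open CellCounts F i
  open Coefficients F
  open HeckeAction F i

  private
    n = suc m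

    ∑-singleton : ∀ {A : Set} (G : A → ℤ) x → ∑ ((+ 1 , x) ∷ []) (λ (a , y) → a *ᶻ G y) ≡ G x
    ∑-singleton G x = trans (ℤP.+-identityʳ _) (ℤP.*-identityˡ (G x))

  proj-TG≡cellSums : ∀ (h : Mat n) π →
    coeffS (proj (TG i ((+ 1 , h) ∷ []))) π ≡ ∑ elements (λ t → cellSum (λ σ → 𝟙 (eqPerm σ π)) (h ⊗ Y t))
  proj-TG≡cellSums h π = begin
    coeffS (proj (TG i L)) π
      ≡⟨ coeffS≡∑ (proj (TG i L)) π ⟩
    ∑ (proj (TG i L)) (λ (a , σ) → a *ᶻ f σ)
      ≡⟨ ∑-proj f (TG i L) ⟩
    ∑ (TG i L) (λ (a , g) → a *ᶻ cellSum f g)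
      ≡⟨ ∑-TG (cellSum f) (cellSum-∼ᴮ f) L ⟩
    ∑ L (λ (a , g) → a *ᶻ ∑ elements (λ t → cellSum f (g ⊗ Y t)))
      ≡⟨ ∑-singleton (λ g → ∑ elements (λ t → cellSum f (g ⊗ Y t))) h ⟩
    ∑ elements (λ t → cellSum f (h ⊗ Y t)) ∎
    where
    open ≡-Reasoning
    L = (+ 1 , h) ∷ []
    f = λ σ → 𝟙 (eqPerm σ π)

  TS-proj≡cellSum : ∀ (h : Mat n) π → coeffS (TS i (proj ((+ 1 , h) ∷ []))) π ≡ cellSum (λ σ → Tcoeff σ π) h
  TS-proj≡cellSum h π = begin
    coeffS (TS i (proj L)) π                          ≡⟨ coeffS≡∑ (TS i (proj L)) π ⟩
    ∑ (TS i (proj L)) (λ (a , σ) → a *ᶻ f σ)          ≡⟨ ∑-TS f (proj L) ⟩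
    ∑ (proj L) (λ (a , σ) → a *ᶻ Tᵢ f σ)              ≡⟨ ∑-proj (Tᵢ f) L ⟩
    ∑ L (λ (a , g) → a *ᶻ cellSum (Tᵢ f) g)           ≡⟨ ∑-singleton (cellSum (Tᵢ f)) h ⟩
    cellSum (λ σ → Tcoeff σ π) h                      ∎
    where
    open ≡-Reasoning
    L = (+ 1 , h) ∷ []
    f = λ σ → 𝟙 (eqPerm σ π)

  proj-commutes : ∀ (h : Mat n) → proj (TG i ((+ 1 , h) ∷ [])) ≈S TS i (proj ((+ 1 , h) ∷ []))
  proj-commutes h π with Cell-dec h
  ... | inj₁ (σ , σ-inj , σ-cell) = begin
    coeffS (proj (TG i ((+ 1 , h) ∷ []))) π
      ≡⟨ proj-TG≡cellSums h π ⟩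
    ∑ elements (λ t → cellSum f (h ⊗ Y t))
      ≡⟨ ∑-cong elements cellSum-at ⟩
    cellCount h π
      ≡⟨ cellCount-Cell σ-cell σ-inj π ⟩
    Tcoeff σ π
      ≡⟨ cellSum-Cell (λ σ → Tcoeff σ π) (Tcoeff-cong π) σ-inj σ-cell ⟨
    cellSum (λ σ → Tcoeff σ π) h
      ≡⟨ TS-proj≡cellSum h π ⟨
    coeffS (TS i (proj ((+ 1 , h) ∷ []))) π ∎
    where
    open ≡-Reasoning
    f = λ σ → 𝟙 (eqPerm σ π)
    cellSum-at : ∀ t → cellSum f (h ⊗ Y t) ≡ 𝟙 (inCell π (h ⊗ Y t))
    cellSum-at t = trans (cellSum-Cell f (λ e → cong 𝟙 (eqPerm-cong e (λ _ → refl)))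
                                         (proj₁ (proj₂ τ)) (proj₂ (proj₂ τ)))
                         (cong 𝟙 (sym (inCell-exact (proj₁ (proj₂ τ)) (proj₂ (proj₂ τ)) π)))
      where τ = Cell-⊗Y σ-cell σ-inj t
  ... | inj₂ none = begin
    coeffS (proj (TG i ((+ 1 , h) ∷ []))) π
      ≡⟨ proj-TG≡cellSums h π ⟩
    ∑ elements (λ t → cellSum f (h ⊗ Y t))
      ≡⟨ ∑-zero elements (λ t → cellSum f (h ⊗ Y t))
          (λ {t} _ → cellSum-noCell f (λ σ σ-inj → noCell-⊗Y none t σ-inj)) ⟩
    + 0
      ≡⟨ cellSum-noCell (λ σ → Tcoeff σ π) none ⟨
    cellSum (λ σ → Tcoeff σ π) h
      ≡⟨ TS-proj≡cellSum h π ⟨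
    coeffS (TS i (proj ((+ 1 , h) ∷ []))) π ∎
    where
    open ≡-Reasoning
    f = λ σ → 𝟙 (eqPerm σ π)

  private
    Q : ℤ
    Q = + q

    weight : Mat n → Perm → ℤ
    weight x ρ = Q ℤ.^ inv ρ *ᶻ 𝟙 (inCell ρ x)

  incl-TS≡Tᵢ : ∀ π {x : Mat n} → IsInvertible x → coeffG (incl (TS i ((+ 1 , π) ∷ []))) x ≡ Tᵢ (weight x) π
  incl-TS≡Tᵢ π {x} x-inv = begin
    coeffG (incl (TS i L)) x                      ≡⟨ coeffG-incl (TS i L) x-inv ⟩
    ∑ (TS i L) (λ (a , ρ) → a *ᶻ weight x ρ)      ≡⟨ ∑-TS (weight x) L ⟩
    ∑ L (λ (a , σ) → a *ᶻ Tᵢ (weight x) σ)        ≡⟨ ∑-singleton (Tᵢ (weight x)) π ⟩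
    Tᵢ (weight x) π                               ∎
    where
    open ≡-Reasoning
    L = (+ 1 , π) ∷ []

  TG-incl≡cellCount : ∀ π {x : Mat n} → IsInvertible x →
                      coeffG (TG i (incl ((+ 1 , π) ∷ []))) x ≡ Q ℤ.^ inv π *ᶻ cellCount x π
  TG-incl≡cellCount π {x} x-inv = begin
    coeffG (TG i (incl L)) x
      ≡⟨ coeffG≡∑ (TG i (incl L)) x ⟩
    ∑ (TG i (incl L)) (λ (a , g) → a *ᶻ 𝟙 (sameCoset g x))
      ≡⟨ ∑-TG (λ g → 𝟙 (sameCoset g x)) sameCoset-resp (incl L) ⟩
    ∑ (incl L) (λ (a , g) → a *ᶻ E g)
      ≡⟨ ∑-incl E L ⟩
    ∑ L (λ (a , ρ) → (a *ᶻ Q ℤ.^ inv ρ) *ᶻ ∑ (cosetReps n) (λ g → if inCell ρ g then E g else + 0))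
      ≡⟨ ℤP.+-identityʳ _ ⟩
    (+ 1 *ᶻ Q ℤ.^ inv π) *ᶻ ∑ (cosetReps n) (λ g → if inCell π g then E g else + 0)
      ≡⟨ cong₂ _*ᶻ_ (ℤP.*-identityˡ (Q ℤ.^ inv π)) (∑-cosetReps-⊗Y x-inv π) ⟩
    Q ℤ.^ inv π *ᶻ cellCount x π ∎
    where
    open ≡-Reasoning
    L = (+ 1 , π) ∷ []
    E : Mat n → ℤ
    E g = ∑ elements (λ t → 𝟙 (sameCoset (g ⊗ Y t) x))
    sameCoset-resp : ∀ {A B} → A ∼ᴮ B → 𝟙 (sameCoset A x) ≡ 𝟙 (sameCoset B x)
    sameCoset-resp A∼B = cong 𝟙 (sameCoset-≡ (∼ᴮ-trans (∼ᴮ-sym A∼B)) (∼ᴮ-trans A∼B))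

  weight-Cell : ∀ {x : Mat n} {σ} → Injective _≡_ _≡_ σ → Cell σ x → ∀ ρ → weight x ρ ≡ 𝟙 (eqPerm ρ σ) *ᶻ Q ℤ.^ inv σ
  weight-Cell {x} {σ} σ-inj σ-cell ρ =
    trans (cong (λ b → Q ℤ.^ inv ρ *ᶻ 𝟙 b) (trans (inCell-exact σ-inj σ-cell ρ) (eqPerm-comm σ ρ)))
          (by-cases (eqPerm ρ σ) refl)
    where
    by-cases : ∀ b → eqPerm ρ σ ≡ b → Q ℤ.^ inv ρ *ᶻ 𝟙 b ≡ 𝟙 b *ᶻ Q ℤ.^ inv σ
    by-cases true  ρ=σ = trans (ℤP.*-comm (Q ℤ.^ inv ρ) (+ 1))
                               (cong (λ k → + 1 *ᶻ Q ℤ.^ k) (inv-cong (eqPerm-sound {σ = ρ} {π = σ} ρ=σ)))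
    by-cases false _   = trans (ℤP.*-zeroʳ (Q ℤ.^ inv ρ)) (sym (ℤP.*-zeroˡ (Q ℤ.^ inv σ)))

  weight-noCell : ∀ {x : Mat n} → (∀ σ → Injective _≡_ _≡_ σ → ¬ Cell σ x) →
                  ∀ {ρ} → Injective _≡_ _≡_ ρ → weight x ρ ≡ + 0
  weight-noCell none {ρ} ρ-inj = trans (cong (λ b → Q ℤ.^ inv ρ *ᶻ 𝟙 b) (≢true⇒≡false (none ρ ρ-inj ∘ inCell-sound)))
                                       (ℤP.*-zeroʳ (Q ℤ.^ inv ρ))

  incl-commutes : ∀ π → Injective _≡_ _≡_ π → incl (TS i ((+ 1 , π) ∷ [])) ≈G TG i (incl ((+ 1 , π) ∷ []))
  incl-commutes π π-inj x x-inv with Cell-dec x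
  ... | inj₁ (σ , σ-inj , σ-cell) = begin
    coeffG (incl (TS i ((+ 1 , π) ∷ []))) x
      ≡⟨ incl-TS≡Tᵢ π x-inv ⟩
    Tᵢ (weight x) π
      ≡⟨ Tᵢ-cong π (weight-Cell σ-inj σ-cell) ⟩
    Tᵢ (λ ρ → 𝟙 (eqPerm ρ σ) *ᶻ Q ℤ.^ inv σ) π
      ≡⟨ Tᵢ-*ʳ (λ ρ → 𝟙 (eqPerm ρ σ)) (Q ℤ.^ inv σ) π ⟩
    Tcoeff π σ *ᶻ Q ℤ.^ inv σ
      ≡⟨ Tcoeff-symmetric σ π-inj ⟩
    Q ℤ.^ inv π *ᶻ Tcoeff σ π
      ≡⟨ cong (Q ℤ.^ inv π *ᶻ_) (cellCount-Cell σ-cell σ-inj π) ⟨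
    Q ℤ.^ inv π *ᶻ cellCount x π
      ≡⟨ TG-incl≡cellCount π x-inv ⟨
    coeffG (TG i (incl ((+ 1 , π) ∷ []))) x ∎
    where open ≡-Reasoning
  ... | inj₂ none = begin
    coeffG (incl (TS i ((+ 1 , π) ∷ []))) x
      ≡⟨ incl-TS≡Tᵢ π x-inv ⟩
    Tᵢ (weight x) π
      ≡⟨ Tᵢ-zero (weight x) π (weight-noCell none (∘swap-injective i π-inj)) (weight-noCell none π-inj) ⟩
    + 0
      ≡⟨ ℤP.*-zeroʳ (Q ℤ.^ inv π) ⟨
    Q ℤ.^ inv π *ᶻ + 0
      ≡⟨ cong (Q ℤ.^ inv π *ᶻ_) (cellCount-noCell none π-inj) ⟨
    Q ℤ.^ inv π *ᶻ cellCount x π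
      ≡⟨ TG-incl≡cellCount π x-inv ⟨
    coeffG (TG i (incl ((+ 1 , π) ∷ []))) x ∎
    where open ≡-Reasoning

corollary3p6 : (q : ℕ) → IsPrimePower q → (F : FiniteField q) →
    (m : ℕ) (i : Fin m) →
    ((h : GLn.Mat F (suc m)) → GLn.IsInvertible F h →
      GLn._≈S_ F (GLn.proj F (GLn.TG F i ((+ 1 , h) ∷ [])))
                 (GLn.TS F i (GLn.proj F ((+ 1 , h) ∷ []))))
    ×
    ((π : Fin (suc m) → Fin (suc m)) → Injective _≡_ _≡_ π →
      GLn._≈G_ F (GLn.incl F (GLn.TS F i ((+ 1 , π) ∷ [])))
                 (GLn.TG F i (GLn.incl F ((+ 1 , π) ∷ []))))
corollary3p6 q _ F m i = (λ h _ → Intertwining.proj-commutes F i h) , Intertwining.incl-commutes F i
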